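{- Let $T_S(u)=T_S(u,x,y,q)$ be the generating series of shifted stacks, where $u$ marks the width of the top row, $x$ the width, $y$ the height and $q$ the area, and let $P_1(u,x,y,q)=uxyq+y\sum_{k\ge 2}(uxq)^k(-yq;q)_{k-2}$. Define $$E(u)=\sum_{n\ge0}\frac{(-1)^nx^{n}y^nu^{2n}q^{n^2+n}P_1(uq^n,x,y,q)}{(uq;q)_n},\qquad F(u)=\sum_{n\ge0}\frac{(-1)^nx^{n+1}y^{n+1}u^{2n+2}q^{n^2+3n+2}}{(uq;q)_{n+1}}.$$ Then $$T_S(u)=\frac{E(u)+E(1)F(u)-E(u)F(1)}{1-F(1)}.$$
   Context: $(a;q)_n=(1-a)(1-aq)\cdots(1-aq^{n-1})$. A shifted stack is a polyomino (up to translation) consisting of $n\ge1$ rows at consecutive heights $1,\dots,n$ (bottom to top), row $i$ occupying columns $a_i,\dots,b_i$ with $a_i\le b_i$, such that $a_{i+1}=a_i-1$, $b_{i+1}\ge a_i$, and there is $s$ with $b_1\le\cdots\le b_s\ge b_{s+1}\ge\cdots\ge b_n$. Its width is the number of columns it meets, its height is $n$, its area is its number of cells and its top row width is $b_n-a_n+1$. -}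

module Defs where

open import Data.Nat as ℕ using (ℕ; zero; suc; _≡ᵇ_)
open import Data.Integer as ℤ using (ℤ; +_; -[1+_]; _⊔_; _⊓_)
open import Data.Bool using (if_then_else_; _∧_)
open import Data.Product using (Σ; _×_; _,_; proj₁; proj₂)
open import Data.List using (List; []; _∷_; length; take; drop; foldr; map)
open import Data.List.Relation.Unary.Linked using (Linked)
open import Relation.Binary.PropositionalEquality using (_≡_)

-- Formal power series in four variables u, x, y, q with ℤ coefficients.
-- A series f is its coefficient function: f d a b c is the coefficient
-- of u^d x^a y^b q^c.

PS : Set
PS = ℕ → ℕ → ℕ → ℕ → ℤ

sumTo : ℕ → (ℕ → ℤ) → ℤ
sumTo zero    f = f 0
sumTo (suc n) f = sumTo n f ℤ.+ f (suc n)

infixl 6 _⊕_ _⊖_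
infixl 7 _⊗_

_⊕_ : PS → PS → PS
(f ⊕ g) d a b c = f d a b c ℤ.+ g d a b c

⊝_ : PS → PS
(⊝ f) d a b c = ℤ.- f d a b c

_⊖_ : PS → PS → PS
f ⊖ g = f ⊕ (⊝ g)

_⊗_ : PS → PS → PS
(f ⊗ g) d a b c =
  sumTo d λ d₁ → sumTo a λ a₁ → sumTo b λ b₁ → sumTo c λ c₁ →
    f d₁ a₁ b₁ c₁ ℤ.* g (d ℕ.∸ d₁) (a ℕ.∸ a₁) (b ℕ.∸ b₁) (c ℕ.∸ c₁)

mono : ℕ → ℕ → ℕ → ℕ → PS
mono i j k l d a b c =
  if (d ≡ᵇ i) ∧ (a ≡ᵇ j) ∧ (b ≡ᵇ k) ∧ (c ≡ᵇ l) then + 1 else + 0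

one zeroPS U X Y Q minusOne : PS
one = mono 0 0 0 0
zeroPS _ _ _ _ = + 0
U = mono 1 0 0 0
X = mono 0 1 0 0
Y = mono 0 0 1 0
Q = mono 0 0 0 1
minusOne = ⊝ one

infixr 8 _^^_
_^^_ : PS → ℕ → PS
f ^^ zero  = one
f ^^ suc n = f ⊗ (f ^^ n)

prodBelow : ℕ → (ℕ → PS) → PS
prodBelow zero    F = one
prodBelow (suc n) F = prodBelow n F ⊗ F n

-- Sum Σ_{n ≥ 0} f n of a family where every monomial of f n has total
-- degree ≥ n (true for every family used below).  Then the coefficient of a
-- monomial of total degree D only receives contributions from n ≤ D.
infSum : (ℕ → PS) → PS
infSum f d a b c = sumTo (d ℕ.+ a ℕ.+ b ℕ.+ c) λ n → f n d a b c

-- 1/(1 - W) = Σ_j W^j, for W without constant term.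
inv1m : PS → PS
inv1m W = infSum (λ j → W ^^ j)

qPoch : PS → ℕ → PS
qPoch A n = prodBelow n λ i → one ⊖ A ⊗ (Q ^^ i)

-- 1/(A;q)_n = ∏_{i<n} 1/(1 - A q^i)   (A without constant term)
qPochInv : PS → ℕ → PS
qPochInv A n = prodBelow n λ i → inv1m (A ⊗ (Q ^^ i))

P₁ : PS → PS
P₁ V = V ⊗ X ⊗ Y ⊗ Q
     ⊕ Y ⊗ infSum (λ j → ((V ⊗ X ⊗ Q) ^^ (j ℕ.+ 2)) ⊗ qPoch (⊝ (Y ⊗ Q)) j)

E : PS → PS
E V = infSum λ n →
  (minusOne ^^ n) ⊗ (X ^^ n) ⊗ (Y ^^ n) ⊗ (V ^^ (2 ℕ.* n))
    ⊗ (Q ^^ (n ℕ.* n ℕ.+ n)) ⊗ P₁ (V ⊗ (Q ^^ n)) ⊗ qPochInv (V ⊗ Q) n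

F : PS → PS
F V = infSum λ n →
  (minusOne ^^ n) ⊗ (X ^^ suc n) ⊗ (Y ^^ suc n) ⊗ (V ^^ (2 ℕ.* n ℕ.+ 2))
    ⊗ (Q ^^ (n ℕ.* n ℕ.+ 3 ℕ.* n ℕ.+ 2)) ⊗ qPochInv (V ⊗ Q) (suc n)

RHS : PS
RHS = (E U ⊕ E one ⊗ F U ⊖ E U ⊗ F one) ⊗ inv1m (F one)

-- A polyomino with rows at heights 1..n is given by the
-- list of rows (a_i , b_i) (bottom to top); row i occupies columns a_i..b_i.
-- Translation classes are represented by the unique representative with
-- a_1 = 0.

Row : Set
Row = ℤ × ℤ

left right : Row → ℤ
left  = proj₁
right = proj₂

rowWidth : Row → ℤ
rowWidth r = right r ℤ.- left r ℤ.+ + 1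

IsShiftedStack : List Row → Set
IsShiftedStack l =
  Σ ℤ (λ b₁ → Σ (List Row) λ rest → l ≡ (+ 0 , b₁) ∷ rest)
  × Data.List.Relation.Unary.All.All (λ r → left r ℤ.≤ right r) l
  × Linked (λ r r′ → (left r′ ≡ left r ℤ.- + 1) × (left r ℤ.≤ right r′)) l
  × Σ ℕ (λ s → (1 ℕ.≤ s) × (s ℕ.≤ length l)
       × Linked (λ r r′ → right r ℤ.≤ right r′) (take s l)
       × Linked (λ r r′ → right r′ ℤ.≤ right r) (drop (s ℕ.∸ 1) l))
  where import Data.List.Relation.Unary.All

area : List Row → ℤ
area = foldr (λ r acc → rowWidth r ℤ.+ acc) (+ 0)

-- number of columns met: the rows pairwise-consecutively overlap, so the
-- columns met form the interval [min a_i , max b_i].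
width : List Row → ℤ
width []       = + 0
width (r ∷ rs) = foldr _⊔_ (right r) (map right rs)
               ℤ.- foldr _⊓_ (left r) (map left rs) ℤ.+ + 1

height : List Row → ℕ
height = length

topRowWidth : List Row → ℤ
topRowWidth []           = + 0
topRowWidth (r ∷ [])     = rowWidth r
topRowWidth (r ∷ r′ ∷ rs) = topRowWidth (r′ ∷ rs)

ShiftedStackWith : ℕ → ℕ → ℕ → ℕ → List Row → Set
ShiftedStackWith d a b c l =
  IsShiftedStack l × (topRowWidth l ≡ + d) × (width l ≡ + a)
  × (height l ≡ b) × (area l ≡ + c)

{-# OPTIONS --safe #-}
module Submission where

-- Let t_m(x,y,q) count the shifted stacks whose top row has width m, so that T_S(u) = Σ_m t_m u^m.
-- Removing the top row of width m ≥ 2 leaves either an increasing stack with top row width ≤ m - 2,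
-- whose rows have distinct widths (counted by (-yq;q)_{m-2}), or a stack with top row width ≥ m - 1,
-- one column narrower.  Hence t_m = y (xq)^m (-yq;q)_{m-2} + x y q^m Σ_{m' ≥ m-1} t_{m'}, which sums
-- to the functional equation T(u) = P_1(u) + x y (uq)^2/(1 - uq) · (T(1) - T(uq)).  Iterating it
-- n times gives T(u) = E(u) + F(u) T(1) up to terms of total degree ≥ n, hence exactly; at u = 1
-- this gives T(1) = E(1)/(1 - F(1)), and substituting back yields the formula.
-- The same top-row decomposition defines a duplicate-free list of the stacks with given statistics
-- whose length obeys the recursion of t_m.

open import Defs
open import Data.Nat using (ℕ)
open import Data.Integer using (ℤ; +_)
open import Data.Product using (Σ; _×_)
open import Data.List using (List; length)
open import Data.List.Relation.Unary.Unique.Propositional using (Unique)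
open import Data.List.Membership.Propositional using (_∈_)
open import Function.Bundles using (_⇔_)
open import Relation.Binary.PropositionalEquality using (_≡_)

module ExponentIdentities where
  open import Data.Nat
  open import Relation.Binary.PropositionalEquality
  open import Data.Nat.Solver using (module +-*-Solver)
  open +-*-Solver

  +-interchange₄ : ∀ x y z w x₁ y₁ z₁ w₁ → (x + y + z + w) + (x₁ + y₁ + z₁ + w₁) ≡ (x + x₁) + (y + y₁) + (z + z₁) + (w + w₁)
  +-interchange₄ = solve 8 (λ x y z w x₁ y₁ z₁ w₁ → (x :+ y :+ z :+ w) :+ (x₁ :+ y₁ :+ z₁ :+ w₁) := (x :+ x₁) :+ (y :+ y₁) :+ (z :+ z₁) :+ (w :+ w₁)) refl

  2*[1+n]≡2*n+2 : ∀ N → 2 * suc N ≡ 2 * N + 2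
  2*[1+n]≡2*n+2 = solve 1 (λ N → con 2 :* (con 1 :+ N) := con 2 :* N :+ con 2) refl

  [1+n]²+[1+n]≡[n²+n]+[n+[n+2]] : ∀ N → suc N * suc N + suc N ≡ (N * N + N) + (N + (N + 2))
  [1+n]²+[1+n]≡[n²+n]+[n+[n+2]] = solve 1 (λ N → (con 1 :+ N) :* (con 1 :+ N) :+ (con 1 :+ N) := (N :* N :+ N) :+ (N :+ (N :+ con 2))) refl

  n²+3n+2≡[1+n]²+[1+n] : ∀ N → N * N + 3 * N + 2 ≡ suc N * suc N + suc N
  n²+3n+2≡[1+n]²+[1+n] = solve 1 (λ N → N :* N :+ con 3 :* N :+ con 2 := (con 1 :+ N) :* (con 1 :+ N) :+ (con 1 :+ N)) refl


module Convolution where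

  open import Algebra.Bundles using (CommutativeRing)
  open import Data.Nat as ℕ using (ℕ; zero; suc; _∸_; _≤_; z≤n; s≤s)
  import Data.Nat.Properties as ℕP
  open import Relation.Binary.PropositionalEquality as P using (_≡_)
  open import Level using (_⊔_)
  open import Data.Sum using (_⊎_; inj₁; inj₂)
  open import Data.Integer as ℤ using (ℤ; +_)

  module Sums {c ℓ} (R : CommutativeRing c ℓ) where
    open CommutativeRing R
    open import Relation.Binary.Reasoning.Setoid setoid

    Σ≤ : ℕ → (ℕ → Carrier) → Carrier
    Σ≤ zero f = f 0
    Σ≤ (suc n) f = Σ≤ n f + f (suc n)

    Σ-cong≤ : ∀ n {f g : ℕ → Carrier} → (∀ i → i ≤ n → f i ≈ g i) → Σ≤ n f ≈ Σ≤ n g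
    Σ-cong≤ zero h = h 0 z≤n
    Σ-cong≤ (suc n) h = +-cong (Σ-cong≤ n (λ i i≤n → h i (ℕP.m≤n⇒m≤1+n i≤n))) (h (suc n) ℕP.≤-refl)

    Σ-cong : ∀ n {f g : ℕ → Carrier} → (∀ i → f i ≈ g i) → Σ≤ n f ≈ Σ≤ n g
    Σ-cong n h = Σ-cong≤ n (λ i _ → h i)

    Σ-+ : ∀ n (f g : ℕ → Carrier) → Σ≤ n (λ i → f i + g i) ≈ Σ≤ n f + Σ≤ n g
    Σ-+ zero f g = refl
    Σ-+ (suc n) f g = begin
      Σ≤ n (λ i → f i + g i) + (f (suc n) + g (suc n))
        ≈⟨ +-congʳ (Σ-+ n f g) ⟩
      (Σ≤ n f + Σ≤ n g) + (f (suc n) + g (suc n))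
        ≈⟨ +-assoc _ _ _ ⟩
      Σ≤ n f + (Σ≤ n g + (f (suc n) + g (suc n)))
        ≈⟨ +-congˡ (sym (+-assoc _ _ _)) ⟩
      Σ≤ n f + ((Σ≤ n g + f (suc n)) + g (suc n))
        ≈⟨ +-congˡ (+-congʳ (+-comm _ _)) ⟩
      Σ≤ n f + ((f (suc n) + Σ≤ n g) + g (suc n))
        ≈⟨ +-congˡ (+-assoc _ _ _) ⟩
      Σ≤ n f + (f (suc n) + (Σ≤ n g + g (suc n)))
        ≈⟨ sym (+-assoc _ _ _) ⟩
      (Σ≤ n f + f (suc n)) + (Σ≤ n g + g (suc n)) ∎

    Σ-*ˡ : ∀ n x (f : ℕ → Carrier) → x * Σ≤ n f ≈ Σ≤ n (λ i → x * f i)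
    Σ-*ˡ zero x f = refl
    Σ-*ˡ (suc n) x f = trans (distribˡ x _ _) (+-congʳ (Σ-*ˡ n x f))

    Σ-*ʳ : ∀ n x (f : ℕ → Carrier) → Σ≤ n f * x ≈ Σ≤ n (λ i → f i * x)
    Σ-*ʳ zero x f = refl
    Σ-*ʳ (suc n) x f = trans (distribʳ x _ _) (+-congʳ (Σ-*ʳ n x f))

    Σ-0 : ∀ n (f : ℕ → Carrier) → (∀ i → i ≤ n → f i ≈ 0#) → Σ≤ n f ≈ 0#
    Σ-0 zero f h = h 0 z≤n
    Σ-0 (suc n) f h = trans (+-cong (Σ-0 n f (λ i i≤n → h i (ℕP.m≤n⇒m≤1+n i≤n))) (h (suc n) ℕP.≤-refl)) (+-identityˡ 0#)

    Σ-peel : ∀ n (g : ℕ → Carrier) → Σ≤ (suc n) g ≈ g 0 + Σ≤ n (λ i → g (suc i))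
    Σ-peel zero g = refl
    Σ-peel (suc n) g = trans (+-congʳ (Σ-peel n g)) (+-assoc _ _ _)

    Σ-single0 : ∀ n (f : ℕ → Carrier) → (∀ i → f (suc i) ≈ 0#) → Σ≤ n f ≈ f 0
    Σ-single0 zero f h = refl
    Σ-single0 (suc n) f h = trans (Σ-peel n f) (trans (+-congˡ (Σ-0 n _ (λ i _ → h i))) (+-identityʳ _))

    Σ-rev : ∀ n (f : ℕ → Carrier) → Σ≤ n f ≈ Σ≤ n (λ i → f (n ∸ i))
    Σ-rev zero f = refl
    Σ-rev (suc n) f = begin
      Σ≤ n f + f (suc n)
        ≈⟨ +-comm _ _ ⟩
      f (suc n) + Σ≤ n f
        ≈⟨ +-congˡ (Σ-rev n f) ⟩
      f (suc n) + Σ≤ n (λ i → f (n ∸ i))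
        ≈⟨ sym (Σ-peel n (λ i → f (suc n ∸ i))) ⟩
      Σ≤ (suc n) (λ i → f (suc n ∸ i)) ∎

    Σ-tri : ∀ n (F : ℕ → ℕ → Carrier) →
      Σ≤ n (λ i → Σ≤ i (λ j → F i j)) ≈ Σ≤ n (λ j → Σ≤ (n ∸ j) (λ k → F (j ℕ.+ k) j))
    Σ-tri zero F = refl
    Σ-tri (suc n) F = begin
      Σ≤ n (λ i → Σ≤ i (λ j → F i j)) + Σ≤ (suc n) (λ j → F (suc n) j)
        ≈⟨ +-congʳ (Σ-tri n F) ⟩
      Σ≤ n (λ j → Σ≤ (n ∸ j) (λ k → F (j ℕ.+ k) j)) + (Σ≤ n (λ j → F (suc n) j) + F (suc n) (suc n))
        ≈⟨ sym (+-assoc _ _ _) ⟩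
      (Σ≤ n (λ j → Σ≤ (n ∸ j) (λ k → F (j ℕ.+ k) j)) + Σ≤ n (λ j → F (suc n) j)) + F (suc n) (suc n)
        ≈⟨ +-cong (sym (Σ-+ n _ _)) (reflexive (P.cong (λ z → F z (suc n)) (P.sym (ℕP.+-identityʳ (suc n))))) ⟩
      Σ≤ n (λ j → Σ≤ (n ∸ j) (λ k → F (j ℕ.+ k) j) + F (suc n) j) + F (suc n ℕ.+ 0) (suc n)
        ≈⟨ +-congʳ (Σ-cong≤ n (λ j j≤n → sym (step j j≤n))) ⟩
      Σ≤ n (λ j → Σ≤ (suc n ∸ j) (λ k → F (j ℕ.+ k) j)) + F (suc n ℕ.+ 0) (suc n)
        ≈⟨ +-congˡ (reflexive (P.cong (λ z → Σ≤ z (λ k → F (suc n ℕ.+ k) (suc n))) (P.sym (ℕP.n∸n≡0 n)))) ⟩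
      Σ≤ (suc n) (λ j → Σ≤ (suc n ∸ j) (λ k → F (j ℕ.+ k) j)) ∎
      where
      step : ∀ j → j ≤ n → Σ≤ (suc n ∸ j) (λ k → F (j ℕ.+ k) j) ≈ Σ≤ (n ∸ j) (λ k → F (j ℕ.+ k) j) + F (suc n) j
      step j j≤n rewrite ℕP.+-∸-assoc 1 j≤n =
        +-congˡ (reflexive (P.cong (λ z → F z j) (P.trans (ℕP.+-suc j (n ∸ j)) (P.cong suc (ℕP.m+[n∸m]≡n j≤n)))))

  module PowerSeries {c ℓ} (R : CommutativeRing c ℓ) where
    open CommutativeRing R
    open Sums R
    open import Relation.Binary.Reasoning.Setoid setoid
    open import Algebra.Structures using (IsCommutativeRing)

    Seq : Set c
    Seq = ℕ → Carrier

    _≈'_ : Seq → Seq → Set ℓ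
    f ≈' g = ∀ n → f n ≈ g n

    _+'_ _*'_ : Seq → Seq → Seq
    (f +' g) n = f n + g n
    (f *' g) n = Σ≤ n (λ i → f i * g (n ∸ i))

    -'_ : Seq → Seq
    (-' f) n = - f n

    0' 1' : Seq
    0' n = 0#
    1' zero = 1#
    1' (suc n) = 0#

    *'-cong : ∀ {f f' g g'} → f ≈' f' → g ≈' g' → (f *' g) ≈' (f' *' g')
    *'-cong p q n = Σ-cong n (λ i → *-cong (p i) (q (n ∸ i)))

    *'-comm : ∀ f g → (f *' g) ≈' (g *' f)
    *'-comm f g n = begin
      Σ≤ n (λ i → f i * g (n ∸ i))
        ≈⟨ Σ-rev n _ ⟩
      Σ≤ n (λ i → f (n ∸ i) * g (n ∸ (n ∸ i)))
        ≈⟨ Σ-cong≤ n (λ i i≤n → trans (*-comm _ _) (*-congʳ (reflexive (P.cong g (ℕP.m∸[m∸n]≡n i≤n))))) ⟩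
      Σ≤ n (λ i → g i * f (n ∸ i)) ∎

    *'-assoc : ∀ f g h → ((f *' g) *' h) ≈' (f *' (g *' h))
    *'-assoc f g h n = begin
      Σ≤ n (λ i → Σ≤ i (λ j → f j * g (i ∸ j)) * h (n ∸ i))
        ≈⟨ Σ-cong n (λ i → Σ-*ʳ i _ _) ⟩
      Σ≤ n (λ i → Σ≤ i (λ j → f j * g (i ∸ j) * h (n ∸ i)))
        ≈⟨ Σ-tri n _ ⟩
      Σ≤ n (λ j → Σ≤ (n ∸ j) (λ k → f j * g (j ℕ.+ k ∸ j) * h (n ∸ (j ℕ.+ k))))
        ≈⟨ Σ-cong n (λ j → Σ-cong (n ∸ j) (λ k → trans (*-assoc _ _ _)
             (*-congˡ (*-cong (reflexive (P.cong g (ℕP.m+n∸m≡n j k)))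
                              (reflexive (P.cong h (P.sym (ℕP.∸-+-assoc n j k)))))))) ⟩
      Σ≤ n (λ j → Σ≤ (n ∸ j) (λ k → f j * (g k * h (n ∸ j ∸ k))))
        ≈⟨ Σ-cong n (λ j → sym (Σ-*ˡ (n ∸ j) _ _)) ⟩
      Σ≤ n (λ j → f j * Σ≤ (n ∸ j) (λ k → g k * h (n ∸ j ∸ k))) ∎

    *'-distribˡ : ∀ f g h → (f *' (g +' h)) ≈' ((f *' g) +' (f *' h))
    *'-distribˡ f g h n = trans (Σ-cong n (λ i → distribˡ _ _ _)) (Σ-+ n _ _)

    *'-distribʳ : ∀ f g h → ((g +' h) *' f) ≈' ((g *' f) +' (h *' f))
    *'-distribʳ f g h n = trans (Σ-cong n (λ i → distribʳ _ _ _)) (Σ-+ n _ _)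

    *'-identityˡ : ∀ f → (1' *' f) ≈' f
    *'-identityˡ f n = trans (Σ-single0 n _ (λ i → zeroˡ _)) (*-identityˡ _)

    *'-identityʳ : ∀ f → (f *' 1') ≈' f
    *'-identityʳ f n = trans (*'-comm f 1' n) (*'-identityˡ f n)

    powerSeries-isCommutativeRing : IsCommutativeRing _≈'_ _+'_ _*'_ -'_ 0' 1'
    powerSeries-isCommutativeRing = record
      { isRing = record
        { +-isAbelianGroup = record
          { isGroup = record
            { isMonoid = record
              { isSemigroup = record
                { isMagma = record
                  { isEquivalence = record
                    { refl = λ n → refl ; sym = λ p n → sym (p n) ; trans = λ p q n → trans (p n) (q n) }
                  ; ∙-cong = λ p q n → +-cong (p n) (q n) }
                ; assoc = λ f g h n → +-assoc _ _ _ }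
              ; identity = (λ f n → +-identityˡ _) , (λ f n → +-identityʳ _) }
            ; inverse = (λ f n → -‿inverseˡ _) , (λ f n → -‿inverseʳ _)
            ; ⁻¹-cong = λ p n → -‿cong (p n) }
          ; comm = λ f g n → +-comm _ _ }
        ; *-cong = *'-cong
        ; *-assoc = *'-assoc
        ; *-identity = *'-identityˡ , *'-identityʳ
        ; distrib = *'-distribˡ , *'-distribʳ }
      ; *-comm = *'-comm }
      where open import Data.Product using (_,_)

    powerSeriesRing : CommutativeRing c ℓ
    powerSeriesRing = record { isCommutativeRing = powerSeries-isCommutativeRing }

    open import Algebra.Properties.Ring ring using (-0#≈0#)

    const : Carrier → Seq
    const x zero = x
    const x (suc n) = 0#

    const-cong : ∀ {x y} → x ≈ y → const x ≈' const y
    const-cong p zero = p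
    const-cong p (suc n) = refl

    const-+ : ∀ x y → const (x + y) ≈' (const x +' const y)
    const-+ x y zero = refl
    const-+ x y (suc n) = sym (+-identityˡ 0#)

    const-* : ∀ x y → const (x * y) ≈' (const x *' const y)
    const-* x y zero = refl
    const-* x y (suc n) = sym (trans (Σ-single0 (suc n) _ (λ i → zeroˡ _)) (zeroʳ x))

    const-neg : ∀ x → const (- x) ≈' (-' const x)
    const-neg x zero = refl
    const-neg x (suc n) = sym -0#≈0#

  record IntegerEmbedding {c ℓ} (R : CommutativeRing c ℓ) : Set (c ⊔ ℓ) where
    open CommutativeRing R
    field
      embed : ℤ → Carrier
      embed-+ : ∀ x y → embed (x ℤ.+ y) ≈ embed x + embed y
      embed-* : ∀ x y → embed (x ℤ.* y) ≈ embed x * embed y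
      embed-neg : ∀ x → embed (ℤ.- x) ≈ - embed x
      embed-0 : embed (+ 0) ≈ 0#
      embed-1 : embed (+ 1) ≈ 1#

  lift-embedding : ∀ {c ℓ} {R : CommutativeRing c ℓ} → IntegerEmbedding R → IntegerEmbedding (PowerSeries.powerSeriesRing R)
  lift-embedding {R = R} H = record
    { embed = λ k → const (embed k)
    ; embed-+ = λ x y n → trans (const-cong (embed-+ x y) n) (const-+ (embed x) (embed y) n)
    ; embed-* = λ x y n → trans (const-cong (embed-* x y) n) (const-* (embed x) (embed y) n)
    ; embed-neg = λ x n → trans (const-cong (embed-neg x) n) (const-neg (embed x) n)
    ; embed-0 = λ n → trans (const-cong embed-0 n) (const-0# n)
    ; embed-1 = λ n → trans (const-cong embed-1 n) (const-1# n) }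
    where
    open CommutativeRing R
    open PowerSeries R
    open IntegerEmbedding H
    const-0# : ∀ n → const 0# n ≈ 0' n
    const-0# zero = refl
    const-0# (suc n) = refl
    const-1# : ∀ n → const 1# n ≈ 1' n
    const-1# zero = refl
    const-1# (suc n) = refl


  module Shift {c ℓ} (R : CommutativeRing c ℓ) where
    open CommutativeRing R
    open Sums R
    open PowerSeries R
    open import Data.Nat using (_<_)
    open import Data.Bool using (if_then_else_)

    monomial : ℕ → Carrier → Seq
    monomial zero x zero = x
    monomial zero x (suc m) = 0#
    monomial (suc i) x zero = 0#
    monomial (suc i) x (suc m) = monomial i x m

    monomial-char : ∀ i x m → monomial i x m ≡ (if m ℕ.≡ᵇ i then x else 0#)
    monomial-char zero x zero = P.refl
    monomial-char zero x (suc m) = P.refl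
    monomial-char (suc i) x zero = P.refl
    monomial-char (suc i) x (suc m) = monomial-char i x m

    monomial-on : ∀ i x → monomial i x i ≡ x
    monomial-on zero x = P.refl
    monomial-on (suc i) x = monomial-on i x

    monomial-off : ∀ i x m → (i < m ⊎ m < i) → monomial i x m ≡ 0#
    monomial-off zero x zero (inj₁ ())
    monomial-off zero x zero (inj₂ ())
    monomial-off zero x (suc m) _ = P.refl
    monomial-off (suc i) x zero _ = P.refl
    monomial-off (suc i) x (suc m) (inj₁ (s≤s p)) = monomial-off i x m (inj₁ p)
    monomial-off (suc i) x (suc m) (inj₂ (s≤s p)) = monomial-off i x m (inj₂ p)

    Σ-monomial-in : ∀ n i x (g : ℕ → Carrier) → i ≤ n → Σ≤ n (λ m → monomial i x m * g m) ≈ x * g i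
    Σ-monomial-out : ∀ n i x (g : ℕ → Carrier) → n < i → Σ≤ n (λ m → monomial i x m * g m) ≈ 0#
    Σ-monomial-in zero zero x g z≤n = refl
    Σ-monomial-in (suc n) i x g i≤ with ℕP.m≤n⇒m<n∨m≡n i≤
    ... | inj₁ (s≤s i≤n) = trans (+-cong (Σ-monomial-in n i x g i≤n) (trans (*-congʳ (reflexive (monomial-off i x (suc n) (inj₁ (s≤s i≤n))))) (zeroˡ _))) (+-identityʳ _)
    ... | inj₂ P.refl = trans (+-cong (Σ-monomial-out n (suc n) x g ℕP.≤-refl) (*-congʳ (reflexive (monomial-on (suc n) x)))) (+-identityˡ _)
    Σ-monomial-out zero (suc i) x g _ = zeroˡ _
    Σ-monomial-out (suc n) i x g n<i = trans (+-cong (Σ-monomial-out n i x g (ℕP.<-trans ℕP.≤-refl n<i)) (trans (*-congʳ (reflexive (monomial-off i x (suc n) (inj₂ n<i)))) (zeroˡ _))) (+-identityˡ _)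

    shift-in : ∀ i x f n → i ≤ n → (monomial i x *' f) n ≈ x * f (n ∸ i)
    shift-in i x f n i≤n = Σ-monomial-in n i x (λ m → f (n ∸ m)) i≤n

    shift-out : ∀ i x f n → n < i → (monomial i x *' f) n ≈ 0#
    shift-out i x f n n<i = Σ-monomial-out n i x (λ m → f (n ∸ m)) n<i


module SeriesRing where

  open import Defs
  open Convolution
  open import Algebra.Bundles using (CommutativeRing)
  open import Data.Nat as ℕ using (ℕ; zero; suc; _∸_)
  open import Data.Integer as ℤ using (ℤ; +_)
  import Data.Integer.Properties as ℤP
  open import Relation.Binary.PropositionalEquality as P using (_≡_; refl; cong₂; trans; sym)
  open import Relation.Nullary using (yes; no)
  open import Data.Maybe using (Maybe; just; nothing)
  open import Data.Product using (_,_)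
  open import Algebra.Structures using (IsCommutativeRing)
  open import Algebra.Solver.Ring.AlmostCommutativeRing using (fromCommutativeRing; _-Raw-AlmostCommutative⟶_)
  import Algebra.Solver.Ring
  import Relation.Binary.Reasoning.Setoid as SetoidReasoning

  module Pointwise {c ℓ} (R : CommutativeRing c ℓ) where
    open CommutativeRing R using (_≈_; +-congʳ) renaming (refl to ≈-refl)
    open PowerSeries R using (powerSeriesRing)
    Σ≤-app : ∀ n F x → Sums.Σ≤ powerSeriesRing n F x ≈ Sums.Σ≤ R n (λ i → F i x)
    Σ≤-app zero F x = ≈-refl
    Σ≤-app (suc n) F x = +-congʳ (Σ≤-app n F x)

  R0 R1 R2 R3 R4 : CommutativeRing _ _
  R0 = ℤP.+-*-commutativeRing
  R1 = PowerSeries.powerSeriesRing R0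
  R2 = PowerSeries.powerSeriesRing R1
  R3 = PowerSeries.powerSeriesRing R2
  R4 = PowerSeries.powerSeriesRing R3

  open CommutativeRing R1 public using () renaming (_*_ to _*₁_)
  open CommutativeRing R2 public using () renaming (_*_ to _*₂_)
  open CommutativeRing R3 public using () renaming (_*_ to _*₃_)
  open CommutativeRing R4 public using () renaming (_*_ to _*₄_)

  Σ≤≡sumTo : ∀ n (F G : ℕ → ℤ) → (∀ i → F i ≡ G i) → Sums.Σ≤ R0 n F ≡ sumTo n G
  Σ≤≡sumTo zero F G h = h 0
  Σ≤≡sumTo (suc n) F G h = cong₂ ℤ._+_ (Σ≤≡sumTo n F G h) (h (suc n))

  *₁-coeff : ∀ (f g : ℕ → ℤ) c → (f *₁ g) c ≡ sumTo c (λ c₁ → f c₁ ℤ.* g (c ∸ c₁))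
  *₁-coeff f g c = Σ≤≡sumTo c _ _ (λ i → refl)

  *₂-coeff : ∀ (f g : ℕ → ℕ → ℤ) b c →
    (f *₂ g) b c ≡ sumTo b (λ b₁ → sumTo c (λ c₁ → f b₁ c₁ ℤ.* g (b ∸ b₁) (c ∸ c₁)))
  *₂-coeff f g b c = trans (Pointwise.Σ≤-app R0 b _ c) (Σ≤≡sumTo b _ _ (λ i → *₁-coeff (f i) (g (b ∸ i)) c))

  *₃-coeff : ∀ (f g : ℕ → ℕ → ℕ → ℤ) a b c →
    (f *₃ g) a b c ≡ sumTo a (λ a₁ → sumTo b (λ b₁ → sumTo c (λ c₁ →
        f a₁ b₁ c₁ ℤ.* g (a ∸ a₁) (b ∸ b₁) (c ∸ c₁))))
  *₃-coeff f g a b c = trans (Pointwise.Σ≤-app R1 a _ b c) (trans (Pointwise.Σ≤-app R0 a _ c)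
    (Σ≤≡sumTo a _ _ (λ i → *₂-coeff (f i) (g (a ∸ i)) b c)))

  *₄-coeff : ∀ (f g : PS) d a b c → (f *₄ g) d a b c ≡ (f ⊗ g) d a b c
  *₄-coeff f g d a b c = trans (Pointwise.Σ≤-app R2 d _ a b c) (trans (Pointwise.Σ≤-app R1 d _ b c)
    (trans (Pointwise.Σ≤-app R0 d _ c) (Σ≤≡sumTo d _ _ (λ i → *₃-coeff (f i) (g (d ∸ i)) a b c))))

  1#₄≗one : ∀ d a b c → CommutativeRing.1# R4 d a b c ≡ one d a b c
  1#₄≗one zero    zero    zero    zero    = refl
  1#₄≗one zero    zero    zero    (suc c) = refl
  1#₄≗one zero    zero    (suc b) c       = refl
  1#₄≗one zero    (suc a) b       c       = refl
  1#₄≗one (suc d) a       b       c       = refl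

  infix 4 _≈_
  _≈_ : PS → PS → Set
  f ≈ g = ∀ d a b c → f d a b c ≡ g d a b c

  ⊗≈*₄ : ∀ f g → f ⊗ g ≈ f *₄ g
  ⊗≈*₄ f g d a b c = sym (*₄-coeff f g d a b c)

  private
    module R4 = CommutativeRing R4
    open SetoidReasoning R4.setoid

    ⊗-cong : ∀ {f f' g g'} → f ≈ f' → g ≈ g' → f ⊗ g ≈ f' ⊗ g'
    ⊗-cong {f} {f'} {g} {g'} p q = begin
      f ⊗ g     ≈⟨ ⊗≈*₄ f g ⟩
      f *₄ g    ≈⟨ R4.*-cong p q ⟩
      f' *₄ g'  ≈⟨ R4.sym (⊗≈*₄ f' g') ⟩
      f' ⊗ g'   ∎

    ⊗-assoc : ∀ f g h → (f ⊗ g) ⊗ h ≈ f ⊗ (g ⊗ h)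
    ⊗-assoc f g h = begin
      (f ⊗ g) ⊗ h    ≈⟨ ⊗≈*₄ (f ⊗ g) h ⟩
      (f ⊗ g) *₄ h   ≈⟨ R4.*-congʳ {h} (⊗≈*₄ f g) ⟩
      (f *₄ g) *₄ h  ≈⟨ R4.*-assoc f g h ⟩
      f *₄ (g *₄ h)  ≈⟨ R4.*-congˡ {f} (R4.sym (⊗≈*₄ g h)) ⟩
      f *₄ (g ⊗ h)   ≈⟨ R4.sym (⊗≈*₄ f (g ⊗ h)) ⟩
      f ⊗ (g ⊗ h)    ∎

    ⊗-comm : ∀ f g → f ⊗ g ≈ g ⊗ f
    ⊗-comm f g = begin
      f ⊗ g   ≈⟨ ⊗≈*₄ f g ⟩
      f *₄ g  ≈⟨ R4.*-comm f g ⟩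
      g *₄ f  ≈⟨ R4.sym (⊗≈*₄ g f) ⟩
      g ⊗ f   ∎

    ⊗-identityˡ : ∀ f → one ⊗ f ≈ f
    ⊗-identityˡ f = begin
      one ⊗ f     ≈⟨ ⊗≈*₄ one f ⟩
      one *₄ f    ≈⟨ R4.*-congʳ {f} (λ d a b c → sym (1#₄≗one d a b c)) ⟩
      R4.1# *₄ f  ≈⟨ R4.*-identityˡ f ⟩
      f           ∎

    ⊗-distribˡ : ∀ f g h → f ⊗ (g ⊕ h) ≈ f ⊗ g ⊕ f ⊗ h
    ⊗-distribˡ f g h = begin
      f ⊗ (g ⊕ h)          ≈⟨ ⊗≈*₄ f (g ⊕ h) ⟩
      f *₄ (g ⊕ h)         ≈⟨ R4.distribˡ f g h ⟩
      f *₄ g ⊕ f *₄ h      ≈⟨ R4.sym (R4.+-cong (⊗≈*₄ f g) (⊗≈*₄ f h)) ⟩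
      f ⊗ g ⊕ f ⊗ h        ∎

  isCommutativeRing : IsCommutativeRing _≈_ _⊕_ _⊗_ ⊝_ zeroPS one
  isCommutativeRing = record
    { isRing = record
      { +-isAbelianGroup = R4.+-isAbelianGroup
      ; *-cong = ⊗-cong
      ; *-assoc = ⊗-assoc
      ; *-identity = ⊗-identityˡ , (λ f → R4.trans (⊗-comm f one) (⊗-identityˡ f))
      ; distrib = ⊗-distribˡ , (λ f g h → R4.trans (⊗-comm (g ⊕ h) f)
                                 (R4.trans (⊗-distribˡ f g h) (R4.+-cong (⊗-comm f g) (⊗-comm f h))))
      }
    ; *-comm = ⊗-comm
    }

  PSR : CommutativeRing _ _
  PSR = record { isCommutativeRing = isCommutativeRing }

  module PR = CommutativeRing PSR
  module ≈-Reasoning = SetoidReasoning PR.setoid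

  ⊕-congˡ : ∀ f {g h} → g ≈ h → f ⊕ g ≈ f ⊕ h
  ⊕-congˡ f = PR.+-congˡ {f}

  ⊕-congʳ : ∀ h {f g} → f ≈ g → f ⊕ h ≈ g ⊕ h
  ⊕-congʳ h = PR.+-congʳ {h}

  ⊗-congˡ : ∀ f {g h} → g ≈ h → f ⊗ g ≈ f ⊗ h
  ⊗-congˡ f = PR.*-congˡ {f}

  ⊗-congʳ : ∀ h {f g} → f ≈ g → f ⊗ h ≈ g ⊗ h
  ⊗-congʳ h = PR.*-congʳ {h}

  seriesEmbedding : IntegerEmbedding R4
  seriesEmbedding = lift-embedding (lift-embedding (lift-embedding (lift-embedding idEmbedding)))
    where
    idEmbedding : IntegerEmbedding R0
    idEmbedding = record { embed = λ k → k ; embed-+ = λ _ _ → refl ; embed-* = λ _ _ → refl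
                         ; embed-neg = λ _ → refl ; embed-0 = refl ; embed-1 = refl }

  open IntegerEmbedding seriesEmbedding renaming (embed to fromℤ)

  -- A copy of fromℤ under which the solver's constants 0, 1 and -1 are literally zeroPS, one and minusOne.
  fromℤ′ : ℤ → PS
  fromℤ′ (+ 0)            = zeroPS
  fromℤ′ (+ 1)            = one
  fromℤ′ ℤ.-[1+ 0 ]       = minusOne
  fromℤ′ (+ suc (suc n))  = fromℤ (+ suc (suc n))
  fromℤ′ ℤ.-[1+ suc n ]   = fromℤ ℤ.-[1+ suc n ]

  fromℤ′≈fromℤ : ∀ k → fromℤ′ k ≈ fromℤ k
  fromℤ′≈fromℤ (+ 0)           = PR.sym embed-0
  fromℤ′≈fromℤ (+ 1)           = PR.sym fromℤ1≈one
    where fromℤ1≈one : fromℤ (+ 1) ≈ one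
          fromℤ1≈one = PR.trans embed-1 1#₄≗one
  fromℤ′≈fromℤ ℤ.-[1+ 0 ]      = PR.sym (PR.trans (embed-neg (+ 1)) (PR.-‿cong (PR.trans embed-1 1#₄≗one)))
  fromℤ′≈fromℤ (+ suc (suc n)) = PR.refl
  fromℤ′≈fromℤ ℤ.-[1+ suc n ]  = PR.refl

  fromℤ′-morphism : CommutativeRing.rawRing R0 -Raw-AlmostCommutative⟶ fromCommutativeRing PSR
  fromℤ′-morphism = record
    { ⟦_⟧    = fromℤ′
    ; +-homo = λ x y → via (x ℤ.+ y) (PR.trans (embed-+ x y) (PR.+-cong (back x) (back y)))
    ; *-homo = λ x y → via (x ℤ.* y) (PR.trans (embed-* x y) (PR.trans (PR.sym (⊗≈*₄ (fromℤ x) (fromℤ y))) (⊗-cong (back x) (back y))))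
    ; -‿homo = λ x → via (ℤ.- x) (PR.trans (embed-neg x) (PR.-‿cong (back x)))
    ; 0-homo = PR.refl
    ; 1-homo = PR.refl }
    where
    back : ∀ k → fromℤ k ≈ fromℤ′ k
    back k = PR.sym (fromℤ′≈fromℤ k)
    via : ∀ k {f} → fromℤ k ≈ f → fromℤ′ k ≈ f
    via k = PR.trans (fromℤ′≈fromℤ k)

  fromℤ′-≟ : ∀ x y → Maybe (fromℤ′ x ≈ fromℤ′ y)
  fromℤ′-≟ x y with x ℤ.≟ y
  ... | yes refl = just PR.refl
  ... | no _     = nothing

  module Solver = Algebra.Solver.Ring (CommutativeRing.rawRing R0) (fromCommutativeRing PSR) fromℤ′-morphism fromℤ′-≟
module Truncation where

  open import Defs
  open SeriesRing
  open ExponentIdentities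
  open import Data.Nat as ℕ using (ℕ; zero; suc; _∸_; _≤_; _<_; z≤n; s≤s)
  import Data.Nat.Properties as ℕP
  open import Data.Integer as ℤ using (ℤ; +_)
  import Data.Integer.Properties as ℤP
  open import Data.Sum using (inj₁; inj₂)
  open import Relation.Binary.PropositionalEquality as P using (_≡_; refl; cong; cong₂; trans; sym)
  open import Relation.Nullary using (yes; no)
  open Solver using (solve; _:=_; _:+_; _:*_; _:-_; con)
  open import Relation.Binary.Bundles using (Setoid)
  import Relation.Binary.Reasoning.Setoid as SetoidReasoning

  sumTo-cong≤ : ∀ n {f g : ℕ → ℤ} → (∀ i → i ≤ n → f i ≡ g i) → sumTo n f ≡ sumTo n g
  sumTo-cong≤ zero    h = h 0 z≤n
  sumTo-cong≤ (suc n) h = cong₂ ℤ._+_ (sumTo-cong≤ n (λ i i≤n → h i (ℕP.m≤n⇒m≤1+n i≤n))) (h (suc n) ℕP.≤-refl)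

  sumTo-0 : ∀ n (f : ℕ → ℤ) → (∀ i → i ≤ n → f i ≡ + 0) → sumTo n f ≡ + 0
  sumTo-0 zero    f h = h 0 z≤n
  sumTo-0 (suc n) f h = cong₂ ℤ._+_ (sumTo-0 n f (λ i i≤n → h i (ℕP.m≤n⇒m≤1+n i≤n))) (h (suc n) ℕP.≤-refl)

  sumBelow : ℕ → (ℕ → ℤ) → ℤ
  sumBelow zero    g = + 0
  sumBelow (suc n) g = sumBelow n g ℤ.+ g n

  sumTo≡sumBelow : ∀ n g → sumTo n g ≡ sumBelow (suc n) g
  sumTo≡sumBelow zero    g = sym (ℤP.+-identityˡ (g 0))
  sumTo≡sumBelow (suc n) g = cong (ℤ._+ g (suc n)) (sumTo≡sumBelow n g)

  sumBelow-stable : ∀ {A} B g → A ≤ B → (∀ n → A ≤ n → g n ≡ + 0) → sumBelow B g ≡ sumBelow A g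
  sumBelow-stable B g A≤B z with ℕP.m≤n⇒m<n∨m≡n A≤B
  ... | inj₂ refl = refl
  sumBelow-stable zero    g _ z | inj₁ ()
  sumBelow-stable (suc B) g _ z | inj₁ A<1+B =
    trans (cong₂ ℤ._+_ (sumBelow-stable B g A≤B z) (z B A≤B)) (ℤP.+-identityʳ _)
    where A≤B = ℕP.≤-pred A<1+B

  infix 4 _≈[_]_
  _≈[_]_ : PS → ℕ → PS → Set
  f ≈[ N ] g = ∀ d a b c → d ℕ.+ a ℕ.+ b ℕ.+ c < N → f d a b c ≡ g d a b c

  Ord : ℕ → PS → Set
  Ord N f = f ≈[ N ] zeroPS

  ≈⇒≈[] : ∀ {f g} N → f ≈ g → f ≈[ N ] g
  ≈⇒≈[] N p d a b c _ = p d a b c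

  ≈[]⇒≈ : ∀ {f g} → (∀ N → f ≈[ N ] g) → f ≈ g
  ≈[]⇒≈ h d a b c = h (suc (d ℕ.+ a ℕ.+ b ℕ.+ c)) d a b c ℕP.≤-refl

  ≈[]-trans : ∀ {f g h N} → f ≈[ N ] g → g ≈[ N ] h → f ≈[ N ] h
  ≈[]-trans p q d a b c l = trans (p d a b c l) (q d a b c l)

  ≈[]-sym : ∀ {f g N} → f ≈[ N ] g → g ≈[ N ] f
  ≈[]-sym p d a b c l = sym (p d a b c l)

  ≈[]-weaken : ∀ {f g N M} → M ≤ N → f ≈[ N ] g → f ≈[ M ] g
  ≈[]-weaken M≤N p d a b c l = p d a b c (ℕP.<-≤-trans l M≤N)

  ≈[]-⊕ : ∀ {f f' g g' N} → f ≈[ N ] f' → g ≈[ N ] g' → f ⊕ g ≈[ N ] f' ⊕ g'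
  ≈[]-⊕ p q d a b c l = cong₂ ℤ._+_ (p d a b c l) (q d a b c l)

  ≈[]-⊝ : ∀ {f f' N} → f ≈[ N ] f' → ⊝ f ≈[ N ] ⊝ f'
  ≈[]-⊝ p d a b c l = cong ℤ.-_ (p d a b c l)

  Ord-weaken : ∀ {M N f} → M ≤ N → Ord N f → Ord M f
  Ord-weaken {f = f} = ≈[]-weaken {f}

  Ord0 : ∀ f → Ord 0 f
  Ord0 f d a b c ()

  Ord₁ : ∀ {f} → f 0 0 0 0 ≡ + 0 → Ord 1 f
  Ord₁ e zero    zero    zero    zero    _         = e
  Ord₁ e zero    zero    zero    (suc c) (s≤s ())
  Ord₁ e zero    zero    (suc b) c       (s≤s ())
  Ord₁ e zero    (suc a) b       c       (s≤s ())
  Ord₁ e (suc d) a       b       c       (s≤s ())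

  OrdX : Ord 1 X
  OrdX = Ord₁ refl

  OrdQ : Ord 1 Q
  OrdQ = Ord₁ refl

  private
    degree-split : ∀ d a b c d₁ a₁ b₁ c₁ → d₁ ≤ d → a₁ ≤ a → b₁ ≤ b → c₁ ≤ c →
      ((d ∸ d₁) ℕ.+ (a ∸ a₁) ℕ.+ (b ∸ b₁) ℕ.+ (c ∸ c₁)) ℕ.+ (d₁ ℕ.+ a₁ ℕ.+ b₁ ℕ.+ c₁) ≡ d ℕ.+ a ℕ.+ b ℕ.+ c
    degree-split d a b c d₁ a₁ b₁ c₁ p q r s =
      trans (+-interchange₄ (d ∸ d₁) (a ∸ a₁) (b ∸ b₁) (c ∸ c₁) d₁ a₁ b₁ c₁)
        (cong₂ ℕ._+_ (cong₂ ℕ._+_ (cong₂ ℕ._+_ (ℕP.m∸n+n≡m p) (ℕP.m∸n+n≡m q)) (ℕP.m∸n+n≡m r)) (ℕP.m∸n+n≡m s))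

  Ord-⊗ : ∀ {m n f g} → Ord m f → Ord n g → Ord (m ℕ.+ n) (f ⊗ g)
  Ord-⊗ {m} {n} {f} {g} of og d a b c l =
    sumTo-0 d _ λ d₁ p → sumTo-0 a _ λ a₁ q → sumTo-0 b _ λ b₁ r → sumTo-0 c _ λ c₁ s → term d₁ a₁ b₁ c₁ p q r s
    where
    term : ∀ d₁ a₁ b₁ c₁ → d₁ ≤ d → a₁ ≤ a → b₁ ≤ b → c₁ ≤ c →
           f d₁ a₁ b₁ c₁ ℤ.* g (d ∸ d₁) (a ∸ a₁) (b ∸ b₁) (c ∸ c₁) ≡ + 0
    term d₁ a₁ b₁ c₁ p q r s with d₁ ℕ.+ a₁ ℕ.+ b₁ ℕ.+ c₁ ℕP.<? m
    ... | yes lt = cong (ℤ._* _) (of d₁ a₁ b₁ c₁ lt)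
    ... | no ge = trans (cong (f d₁ a₁ b₁ c₁ ℤ.*_) (og _ _ _ _ lt)) (ℤP.*-zeroʳ (f d₁ a₁ b₁ c₁))
      where
      lt : (d ∸ d₁) ℕ.+ (a ∸ a₁) ℕ.+ (b ∸ b₁) ℕ.+ (c ∸ c₁) < n
      lt = ℕP.≰⇒> λ n≤ → ℕP.<⇒≱ l (ℕP.≤-trans (ℕP.+-mono-≤ (ℕP.≮⇒≥ ge) n≤)
             (ℕP.≤-reflexive (trans (ℕP.+-comm (d₁ ℕ.+ a₁ ℕ.+ b₁ ℕ.+ c₁) _) (degree-split d a b c d₁ a₁ b₁ c₁ p q r s))))

  Ord-⊗ˡ : ∀ {n f} g → Ord n f → Ord n (f ⊗ g)
  Ord-⊗ˡ {n} {f} g o = P.subst (λ k → Ord k (f ⊗ g)) (ℕP.+-identityʳ n) (Ord-⊗ {g = g} o (Ord0 g))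

  Ord-⊗ʳ : ∀ {n g} f → Ord n g → Ord n (f ⊗ g)
  Ord-⊗ʳ f = Ord-⊗ {f = f} (Ord0 f)

  Ord-^^ : ∀ {f} n → Ord 1 f → Ord n (f ^^ n)
  Ord-^^ zero    o = Ord0 _
  Ord-^^ (suc n) o = Ord-⊗ o (Ord-^^ n o)

  ≈[]-⊗ˡ : ∀ {m N h h'} g → Ord m g → h ≈[ N ] h' → g ⊗ h ≈[ m ℕ.+ N ] g ⊗ h'
  ≈[]-⊗ˡ {m} {N} {h} {h'} g og p d a b c l =
    ℤP.i-j≡0⇒i≡j _ _ (trans (sym (distrib d a b c)) (Ord-⊗ {m} {N} {g} {h ⊖ h'} og h-h' d a b c l))
    where
    h-h' : Ord N (h ⊖ h')
    h-h' d a b c l = trans (cong (ℤ._- h' d a b c) (p d a b c l)) (ℤP.+-inverseʳ (h' d a b c))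
    distrib : g ⊗ (h ⊖ h') ≈ g ⊗ h ⊖ g ⊗ h'
    distrib = solve 3 (λ g h h' → g :* (h :- h') := g :* h :- g :* h') PR.refl g h h'

  ≈[]-⊗ : ∀ {N f f' g g'} → f ≈[ N ] f' → g ≈[ N ] g' → f ⊗ g ≈[ N ] f' ⊗ g'
  ≈[]-⊗ {N} {f} {f'} {g} {g'} p q d a b c l = begin
      (f ⊗ g) d a b c   ≡⟨ ≈[]-⊗ˡ f (Ord0 f) q d a b c l ⟩
      (f ⊗ g') d a b c  ≡⟨ PR.*-comm f g' d a b c ⟩
      (g' ⊗ f) d a b c  ≡⟨ ≈[]-⊗ˡ g' (Ord0 g') p d a b c l ⟩
      (g' ⊗ f') d a b c ≡⟨ PR.*-comm g' f' d a b c ⟩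
      (f' ⊗ g') d a b c ∎
    where open P.≡-Reasoning

  fsum : ℕ → (ℕ → PS) → PS
  fsum zero    f = zeroPS
  fsum (suc n) f = fsum n f ⊕ f n

  fsum-coeff : ∀ n f d a b c → fsum n f d a b c ≡ sumBelow n (λ i → f i d a b c)
  fsum-coeff zero    f d a b c = refl
  fsum-coeff (suc n) f d a b c = cong (ℤ._+ f n d a b c) (fsum-coeff n f d a b c)

  infSum-trunc : ∀ {K} M (f : ℕ → PS) → (∀ n → Ord n (f n)) → (∀ n → M ≤ n → Ord K (f n)) →
                 infSum f ≈[ K ] fsum M f
  infSum-trunc {K} M f ord ord-tail d a b c l
    rewrite fsum-coeff M f d a b c | sumTo≡sumBelow (d ℕ.+ a ℕ.+ b ℕ.+ c) (λ n → f n d a b c)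
    with ℕP.≤-total M (suc (d ℕ.+ a ℕ.+ b ℕ.+ c))
  ... | inj₁ M≤ = sumBelow-stable _ _ M≤ (λ n M≤n → ord-tail n M≤n d a b c l)
  ... | inj₂ ≤M = sym (sumBelow-stable M _ ≤M (λ n D<n → ord n d a b c D<n))

  infSum-cong : ∀ {f g : ℕ → PS} → (∀ n → f n ≈ g n) → infSum f ≈ infSum g
  infSum-cong h d a b c = sumTo-cong≤ (d ℕ.+ a ℕ.+ b ℕ.+ c) (λ n _ → h n d a b c)

  Ord-infSum : ∀ {K} (f : ℕ → PS) → (∀ n → Ord K (f n)) → Ord K (infSum f)
  Ord-infSum f h d a b c l = sumTo-0 (d ℕ.+ a ℕ.+ b ℕ.+ c) _ (λ n _ → h n d a b c l)

  ^^-cong : ∀ {f g} n → f ≈ g → f ^^ n ≈ g ^^ n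
  ^^-cong zero    p = PR.refl
  ^^-cong (suc n) p = PR.*-cong p (^^-cong n p)

  ^^-+ : ∀ f m n → f ^^ (m ℕ.+ n) ≈ f ^^ m ⊗ f ^^ n
  ^^-+ f zero    n = PR.sym (PR.*-identityˡ (f ^^ n))
  ^^-+ f (suc m) n = begin
    f ⊗ f ^^ (m ℕ.+ n)     ≈⟨ ⊗-congˡ f (^^-+ f m n) ⟩
    f ⊗ (f ^^ m ⊗ f ^^ n)  ≈⟨ PR.sym (PR.*-assoc f (f ^^ m) (f ^^ n)) ⟩
    f ⊗ f ^^ m ⊗ f ^^ n    ∎
    where open ≈-Reasoning

  ^^-distrib-⊗ : ∀ f g n → (f ⊗ g) ^^ n ≈ f ^^ n ⊗ g ^^ n
  ^^-distrib-⊗ f g zero    = PR.sym (PR.*-identityˡ one)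
  ^^-distrib-⊗ f g (suc n) = begin
    (f ⊗ g) ⊗ (f ⊗ g) ^^ n      ≈⟨ ⊗-congˡ (f ⊗ g) (^^-distrib-⊗ f g n) ⟩
    (f ⊗ g) ⊗ (f ^^ n ⊗ g ^^ n) ≈⟨ solve 4 (λ f g x y → (f :* g) :* (x :* y) := (f :* x) :* (g :* y)) PR.refl f g (f ^^ n) (g ^^ n) ⟩
    f ^^ suc n ⊗ g ^^ suc n     ∎
    where open ≈-Reasoning

  one-^^ : ∀ n → one ^^ n ≈ one
  one-^^ zero    = PR.refl
  one-^^ (suc n) = PR.trans (PR.*-identityˡ (one ^^ n)) (one-^^ n)

  geometric-sum : ∀ W N → (one ⊖ W) ⊗ fsum N (W ^^_) ≈ one ⊖ W ^^ N
  geometric-sum W zero    = solve 1 (λ w → (con (+ 1) :- w) :* con (+ 0) := con (+ 1) :- con (+ 1)) PR.refl W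
  geometric-sum W (suc N) = begin
    (one ⊖ W) ⊗ (S ⊕ Wᴺ)          ≈⟨ solve 3 (λ w s wn → (con (+ 1) :- w) :* (s :+ wn) := (con (+ 1) :- w) :* s :+ (wn :- w :* wn)) PR.refl W S Wᴺ ⟩
    (one ⊖ W) ⊗ S ⊕ (Wᴺ ⊖ W ⊗ Wᴺ) ≈⟨ ⊕-congʳ (Wᴺ ⊖ W ⊗ Wᴺ) (geometric-sum W N) ⟩
    (one ⊖ Wᴺ) ⊕ (Wᴺ ⊖ W ⊗ Wᴺ)    ≈⟨ solve 2 (λ w wn → (con (+ 1) :- wn) :+ (wn :- w :* wn) := con (+ 1) :- w :* wn) PR.refl W Wᴺ ⟩
    one ⊖ W ⊗ Wᴺ                  ∎
    where
    open ≈-Reasoning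
    S = fsum N (W ^^_)
    Wᴺ = W ^^ N

  inv1m-trunc : ∀ {W} N → Ord 1 W → inv1m W ≈[ N ] fsum N (W ^^_)
  inv1m-trunc {W} N o = infSum-trunc N (W ^^_) (λ n → Ord-^^ n o) (λ n N≤n → Ord-weaken N≤n (Ord-^^ n o))

  inv1m-inverse : ∀ {W} → Ord 1 W → (one ⊖ W) ⊗ inv1m W ≈ one
  inv1m-inverse {W} o = ≈[]⇒≈ coeff
    where
    open P.≡-Reasoning
    coeff : ∀ N → (one ⊖ W) ⊗ inv1m W ≈[ N ] one
    coeff N d a b c l = begin
      ((one ⊖ W) ⊗ inv1m W) d a b c          ≡⟨ ≈[]-⊗ˡ (one ⊖ W) (Ord0 _) (inv1m-trunc N o) d a b c l ⟩
      ((one ⊖ W) ⊗ fsum N (W ^^_)) d a b c   ≡⟨ geometric-sum W N d a b c ⟩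
      one d a b c ℤ.- (W ^^ N) d a b c       ≡⟨ cong (λ z → one d a b c ℤ.- z) (Ord-^^ N o d a b c l) ⟩
      one d a b c ℤ.- + 0                    ≡⟨ ℤP.+-identityʳ _ ⟩
      one d a b c                            ∎

  inv1m-⊗-truncation : ∀ {W} m → Ord 1 W → (one ⊖ W ^^ m) ⊗ inv1m W ≈ fsum m (W ^^_)
  inv1m-⊗-truncation {W} m o = begin
    (one ⊖ W ^^ m) ⊗ I    ≈⟨ ⊗-congʳ I (PR.sym (geometric-sum W m)) ⟩
    ((one ⊖ W) ⊗ S) ⊗ I   ≈⟨ solve 3 (λ w s i → ((con (+ 1) :- w) :* s) :* i := s :* ((con (+ 1) :- w) :* i)) PR.refl W S I ⟩
    S ⊗ ((one ⊖ W) ⊗ I)   ≈⟨ ⊗-congˡ S (inv1m-inverse o) ⟩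
    S ⊗ one               ≈⟨ PR.*-identityʳ S ⟩
    S                     ∎
    where
    open ≈-Reasoning
    S = fsum m (W ^^_)
    I = inv1m W

  ≈[]-setoid : ℕ → Setoid _ _
  ≈[]-setoid N = record
    { Carrier = PS
    ; _≈_ = _≈[ N ]_
    ; isEquivalence = record { refl = λ _ _ _ _ _ → refl ; sym = λ {f} {g} → ≈[]-sym {f} {g} ; trans = λ {f} {g} {h} → ≈[]-trans {f} {g} {h} } }

  module ≈[]-Reasoning (N : ℕ) = SetoidReasoning (≈[]-setoid N)
module Monomials where

  open import Defs
  open SeriesRing
  open Truncation using (^^-cong)
  open Convolution using (module Shift)
  open import Data.Nat as ℕ using (ℕ; zero; suc; _∸_; _≤_; _<_; s≤s; _≡ᵇ_)
  import Data.Nat.Properties as ℕP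
  open import Data.Integer as ℤ using (+_)
  import Data.Integer.Properties as ℤP
  open import Data.Bool using (true; false; if_then_else_; _∧_)
  open import Data.Sum using (_⊎_; inj₁; inj₂)
  open import Data.Product using (_×_; _,_)
  import Data.Sum as Sum
  open import Relation.Binary.PropositionalEquality as P using (_≡_; refl; trans; sym)
  open import Relation.Nullary using (yes; no)
  open import Data.Empty using (⊥-elim)

  private
    module S0 = Shift R0
    module S1 = Shift R1
    module S2 = Shift R2
    module S3 = Shift R3

  monomial₄ : ℕ → ℕ → ℕ → ℕ → PS
  monomial₄ i j k l = S3.monomial i (S2.monomial j (S1.monomial k (S0.monomial l (+ 1))))

  mono≈monomial₄ : ∀ i j k l → mono i j k l ≈ monomial₄ i j k l
  mono≈monomial₄ i j k l d a b c
    rewrite S3.monomial-char i (S2.monomial j (S1.monomial k (S0.monomial l (+ 1)))) d with d ≡ᵇ i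
  ... | false = refl
  ... | true rewrite S2.monomial-char j (S1.monomial k (S0.monomial l (+ 1))) a with a ≡ᵇ j
  ... | false = refl
  ... | true rewrite S1.monomial-char k (S0.monomial l (+ 1)) b with b ≡ᵇ k
  ... | false = refl
  ... | true rewrite S0.monomial-char l (+ 1) c with c ≡ᵇ l
  ... | false = refl
  ... | true = refl

  Outside : ℕ → ℕ → ℕ → ℕ → ℕ → ℕ → ℕ → ℕ → Set
  Outside i j k l d a b c = d < i ⊎ a < j ⊎ b < k ⊎ c < l

  private
    via-monomial₄ : ∀ i j k l f d a b c → (mono i j k l ⊗ f) d a b c ≡ (monomial₄ i j k l *₄ f) d a b c
    via-monomial₄ i j k l f = PR.trans (⊗-congʳ f (mono≈monomial₄ i j k l)) (⊗≈*₄ (monomial₄ i j k l) f)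

  mono-in : ∀ i j k l f d a b c → i ≤ d → j ≤ a → k ≤ b → l ≤ c →
    (mono i j k l ⊗ f) d a b c ≡ f (d ∸ i) (a ∸ j) (b ∸ k) (c ∸ l)
  mono-in i j k l f d a b c p q r s = trans (via-monomial₄ i j k l f d a b c)
    (trans (S3.shift-in i x₃ f d p a b c)
    (trans (S2.shift-in j x₂ (f (d ∸ i)) a q b c)
    (trans (S1.shift-in k x₁ (f (d ∸ i) (a ∸ j)) b r c)
    (trans (S0.shift-in l (+ 1) (f (d ∸ i) (a ∸ j) (b ∸ k)) c s)
      (ℤP.*-identityˡ _)))))
    where x₁ = S0.monomial l (+ 1)
          x₂ = S1.monomial k x₁
          x₃ = S2.monomial j x₂


  mono-out : ∀ i j k l f d a b c → Outside i j k l d a b c → (mono i j k l ⊗ f) d a b c ≡ + 0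
  mono-out i j k l f d a b c o with i ℕP.≤? d | j ℕP.≤? a | k ℕP.≤? b
  ... | no i≰d | _ | _ =
    trans (via-monomial₄ i j k l f d a b c) (S3.shift-out i x₃ f d (ℕP.≰⇒> i≰d) a b c)
    where x₃ = S2.monomial j (S1.monomial k (S0.monomial l (+ 1)))
  ... | yes i≤d | no j≰a | _ =
    trans (via-monomial₄ i j k l f d a b c) (trans (S3.shift-in i x₃ f d i≤d a b c)
      (S2.shift-out j x₂ (f (d ∸ i)) a (ℕP.≰⇒> j≰a) b c))
    where x₂ = S1.monomial k (S0.monomial l (+ 1))
          x₃ = S2.monomial j x₂
  ... | yes i≤d | yes j≤a | no k≰b =
    trans (via-monomial₄ i j k l f d a b c) (trans (S3.shift-in i x₃ f d i≤d a b c)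
      (trans (S2.shift-in j x₂ (f (d ∸ i)) a j≤a b c)
      (S1.shift-out k x₁ (f (d ∸ i) (a ∸ j)) b (ℕP.≰⇒> k≰b) c)))
    where x₁ = S0.monomial l (+ 1)
          x₂ = S1.monomial k x₁
          x₃ = S2.monomial j x₂
  ... | yes i≤d | yes j≤a | yes k≤b =
    trans (via-monomial₄ i j k l f d a b c) (trans (S3.shift-in i x₃ f d i≤d a b c)
      (trans (S2.shift-in j x₂ (f (d ∸ i)) a j≤a b c)
      (trans (S1.shift-in k x₁ (f (d ∸ i) (a ∸ j)) b k≤b c)
      (S0.shift-out l (+ 1) (f (d ∸ i) (a ∸ j) (b ∸ k)) c (last o)))))
    where x₁ = S0.monomial l (+ 1)
          x₂ = S1.monomial k x₁
          x₃ = S2.monomial j x₂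
          last : Outside i j k l d a b c → c < l
          last (inj₁ d<i)                = ⊥-elim (ℕP.<⇒≱ d<i i≤d)
          last (inj₂ (inj₁ a<j))         = ⊥-elim (ℕP.<⇒≱ a<j j≤a)
          last (inj₂ (inj₂ (inj₁ b<k)))  = ⊥-elim (ℕP.<⇒≱ b<k k≤b)
          last (inj₂ (inj₂ (inj₂ c<l)))  = c<l

  private
    ≡ᵇ-∸ : ∀ i i' d → i ≤ d → ((d ∸ i) ≡ᵇ i') ≡ (d ≡ᵇ (i ℕ.+ i'))
    ≡ᵇ-∸ zero    i' d       _       = refl
    ≡ᵇ-∸ (suc i) i' (suc d) (s≤s p) = ≡ᵇ-∸ i i' d p

    <⇒≡ᵇ-false : ∀ d m → d < m → (d ≡ᵇ m) ≡ false
    <⇒≡ᵇ-false zero    (suc m) _       = refl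
    <⇒≡ᵇ-false (suc d) (suc m) (s≤s p) = <⇒≡ᵇ-false d m p

    if-∧-false : ∀ x y z w → x ≡ false ⊎ y ≡ false ⊎ z ≡ false ⊎ w ≡ false →
      (if x ∧ y ∧ z ∧ w then + 1 else + 0) ≡ + 0
    if-∧-false false y    z     w     _ = refl
    if-∧-false true false z     w     _ = refl
    if-∧-false true true  false w     _ = refl
    if-∧-false true true  true  false _ = refl
    if-∧-false true true  true  true  (inj₁ ())
    if-∧-false true true  true  true  (inj₂ (inj₁ ()))
    if-∧-false true true  true  true  (inj₂ (inj₂ (inj₁ ())))
    if-∧-false true true  true  true  (inj₂ (inj₂ (inj₂ ())))

  mono-vanishes : ∀ {i j k l d a b c} → Outside i j k l d a b c → mono i j k l d a b c ≡ + 0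
  mono-vanishes {i} {j} {k} {l} {d} {a} {b} {c} o = if-∧-false (d ≡ᵇ i) (a ≡ᵇ j) (b ≡ᵇ k) (c ≡ᵇ l)
    (Sum.map (<⇒≡ᵇ-false d i) (Sum.map (<⇒≡ᵇ-false a j) (Sum.map (<⇒≡ᵇ-false b k) (<⇒≡ᵇ-false c l))) o)

  private
    mono-⊗-outside : ∀ i j k l i' j' k' l' d a b c → Outside i j k l d a b c →
      (mono i j k l ⊗ mono i' j' k' l') d a b c ≡ mono (i ℕ.+ i') (j ℕ.+ j') (k ℕ.+ k') (l ℕ.+ l') d a b c
    mono-⊗-outside i j k l i' j' k' l' d a b c o =
      trans (mono-out i j k l (mono i' j' k' l') d a b c o) (sym (mono-vanishes (widen o)))
      where
      widen : Outside i j k l d a b c → Outside (i ℕ.+ i') (j ℕ.+ j') (k ℕ.+ k') (l ℕ.+ l') d a b c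
      widen = Sum.map (λ p → ℕP.<-≤-trans p (ℕP.m≤m+n i i')) (Sum.map (λ p → ℕP.<-≤-trans p (ℕP.m≤m+n j j'))
                (Sum.map (λ p → ℕP.<-≤-trans p (ℕP.m≤m+n k k')) (λ p → ℕP.<-≤-trans p (ℕP.m≤m+n l l'))))

  inside-or-Outside : ∀ i j k l d a b c → (i ≤ d × j ≤ a × k ≤ b × l ≤ c) ⊎ Outside i j k l d a b c
  inside-or-Outside i j k l d a b c with i ℕP.≤? d | j ℕP.≤? a | k ℕP.≤? b | l ℕP.≤? c
  ... | yes p | yes q | yes r | yes s = inj₁ (p , q , r , s)
  ... | no p  | _     | _     | _     = inj₂ (inj₁ (ℕP.≰⇒> p))
  ... | yes _ | no q  | _     | _     = inj₂ (inj₂ (inj₁ (ℕP.≰⇒> q)))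
  ... | yes _ | yes _ | no r  | _     = inj₂ (inj₂ (inj₂ (inj₁ (ℕP.≰⇒> r))))
  ... | yes _ | yes _ | yes _ | no s  = inj₂ (inj₂ (inj₂ (inj₂ (ℕP.≰⇒> s))))

  mono-⊗ : ∀ i j k l i' j' k' l' → mono i j k l ⊗ mono i' j' k' l' ≈ mono (i ℕ.+ i') (j ℕ.+ j') (k ℕ.+ k') (l ℕ.+ l')
  mono-⊗ i j k l i' j' k' l' d a b c with inside-or-Outside i j k l d a b c
  ... | inj₁ (p , q , r , s)
    rewrite mono-in i j k l (mono i' j' k' l') d a b c p q r s
          | ≡ᵇ-∸ i i' d p | ≡ᵇ-∸ j j' a q | ≡ᵇ-∸ k k' b r | ≡ᵇ-∸ l l' c s = refl
  ... | inj₂ o = mono-⊗-outside i j k l i' j' k' l' d a b c o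

  mono-^^ : ∀ i j k l n → mono i j k l ^^ n ≈ mono (n ℕ.* i) (n ℕ.* j) (n ℕ.* k) (n ℕ.* l)
  mono-^^ i j k l zero    = PR.refl
  mono-^^ i j k l (suc n) = PR.trans (⊗-congˡ (mono i j k l) (mono-^^ i j k l n)) (mono-⊗ i j k l (n ℕ.* i) (n ℕ.* j) (n ℕ.* k) (n ℕ.* l))

  private
    mono-cong : ∀ {i j k l i' j' k' l'} → i ≡ i' → j ≡ j' → k ≡ k' → l ≡ l' → mono i j k l ≈ mono i' j' k' l'
    mono-cong refl refl refl refl = PR.refl

  U-^^ : ∀ n → U ^^ n ≈ mono n 0 0 0
  U-^^ n = PR.trans (mono-^^ 1 0 0 0 n) (mono-cong (ℕP.*-identityʳ n) (ℕP.*-zeroʳ n) (ℕP.*-zeroʳ n) (ℕP.*-zeroʳ n))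

  Q-^^ : ∀ n → Q ^^ n ≈ mono 0 0 0 n
  Q-^^ n = PR.trans (mono-^^ 0 0 0 1 n) (mono-cong (ℕP.*-zeroʳ n) (ℕP.*-zeroʳ n) (ℕP.*-zeroʳ n) (ℕP.*-identityʳ n))

  [X⊗Q]-^^ : ∀ n → (X ⊗ Q) ^^ n ≈ mono 0 n 0 n
  [X⊗Q]-^^ n = PR.trans (^^-cong n (mono-⊗ 0 1 0 0 0 0 0 1))
    (PR.trans (mono-^^ 0 1 0 1 n) (mono-cong (ℕP.*-zeroʳ n) (ℕP.*-identityʳ n) (ℕP.*-zeroʳ n) (ℕP.*-identityʳ n)))

  Y⊗[X⊗Q]-^^ : ∀ n → Y ⊗ (X ⊗ Q) ^^ n ≈ mono 0 n 1 n
  Y⊗[X⊗Q]-^^ n = PR.trans (⊗-congˡ Y ([X⊗Q]-^^ n)) (mono-⊗ 0 0 1 0 0 n 0 n)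

  X⊗Y⊗Q-^^ : ∀ n → X ⊗ Y ⊗ Q ^^ n ≈ mono 0 1 1 n
  X⊗Y⊗Q-^^ n = PR.trans (PR.*-cong (mono-⊗ 0 1 0 0 0 0 1 0) (Q-^^ n)) (mono-⊗ 0 1 1 0 0 0 0 n)
module StackCounts where

  open import Defs
  open SeriesRing
  open Truncation
  open Monomials
  open import Data.Nat as ℕ using (ℕ; zero; suc; _∸_; _≤_; _<_; z≤n; s≤s; _≡ᵇ_; _≤ᵇ_)
  import Data.Nat.Properties as ℕP
  open import Data.Integer as ℤ using (ℤ; +_)
  import Data.Integer.Properties as ℤP
  open import Data.Bool using (Bool; true; false; if_then_else_; _∧_)
  open import Data.Sum using (inj₁; inj₂)
  open import Data.Product using (_,_)
  open import Relation.Binary.PropositionalEquality as P using (_≡_; refl; cong; cong₂; trans; sym)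
  open import Relation.Nullary using (Dec; yes; no)
  import Data.Empty
  import Data.Product
  import Relation.Nullary.Decidable

  open Solver using (solve; _:=_; _:+_; _:*_; _:-_; :-_; con)

  when : ∀ {p} {A : Set p} → Dec A → ℕ → ℕ
  when (yes _) n = n
  when (no _) n = 0


  subsetCount : ℕ → ℕ → ℕ → ℕ
  subsetCountStep : ℕ → ℕ → ℕ → ℕ
  subsetCount zero b c = if (b ≡ᵇ 0) ∧ (c ≡ᵇ 0) then 1 else 0
  subsetCount (suc j) b c = subsetCount j b c ℕ.+ subsetCountStep j b c
  subsetCountStep j zero c = 0
  subsetCountStep j (suc b) c = when (suc j ℕP.≤? c) (subsetCount j b (c ∸ suc j))

  subsetSeries : ℕ → PS
  subsetSeries j zero zero b c = + subsetCount j b c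
  subsetSeries j zero (suc a) b c = + 0
  subsetSeries j (suc d) a b c = + 0

  negYQPoch : ℕ → PS
  negYQPoch j = qPoch (⊝ (Y ⊗ Q)) j

  private
    one≗subsetSeries₀ : ∀ b c → one 0 0 b c ≡ + subsetCount 0 b c
    one≗subsetSeries₀ b c with b ≡ᵇ 0 | c ≡ᵇ 0
    ... | true | true = refl
    ... | true | false = refl
    ... | false | _ = refl

  negYQPoch-suc : ∀ j → negYQPoch (suc j) ≈ negYQPoch j ⊕ mono 0 0 1 (suc j) ⊗ negYQPoch j
  negYQPoch-suc j = begin
    negYQPoch j ⊗ (one ⊖ (⊝ (Y ⊗ Q)) ⊗ (Q ^^ j))
      ≈⟨ solve 3 (λ p y q → p :* (con (+ 1) :- (:- y) :* q) := p :+ y :* q :* p) PR.refl (negYQPoch j) (Y ⊗ Q) (Q ^^ j) ⟩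
    negYQPoch j ⊕ (Y ⊗ Q) ⊗ (Q ^^ j) ⊗ negYQPoch j
      ≈⟨ ⊕-congˡ (negYQPoch j) (⊗-congʳ (negYQPoch j) (PR.trans (PR.*-cong (mono-⊗ 0 0 1 0 0 0 0 1) (Q-^^ j)) (mono-⊗ 0 0 1 1 0 0 0 j))) ⟩
    negYQPoch j ⊕ mono 0 0 1 (suc j) ⊗ negYQPoch j ∎
    where open ≈-Reasoning

  negYQPoch≈subsetSeries : ∀ j → negYQPoch j ≈ subsetSeries j
  negYQPoch≈subsetSeries zero zero zero b c = one≗subsetSeries₀ b c
  negYQPoch≈subsetSeries zero zero (suc a) b c = refl
  negYQPoch≈subsetSeries zero (suc d) a b c = refl
  negYQPoch≈subsetSeries (suc j) d a b c = trans (negYQPoch-suc j d a b c) (trans (cong₂ ℤ._+_ (negYQPoch≈subsetSeries j d a b c) (lem d a b c)) (fin d a b c))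
    where
    M = mono 0 0 1 (suc j)
    lem : ∀ d a b c → (M ⊗ negYQPoch j) d a b c ≡ (M ⊗ subsetSeries j) d a b c
    lem = ⊗-congˡ M (negYQPoch≈subsetSeries j)
    fin : ∀ d a b c → subsetSeries j d a b c ℤ.+ (M ⊗ subsetSeries j) d a b c ≡ subsetSeries (suc j) d a b c
    fin d a zero c = trans (cong (λ z → subsetSeries j d a zero c ℤ.+ z) (mono-out 0 0 1 (suc j) (subsetSeries j) d a zero c (inj₂ (inj₂ (inj₁ (s≤s z≤n))))))
                           (trans (ℤP.+-identityʳ _) (z d a c))
      where
      z : ∀ d a c → subsetSeries j d a zero c ≡ subsetSeries (suc j) d a zero c
      z zero zero c = cong +_ (sym (ℕP.+-identityʳ _))
      z zero (suc a) c = refl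
      z (suc d) a c = refl
    fin d a (suc b) c with suc j ℕP.≤? c
    ... | yes p = trans (cong (λ z → subsetSeries j d a (suc b) c ℤ.+ z) (mono-in 0 0 1 (suc j) (subsetSeries j) d a (suc b) c z≤n z≤n (s≤s z≤n) p)) (z d a)
      where
      z : ∀ d a → subsetSeries j d a (suc b) c ℤ.+ subsetSeries j d a b (c ∸ suc j) ≡ subsetSeries (suc j) d a (suc b) c
      z zero zero rewrite Relation.Nullary.Decidable.dec-yes (suc j ℕP.≤? c) p .Data.Product.proj₂ = refl
      z zero (suc a) = refl
      z (suc d) a = refl
    ... | no p = trans (cong (λ z → subsetSeries j d a (suc b) c ℤ.+ z) (mono-out 0 0 1 (suc j) (subsetSeries j) d a (suc b) c (inj₂ (inj₂ (inj₂ (ℕP.≰⇒> p)))))) (z d a)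
      where
      z : ∀ d a → subsetSeries j d a (suc b) c ℤ.+ + 0 ≡ subsetSeries (suc j) d a (suc b) c
      z zero zero rewrite Relation.Nullary.Decidable.dec-no (suc j ℕP.≤? c) p = refl
      z zero (suc a) = refl
      z (suc d) a = refl

  when-0 : ∀ {p} {A : Set p} (d : Dec A) → when d 0 ≡ 0
  when-0 (yes _) = refl
  when-0 (no _)  = refl

  when-no : ∀ {p} {A : Set p} (d : Dec A) n → Relation.Nullary.¬ A → when d n ≡ 0
  when-no (yes a) n ¬a = Data.Empty.⊥-elim (¬a a)
  when-no (no _) n _ = refl


  sumℕ : ℕ → (ℕ → ℕ) → ℕ
  sumℕ zero f = f 0
  sumℕ (suc n) f = sumℕ n f ℕ.+ f (suc n)

  sumℕ-0 : ∀ n {f : ℕ → ℕ} → (∀ m → f m ≡ 0) → sumℕ n f ≡ 0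
  sumℕ-0 zero    h = h 0
  sumℕ-0 (suc n) h = cong₂ ℕ._+_ (sumℕ-0 n h) (h (suc n))

  sumTo-+≡+sumℕ : ∀ n f → sumTo n (λ i → + f i) ≡ + sumℕ n f
  sumTo-+≡+sumℕ zero f = refl
  sumTo-+≡+sumℕ (suc n) f = trans (cong (ℤ._+ + f (suc n)) (sumTo-+≡+sumℕ n f)) (sym (ℤP.pos-+ (sumℕ n f) (f (suc n))))

  subsetCountAt : ℕ → ℕ → ℕ → ℕ → ℕ
  subsetCountAt k zero b c = subsetCount k b c
  subsetCountAt k (suc _) b c = 0

  -- stackCount m a b c counts the stacks by top row width, width, height and area, following the
  -- top-row decomposition: increasingCount for an increasing remainder, extendingCount for a remainder
  -- whose top row has width ≥ m - 1.
  stackCount : ℕ → ℕ → ℕ → ℕ → ℕ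
  increasingCount : ℕ → ℕ → ℕ → ℕ → ℕ
  extendingCount : ℕ → ℕ → ℕ → ℕ → ℕ
  extendingCountAt : ℕ → ℕ → ℕ → ℕ → ℕ → ℕ

  stackCount zero a b c = 0
  stackCount (suc zero) a b c = if (a ≡ᵇ 1) ∧ (b ≡ᵇ 1) ∧ (c ≡ᵇ 1) then 1 else 0
  stackCount (suc (suc k)) a zero c = 0
  stackCount (suc (suc k)) a (suc b) c = increasingCount k a b c ℕ.+ extendingCount k a b c

  increasingCount k a b c = when (suc (suc k) ℕP.≤? a) (when (suc (suc k) ℕP.≤? c) (subsetCountAt k (a ∸ suc (suc k)) b (c ∸ suc (suc k))))
  extendingCount k a b c = when (1 ℕP.≤? a) (when (suc (suc k) ℕP.≤? c)
     (sumℕ (a ∸ 1 ℕ.+ b ℕ.+ (c ∸ suc (suc k))) (extendingCountAt k (a ∸ 1) b (c ∸ suc (suc k)))))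
  extendingCountAt k a b c m = if suc k ≤ᵇ m then stackCount m a b c else 0

  stackSeries : ℕ → PS
  stackSeries m zero a b c = + stackCount m a b c
  stackSeries m (suc d) a b c = + 0

  stackSeriesFrom : ℕ → PS
  stackSeriesFrom j = infSum (λ m → if j ≤ᵇ m then stackSeries m else zeroPS)

  increasingSeries : ℕ → PS
  increasingSeries k = Y ⊗ (X ⊗ Q) ^^ (suc (suc k)) ⊗ negYQPoch k

  stackCount-narrow : ∀ m a b c → a < m → stackCount m a b c ≡ 0
  stackCount-narrow (suc zero) zero b c _ = refl
  stackCount-narrow (suc zero) (suc a) b c (s≤s ())
  stackCount-narrow (suc (suc k)) a zero c _ = refl
  stackCount-narrow (suc (suc k)) a (suc b) c a<m = cong₂ ℕ._+_
    (when-no (suc (suc k) ℕP.≤? a) _ (ℕP.<⇒≱ a<m))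
    (extending-0 (1 ℕP.≤? a))
    where
    extending-0 : (d : Dec (1 ≤ a)) →
      when d (when (suc (suc k) ℕP.≤? c) (sumℕ (a ∸ 1 ℕ.+ b ℕ.+ (c ∸ suc (suc k))) (extendingCountAt k (a ∸ 1) b (c ∸ suc (suc k))))) ≡ 0
    extending-0 (no _)    = refl
    extending-0 (yes 1≤a) = trans (cong (when (suc (suc k) ℕP.≤? c)) (sumℕ-0 (a ∸ 1 ℕ.+ b ℕ.+ (c ∸ suc (suc k))) term-0))
                                  (when-0 (suc (suc k) ℕP.≤? c))
      where
      term-0 : ∀ m → extendingCountAt k (a ∸ 1) b (c ∸ suc (suc k)) m ≡ 0
      term-0 m with suc k ℕ.≤ᵇ m in eq
      ... | false = refl
      ... | true = stackCount-narrow m (a ∸ 1) b (c ∸ suc (suc k))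
            (ℕP.<-≤-trans (ℕP.≤-trans (ℕP.≤-reflexive (ℕP.+-comm 1 (a ∸ 1))) (ℕP.≤-trans (ℕP.≤-reflexive (ℕP.m∸n+n≡m 1≤a)) (ℕP.≤-pred a<m)))
               (ℕP.≤ᵇ⇒≤ (suc k) m (P.subst Data.Bool.T (sym eq) _)))

  Ord-stackSeries : ∀ m → Ord m (stackSeries m)
  Ord-stackSeries m zero a b c l = cong +_ (stackCount-narrow m a b c (ℕP.≤-<-trans (ℕP.≤-trans (ℕP.m≤m+n a b) (ℕP.m≤m+n (a ℕ.+ b) c)) l))
  Ord-stackSeries m (suc d) a b c l = refl

  stackSeries-0 : stackSeries 0 ≈ zeroPS
  stackSeries-0 zero a b c = refl
  stackSeries-0 (suc d) a b c = refl

  stackSeries-1 : stackSeries 1 ≈ X ⊗ Y ⊗ Q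
  stackSeries-1 = PR.sym (PR.trans (⊗-congʳ Q (mono-⊗ 0 1 0 0 0 0 1 0)) (PR.trans (mono-⊗ 0 1 1 0 0 0 0 1) mono≈stackSeries₁))
    where
    mono≈stackSeries₁ : mono 0 1 1 1 ≈ stackSeries 1
    mono≈stackSeries₁ zero a b c with (a ≡ᵇ 1) ∧ (b ≡ᵇ 1) ∧ (c ≡ᵇ 1)
    ... | true  = refl
    ... | false = refl
    mono≈stackSeries₁ (suc d) a b c = refl

  mono-⊗-U-free : ∀ j k l f → (∀ d a b c → f (suc d) a b c ≡ + 0) → ∀ d a b c → (mono 0 j k l ⊗ f) (suc d) a b c ≡ + 0
  mono-⊗-U-free j k l f f-U-free d a b c with inside-or-Outside 0 j k l (suc d) a b c
  ... | inj₁ (_ , p , q , r) = trans (mono-in 0 j k l f (suc d) a b c z≤n p q r) (f-U-free d _ _ _)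
  ... | inj₂ o               = mono-out 0 j k l f (suc d) a b c o

  stackSeriesFrom-U-free : ∀ j d a b c → stackSeriesFrom j (suc d) a b c ≡ + 0
  stackSeriesFrom-U-free j d a b c = sumTo-0 (suc d ℕ.+ a ℕ.+ b ℕ.+ c) _ (λ m _ → z m)
    where
    z : ∀ m → (if j ≤ᵇ m then stackSeries m else zeroPS) (suc d) a b c ≡ + 0
    z m with j ≤ᵇ m
    ... | true = refl
    ... | false = refl

  stackSeriesFrom-coeff : ∀ k a b c → stackSeriesFrom (suc k) 0 a b c ≡ + sumℕ (a ℕ.+ b ℕ.+ c) (extendingCountAt k a b c)
  stackSeriesFrom-coeff k a b c = trans (sumTo-cong≤ (a ℕ.+ b ℕ.+ c) (λ m _ → z m)) (sumTo-+≡+sumℕ (a ℕ.+ b ℕ.+ c) (extendingCountAt k a b c))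
    where
    z : ∀ m → (if suc k ≤ᵇ m then stackSeries m else zeroPS) 0 a b c ≡ + extendingCountAt k a b c m
    z m with suc k ≤ᵇ m
    ... | true = refl
    ... | false = refl

  private
    increasing-coeff : ∀ k a b c →
      (mono 0 (suc (suc k)) 1 (suc (suc k)) ⊗ subsetSeries k) 0 a (suc b) c ≡ + increasingCount k a b c
    increasing-coeff k a b c with suc (suc k) ℕP.≤? a | suc (suc k) ℕP.≤? c
    ... | no p  | _     = mono-out 0 (suc (suc k)) 1 (suc (suc k)) (subsetSeries k) 0 a (suc b) c (inj₂ (inj₁ (ℕP.≰⇒> p)))
    ... | yes p | no q  = mono-out 0 (suc (suc k)) 1 (suc (suc k)) (subsetSeries k) 0 a (suc b) c (inj₂ (inj₂ (inj₂ (ℕP.≰⇒> q))))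
    ... | yes p | yes q = trans (mono-in 0 (suc (suc k)) 1 (suc (suc k)) (subsetSeries k) 0 a (suc b) c z≤n p (s≤s z≤n) q) (at (a ∸ suc (suc k)))
      where
      at : ∀ a' → subsetSeries k 0 a' b (c ∸ suc (suc k)) ≡ + subsetCountAt k a' b (c ∸ suc (suc k))
      at zero    = refl
      at (suc _) = refl

    extending-coeff : ∀ k a b c →
      (mono 0 1 1 (suc (suc k)) ⊗ stackSeriesFrom (suc k)) 0 a (suc b) c ≡ + extendingCount k a b c
    extending-coeff k a b c with 1 ℕP.≤? a | suc (suc k) ℕP.≤? c
    ... | no p  | _     = mono-out 0 1 1 (suc (suc k)) (stackSeriesFrom (suc k)) 0 a (suc b) c (inj₂ (inj₁ (ℕP.≰⇒> p)))
    ... | yes p | no q  = mono-out 0 1 1 (suc (suc k)) (stackSeriesFrom (suc k)) 0 a (suc b) c (inj₂ (inj₂ (inj₂ (ℕP.≰⇒> q))))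
    ... | yes p | yes q = trans (mono-in 0 1 1 (suc (suc k)) (stackSeriesFrom (suc k)) 0 a (suc b) c z≤n p (s≤s z≤n) q)
                                (stackSeriesFrom-coeff k (a ∸ 1) b (c ∸ suc (suc k)))

  stackSeries-suc-suc : ∀ k → stackSeries (suc (suc k)) ≈ increasingSeries k ⊕ X ⊗ Y ⊗ Q ^^ (suc (suc k)) ⊗ stackSeriesFrom (suc k)
  stackSeries-suc-suc k = PR.sym (PR.trans
    (PR.+-cong (PR.*-cong (Y⊗[X⊗Q]-^^ K) (negYQPoch≈subsetSeries k)) (⊗-congʳ (stackSeriesFrom (suc k)) (X⊗Y⊗Q-^^ K)))
    coeffs)
    where
    K = suc (suc k)
    coeffs : mono 0 K 1 K ⊗ subsetSeries k ⊕ mono 0 1 1 K ⊗ stackSeriesFrom (suc k) ≈ stackSeries K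
    coeffs (suc d) a b c = cong₂ ℤ._+_ (mono-⊗-U-free K 1 K (subsetSeries k) (λ _ _ _ _ → refl) d a b c)
                                        (mono-⊗-U-free 1 1 K (stackSeriesFrom (suc k)) (stackSeriesFrom-U-free (suc k)) d a b c)
    coeffs zero a zero c = cong₂ ℤ._+_ (mono-out 0 K 1 K (subsetSeries k) 0 a 0 c (inj₂ (inj₂ (inj₁ (s≤s z≤n)))))
                                      (mono-out 0 1 1 K (stackSeriesFrom (suc k)) 0 a 0 c (inj₂ (inj₂ (inj₁ (s≤s z≤n)))))
    coeffs zero a (suc b) c = trans (cong₂ ℤ._+_ (increasing-coeff k a b c) (extending-coeff k a b c))
                                    (sym (ℤP.pos-+ (increasingCount k a b c) (extendingCount k a b c)))
module FiniteSums where

  open import Defs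
  open SeriesRing
  open Truncation
  open import Data.Nat as ℕ using (ℕ; zero; suc; _∸_; _≤_; _<_; _≤ᵇ_)
  import Data.Nat.Properties as ℕP
  open import Data.Integer as ℤ using (+_)
  open import Data.Bool using (true; false; if_then_else_; T)
  open import Data.Empty using (⊥-elim)
  open import Relation.Binary.PropositionalEquality as P using (refl; cong₂; sym)
  open Solver using (solve; _:=_; _:+_; _:-_; con)
  open ≈-Reasoning

  fsum-cong< : ∀ n {f g : ℕ → PS} → (∀ k → k < n → f k ≈ g k) → fsum n f ≈ fsum n g
  fsum-cong< zero    h = PR.refl
  fsum-cong< (suc n) h = PR.+-cong (fsum-cong< n (λ k k<n → h k (ℕP.m<n⇒m<1+n k<n))) (h n ℕP.≤-refl)

  fsum-cong : ∀ n {f g : ℕ → PS} → (∀ k → f k ≈ g k) → fsum n f ≈ fsum n g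
  fsum-cong n h = fsum-cong< n (λ k _ → h k)

  fsum-cong[] : ∀ {K} n {f g : ℕ → PS} → (∀ k → f k ≈[ K ] g k) → fsum n f ≈[ K ] fsum n g
  fsum-cong[] zero    h d a b c l = refl
  fsum-cong[] (suc n) h d a b c l = cong₂ ℤ._+_ (fsum-cong[] n h d a b c l) (h n d a b c l)

  fsum-⊕ : ∀ n (f g : ℕ → PS) → fsum n (λ k → f k ⊕ g k) ≈ fsum n f ⊕ fsum n g
  fsum-⊕ zero    f g = PR.sym (PR.+-identityˡ zeroPS)
  fsum-⊕ (suc n) f g = begin
    fsum n (λ k → f k ⊕ g k) ⊕ (f n ⊕ g n)  ≈⟨ ⊕-congʳ (f n ⊕ g n) (fsum-⊕ n f g) ⟩
    (fsum n f ⊕ fsum n g) ⊕ (f n ⊕ g n)    ≈⟨ solve 4 (λ a b x y → (a :+ b) :+ (x :+ y) := (a :+ x) :+ (b :+ y)) PR.refl (fsum n f) (fsum n g) (f n) (g n) ⟩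
    (fsum n f ⊕ f n) ⊕ (fsum n g ⊕ g n)    ∎

  fsum-⊖ : ∀ n (f g : ℕ → PS) → fsum n f ⊖ fsum n g ≈ fsum n (λ k → f k ⊖ g k)
  fsum-⊖ zero    f g = solve 0 (con (+ 0) :- con (+ 0) := con (+ 0)) PR.refl
  fsum-⊖ (suc n) f g = begin
    (fsum n f ⊕ f n) ⊖ (fsum n g ⊕ g n)    ≈⟨ solve 4 (λ a b x y → (a :+ x) :- (b :+ y) := (a :- b) :+ (x :- y)) PR.refl (fsum n f) (fsum n g) (f n) (g n) ⟩
    (fsum n f ⊖ fsum n g) ⊕ (f n ⊖ g n)    ≈⟨ ⊕-congʳ (f n ⊖ g n) (fsum-⊖ n f g) ⟩
    fsum n (λ k → f k ⊖ g k) ⊕ (f n ⊖ g n) ∎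

  fsum-⊗ˡ : ∀ n x (f : ℕ → PS) → x ⊗ fsum n f ≈ fsum n (λ k → x ⊗ f k)
  fsum-⊗ˡ zero    x f = PR.zeroʳ x
  fsum-⊗ˡ (suc n) x f = PR.trans (PR.distribˡ x (fsum n f) (f n)) (⊕-congʳ (x ⊗ f n) (fsum-⊗ˡ n x f))

  fsum-⊗ʳ : ∀ n x (f : ℕ → PS) → fsum n f ⊗ x ≈ fsum n (λ k → f k ⊗ x)
  fsum-⊗ʳ zero    x f = PR.zeroˡ x
  fsum-⊗ʳ (suc n) x f = PR.trans (PR.distribʳ x (fsum n f) (f n)) (⊕-congʳ (f n ⊗ x) (fsum-⊗ʳ n x f))

  fsum-peel : ∀ n (f : ℕ → PS) → fsum (suc n) f ≈ f 0 ⊕ fsum n (λ k → f (suc k))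
  fsum-peel zero    f = PR.+-comm zeroPS (f 0)
  fsum-peel (suc n) f = PR.trans (⊕-congʳ (f (suc n)) (fsum-peel n f)) (PR.+-assoc (f 0) _ _)

  fsum-zero : ∀ n → fsum n (λ _ → zeroPS) ≈ zeroPS
  fsum-zero zero    = PR.refl
  fsum-zero (suc n) = PR.trans (PR.+-identityʳ _) (fsum-zero n)

  fsum-swap : ∀ n m (F : ℕ → ℕ → PS) → fsum n (λ i → fsum m (F i)) ≈ fsum m (λ j → fsum n (λ i → F i j))
  fsum-swap zero    m F = PR.sym (fsum-zero m)
  fsum-swap (suc n) m F = begin
    fsum n (λ i → fsum m (F i)) ⊕ fsum m (F n)              ≈⟨ ⊕-congʳ (fsum m (F n)) (fsum-swap n m F) ⟩
    fsum m (λ j → fsum n (λ i → F i j)) ⊕ fsum m (F n)      ≈⟨ PR.sym (fsum-⊕ m _ (F n)) ⟩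
    fsum m (λ j → fsum n (λ i → F i j) ⊕ F n j)             ∎

  fsum-extend : ∀ m N (f : ℕ → PS) → m ≤ N → fsum m f ≈ fsum N (λ i → if suc i ≤ᵇ m then f i else zeroPS)
  fsum-extend m N f m≤N = P.subst (λ n → fsum m f ≈ fsum n g) (ℕP.m∸n+n≡m m≤N) (extend (N ∸ m))
    where
    g : ℕ → PS
    g i = if suc i ≤ᵇ m then f i else zeroPS

    below : ∀ k → k < m → f k ≈ g k
    below k k<m with suc k ≤ᵇ m in eq
    ... | true  = PR.refl
    ... | false = ⊥-elim (P.subst T eq (ℕP.≤⇒≤ᵇ k<m))

    above : ∀ k → m ≤ k → g k ≈ zeroPS
    above k m≤k with suc k ≤ᵇ m in eq
    ... | false = PR.refl
    ... | true  = ⊥-elim (ℕP.<⇒≱ (ℕP.≤ᵇ⇒≤ (suc k) m (P.subst T (sym eq) _)) m≤k)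

    extend : ∀ r → fsum m f ≈ fsum (r ℕ.+ m) g
    extend zero    = fsum-cong< m below
    extend (suc r) = PR.trans (PR.sym (PR.+-identityʳ (fsum m f)))
                       (PR.+-cong (extend r) (PR.sym (above (r ℕ.+ m) (ℕP.m≤n+m m r))))
module FunctionalEquation where

  open import Defs
  open SeriesRing
  open Truncation
  open StackCounts
  open FiniteSums
  open import Data.Nat as ℕ using (ℕ; suc; _≤ᵇ_)
  import Data.Nat.Properties as ℕP
  open import Data.Integer using (+_)
  open import Data.Bool using (true; false; if_then_else_)
  open import Relation.Binary.PropositionalEquality as P using (refl)
  open Solver using (solve; _:=_; _:+_; _:*_; _:-_; con)

  stackGF : PS → PS
  stackGF V = infSum (λ m → stackSeries m ⊗ V ^^ m)

  feFactor : PS → PS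
  feFactor V = X ⊗ Y ⊗ (V ⊗ Q) ^^ 2 ⊗ inv1m (V ⊗ Q)

  stackGF-trunc : ∀ V N → stackGF V ≈[ N ] fsum N (λ m → stackSeries m ⊗ V ^^ m)
  stackGF-trunc V N = infSum-trunc N (λ m → stackSeries m ⊗ V ^^ m) (λ m → Ord-⊗ˡ (V ^^ m) (Ord-stackSeries m)) (λ m N≤m → Ord-weaken N≤m (Ord-⊗ˡ (V ^^ m) (Ord-stackSeries m)))

  stackGF-cong : ∀ {V V'} → V ≈ V' → stackGF V ≈ stackGF V'
  stackGF-cong e = infSum-cong (λ m → ⊗-congˡ (stackSeries m) (^^-cong m e))

  Ord-feFactor : ∀ V → Ord 1 (feFactor V)
  Ord-feFactor V = Ord-⊗ˡ (inv1m (V ⊗ Q)) (Ord-⊗ˡ ((V ⊗ Q) ^^ 2) (Ord-⊗ˡ Y OrdX))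

  module _ (V : PS) (N : ℕ) where
    private
      W = V ⊗ Q
      L = suc (suc N)
      XYQ^^ : ℕ → PS
      XYQ^^ k = X ⊗ Y ⊗ Q ^^ suc (suc k)

      filtered : ℕ → ℕ → PS
      filtered k m = if suc k ≤ᵇ m then stackSeries m else zeroPS

      S≤N : ℕ → PS
      S≤N k = fsum (suc N) (filtered k)

      double : ℕ → ℕ → PS
      double m i = X ⊗ Y ⊗ W ^^ 2 ⊗ stackSeries m ⊗ W ^^ i

      A B C C' D : PS
      A  = V ⊗ X ⊗ Y ⊗ Q
      B  = fsum N (λ k → increasingSeries k ⊗ V ^^ suc (suc k))
      C  = fsum N (λ k → XYQ^^ k ⊗ stackSeriesFrom (suc k) ⊗ V ^^ suc (suc k))
      C' = fsum N (λ k → XYQ^^ k ⊗ S≤N k ⊗ V ^^ suc (suc k))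
      D  = fsum (suc N) (λ m → fsum m (double m))

    stackGF-split : fsum L (λ m → stackSeries m ⊗ V ^^ m) ≈ A ⊕ (B ⊕ C)
    stackGF-split = begin
      fsum L g                                          ≈⟨ PR.trans (fsum-peel (suc N) g) (⊕-congˡ (g 0) (fsum-peel N (λ k → g (suc k)))) ⟩
      g 0 ⊕ (g 1 ⊕ fsum N (λ k → g (suc (suc k))))      ≈⟨ PR.+-cong (⊗-congʳ one stackSeries-0) (PR.+-cong (⊗-congʳ (V ⊗ one) stackSeries-1) rest) ⟩
      zeroPS ⊗ one ⊕ (X ⊗ Y ⊗ Q ⊗ (V ⊗ one) ⊕ (B ⊕ C))  ≈⟨ solve 6 (λ x y q v b c → con (+ 0) :* con (+ 1) :+ (x :* y :* q :* (v :* con (+ 1)) :+ (b :+ c)) := v :* x :* y :* q :+ (b :+ c)) PR.refl X Y Q V B C ⟩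
      A ⊕ (B ⊕ C)                                       ∎
      where
      open ≈-Reasoning
      g : ℕ → PS
      g m = stackSeries m ⊗ V ^^ m
      rest : fsum N (λ k → g (suc (suc k))) ≈ B ⊕ C
      rest = PR.trans (fsum-cong N (λ k → PR.trans (⊗-congʳ (V ^^ suc (suc k)) (stackSeries-suc-suc k))
                                            (PR.distribʳ (V ^^ suc (suc k)) (increasingSeries k) (XYQ^^ k ⊗ stackSeriesFrom (suc k)))))
                      (fsum-⊕ N (λ k → increasingSeries k ⊗ V ^^ suc (suc k)) (λ k → XYQ^^ k ⊗ stackSeriesFrom (suc k) ⊗ V ^^ suc (suc k)))

    C-trunc : C ≈[ L ] C'
    C-trunc = fsum-cong[] N (λ k → ≈[]-⊗ (≈[]-⊗ˡ (XYQ^^ k) (Ord-⊗ˡ (Q ^^ suc (suc k)) (Ord-⊗ˡ Y OrdX)) (S-trunc k))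
                                          (≈⇒≈[] L (PR.refl {V ^^ suc (suc k)})))
      where
      Ord-filtered : ∀ k m → Ord m (filtered k m)
      Ord-filtered k m with suc k ≤ᵇ m
      ... | true  = Ord-stackSeries m
      ... | false = λ _ _ _ _ _ → refl
      S-trunc : ∀ k → stackSeriesFrom (suc k) ≈[ suc N ] S≤N k
      S-trunc k = infSum-trunc (suc N) (filtered k) (Ord-filtered k) (λ m N≤m → Ord-weaken N≤m (Ord-filtered k m))

    C'≈D : C' ≈ D
    C'≈D = begin
      C'                                                                     ≈⟨ fsum-cong N row ⟩
      fsum N (λ k → fsum (suc N) (λ m → if suc k ≤ᵇ m then double m k else zeroPS)) ≈⟨ fsum-swap N (suc N) doubleFiltered ⟩
      fsum (suc N) (λ m → fsum N (λ k → if suc k ≤ᵇ m then double m k else zeroPS)) ≈⟨ fsum-cong< (suc N) (λ m m≤N → PR.sym (fsum-extend m N (double m) (ℕP.≤-pred m≤N))) ⟩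
      D                                                                      ∎
      where
      open ≈-Reasoning
      doubleFiltered : ℕ → ℕ → PS
      doubleFiltered k m = if suc k ≤ᵇ m then double m k else zeroPS
      entry : ∀ k m → XYQ^^ k ⊗ filtered k m ⊗ V ^^ suc (suc k)
                      ≈ doubleFiltered k m
      entry k m with suc k ≤ᵇ m
      ... | false = solve 2 (λ a b → a :* con (+ 0) :* b := con (+ 0)) PR.refl (XYQ^^ k) (V ^^ suc (suc k))
      ... | true  = begin
        X ⊗ Y ⊗ Q ^^ suc (suc k) ⊗ stackSeries m ⊗ V ^^ suc (suc k)   ≈⟨ solve 5 (λ x y q tm v → x :* y :* q :* tm :* v := x :* y :* tm :* (v :* q)) PR.refl X Y (Q ^^ suc (suc k)) (stackSeries m) (V ^^ suc (suc k)) ⟩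
        X ⊗ Y ⊗ stackSeries m ⊗ (V ^^ suc (suc k) ⊗ Q ^^ suc (suc k)) ≈⟨ ⊗-congˡ (X ⊗ Y ⊗ stackSeries m) (PR.trans (PR.sym (^^-distrib-⊗ V Q (suc (suc k)))) (^^-+ W 2 k)) ⟩
        X ⊗ Y ⊗ stackSeries m ⊗ (W ^^ 2 ⊗ W ^^ k)                     ≈⟨ solve 5 (λ x y tm w2 wk → x :* y :* tm :* (w2 :* wk) := x :* y :* w2 :* tm :* wk) PR.refl X Y (stackSeries m) (W ^^ 2) (W ^^ k) ⟩
        double m k                                          ∎
      row : ∀ k → XYQ^^ k ⊗ S≤N k ⊗ V ^^ suc (suc k) ≈ fsum (suc N) (λ m → if suc k ≤ᵇ m then double m k else zeroPS)
      row k = PR.trans (⊗-congʳ (V ^^ suc (suc k)) (fsum-⊗ˡ (suc N) (XYQ^^ k) (filtered k)))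
                (PR.trans (fsum-⊗ʳ (suc N) (V ^^ suc (suc k)) (λ m → XYQ^^ k ⊗ filtered k m)) (fsum-cong (suc N) (entry k)))

    P₁-trunc : P₁ V ≈[ L ] A ⊕ B
    P₁-trunc = ≈[]-trans (≈[]-⊕ (≈⇒≈[] L (PR.refl {A})) (≈[]-⊗ˡ Y (Ord0 Y) tail-trunc))
                         (≈⇒≈[] L (⊕-congˡ A (PR.trans (fsum-⊗ˡ N Y term) (fsum-cong N Y⊗term))))
      where
      term : ℕ → PS
      term j = (V ⊗ X ⊗ Q) ^^ (j ℕ.+ 2) ⊗ qPoch (⊝ (Y ⊗ Q)) j
      Ord-term : ∀ j → Ord (j ℕ.+ 2) (term j)
      Ord-term j = Ord-⊗ˡ (qPoch (⊝ (Y ⊗ Q)) j) (Ord-^^ (j ℕ.+ 2) (Ord-⊗ˡ Q (Ord-⊗ʳ V OrdX)))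
      tail-trunc : infSum term ≈[ L ] fsum N term
      tail-trunc = infSum-trunc N term (λ j → Ord-weaken (ℕP.m≤m+n j 2) (Ord-term j))
                     (λ j N≤j → Ord-weaken (ℕP.≤-trans (ℕP.≤-reflexive (ℕP.+-comm 2 N)) (ℕP.+-monoˡ-≤ 2 N≤j)) (Ord-term j))
      Y⊗term : ∀ j → Y ⊗ term j ≈ increasingSeries j ⊗ V ^^ suc (suc j)
      Y⊗term j = begin
        Y ⊗ ((V ⊗ X ⊗ Q) ^^ (j ℕ.+ 2) ⊗ negYQPoch j)                        ≈⟨ PR.reflexive (P.cong (λ n → Y ⊗ ((V ⊗ X ⊗ Q) ^^ n ⊗ negYQPoch j)) (ℕP.+-comm j 2)) ⟩
        Y ⊗ ((V ⊗ X ⊗ Q) ^^ suc (suc j) ⊗ negYQPoch j)                      ≈⟨ ⊗-congˡ Y (⊗-congʳ (negYQPoch j) (PR.trans (^^-cong (suc (suc j)) (PR.*-assoc V X Q)) (^^-distrib-⊗ V (X ⊗ Q) (suc (suc j))))) ⟩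
        Y ⊗ ((V ^^ suc (suc j) ⊗ (X ⊗ Q) ^^ suc (suc j)) ⊗ negYQPoch j)     ≈⟨ solve 4 (λ y v xq p → y :* ((v :* xq) :* p) := y :* xq :* p :* v) PR.refl Y (V ^^ suc (suc j)) ((X ⊗ Q) ^^ suc (suc j)) (negYQPoch j) ⟩
        increasingSeries j ⊗ V ^^ suc (suc j)                                     ∎
        where open ≈-Reasoning

    feFactor-trunc : feFactor V ⊗ (stackGF one ⊖ stackGF W) ≈[ L ] feFactor V ⊗ (fsum (suc N) (λ m → stackSeries m ⊗ one ^^ m) ⊖ fsum (suc N) (λ m → stackSeries m ⊗ W ^^ m))
    feFactor-trunc = ≈[]-⊗ˡ (feFactor V) (Ord-feFactor V) (≈[]-⊕ (stackGF-trunc one (suc N)) (≈[]-⊝ (stackGF-trunc W (suc N))))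

    feFactor-geometric : feFactor V ⊗ (fsum (suc N) (λ m → stackSeries m ⊗ one ^^ m) ⊖ fsum (suc N) (λ m → stackSeries m ⊗ W ^^ m)) ≈ D
    feFactor-geometric = PR.trans (⊗-congˡ (feFactor V) (fsum-⊖ (suc N) (λ m → stackSeries m ⊗ one ^^ m) (λ m → stackSeries m ⊗ W ^^ m)))
                     (PR.trans (fsum-⊗ˡ (suc N) (feFactor V) (λ m → stackSeries m ⊗ one ^^ m ⊖ stackSeries m ⊗ W ^^ m)) (fsum-cong (suc N) term))
      where
      open ≈-Reasoning
      I = inv1m W
      term : ∀ m → feFactor V ⊗ (stackSeries m ⊗ one ^^ m ⊖ stackSeries m ⊗ W ^^ m) ≈ fsum m (double m)
      term m = begin
        X ⊗ Y ⊗ W ^^ 2 ⊗ I ⊗ (stackSeries m ⊗ one ^^ m ⊖ stackSeries m ⊗ W ^^ m)  ≈⟨ ⊗-congˡ (feFactor V) (⊕-congʳ (⊝ (stackSeries m ⊗ W ^^ m)) (⊗-congˡ (stackSeries m) (one-^^ m))) ⟩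
        X ⊗ Y ⊗ W ^^ 2 ⊗ I ⊗ (stackSeries m ⊗ one ⊖ stackSeries m ⊗ W ^^ m)       ≈⟨ solve 6 (λ x y w2 i tm wm → x :* y :* w2 :* i :* (tm :* con (+ 1) :- tm :* wm) := (x :* y :* w2 :* tm) :* ((con (+ 1) :- wm) :* i)) PR.refl X Y (W ^^ 2) I (stackSeries m) (W ^^ m) ⟩
        (X ⊗ Y ⊗ W ^^ 2 ⊗ stackSeries m) ⊗ ((one ⊖ W ^^ m) ⊗ I)         ≈⟨ ⊗-congˡ (X ⊗ Y ⊗ W ^^ 2 ⊗ stackSeries m) (inv1m-⊗-truncation m (Ord-⊗ʳ V OrdQ)) ⟩
        (X ⊗ Y ⊗ W ^^ 2 ⊗ stackSeries m) ⊗ fsum m (W ^^_)               ≈⟨ fsum-⊗ˡ m (X ⊗ Y ⊗ W ^^ 2 ⊗ stackSeries m) (W ^^_) ⟩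
        fsum m (double m)                                     ∎

    functionalEquation-trunc : stackGF V ≈[ L ] P₁ V ⊕ feFactor V ⊗ (stackGF one ⊖ stackGF W)
    functionalEquation-trunc = begin
      stackGF V                               ≈⟨ stackGF-trunc V L ⟩
      fsum L (λ m → stackSeries m ⊗ V ^^ m)        ≈⟨ ≈⇒≈[] L stackGF-split ⟩
      A ⊕ (B ⊕ C)                        ≈⟨ ≈[]-⊕ (≈⇒≈[] L (PR.refl {A})) (≈[]-⊕ (≈⇒≈[] L (PR.refl {B})) (≈[]-trans C-trunc (≈⇒≈[] L C'≈D))) ⟩
      A ⊕ (B ⊕ D)                        ≈⟨ ≈⇒≈[] L (PR.sym (PR.+-assoc A B D)) ⟩
      A ⊕ B ⊕ D                          ≈⟨ ≈[]-sym (≈[]-⊕ P₁-trunc (≈[]-trans feFactor-trunc (≈⇒≈[] L feFactor-geometric))) ⟩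
      P₁ V ⊕ feFactor V ⊗ (stackGF one ⊖ stackGF W)      ∎
      where open ≈[]-Reasoning L

  functionalEquation : ∀ V → stackGF V ≈ P₁ V ⊕ feFactor V ⊗ (stackGF one ⊖ stackGF (V ⊗ Q))
  functionalEquation V = ≈[]⇒≈ (λ N → ≈[]-weaken (ℕP.m≤n+m N 2) (functionalEquation-trunc V N))
module Iteration where

  open import Defs
  open SeriesRing
  open Truncation
  open Monomials
  open StackCounts
  open FunctionalEquation
  open ExponentIdentities
  open import Data.Nat as ℕ using (ℕ; zero; suc; _∸_; _≤_; z≤n; s≤s)
  import Data.Nat.Properties as ℕP
  open import Data.Integer as ℤ using (ℤ; +_)
  import Data.Integer.Properties as ℤP
  open import Data.Sum using (inj₁; inj₂)
  open import Data.Empty using (⊥-elim)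
  open import Relation.Nullary using (yes; no)
  open import Relation.Binary.PropositionalEquality as P using (_≡_; _≢_; refl; cong; cong₂; trans; sym)
  open Solver using (solve; _:=_; _:+_; _:*_; _:-_; :-_; con)

  sgn : ℕ → PS
  sgn n = minusOne ^^ n

  iterFactor : PS → ℕ → PS
  iterFactor V n = X ^^ n ⊗ Y ^^ n ⊗ V ^^ (2 ℕ.* n) ⊗ Q ^^ (n ℕ.* n ℕ.+ n) ⊗ qPochInv (V ⊗ Q) n

  eT fT : PS → ℕ → PS
  eT V n = (minusOne ^^ n) ⊗ (X ^^ n) ⊗ (Y ^^ n) ⊗ (V ^^ (2 ℕ.* n))
      ⊗ (Q ^^ (n ℕ.* n ℕ.+ n)) ⊗ P₁ (V ⊗ (Q ^^ n)) ⊗ qPochInv (V ⊗ Q) n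
  fT V n = (minusOne ^^ n) ⊗ (X ^^ suc n) ⊗ (Y ^^ suc n) ⊗ (V ^^ (2 ℕ.* n ℕ.+ 2))
      ⊗ (Q ^^ (n ℕ.* n ℕ.+ 3 ℕ.* n ℕ.+ 2)) ⊗ qPochInv (V ⊗ Q) (suc n)

  inv1m-cong : ∀ {W W'} → W ≈ W' → inv1m W ≈ inv1m W'
  inv1m-cong e = infSum-cong (λ j → ^^-cong j e)

  ^^-≡ : ∀ f {m n} → m ≡ n → f ^^ m ≈ f ^^ n
  ^^-≡ f refl = PR.refl

  iterFactor-suc : ∀ V N → iterFactor V (suc N) ≈ iterFactor V N ⊗ feFactor (V ⊗ Q ^^ N)
  iterFactor-suc V N = begin
    X ^^ suc N ⊗ Y ^^ suc N ⊗ V ^^ (2 ℕ.* suc N) ⊗ Q ^^ (suc N ℕ.* suc N ℕ.+ suc N) ⊗ (P ⊗ inv1m ((V ⊗ Q) ⊗ Qᴺ))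
      ≈⟨ PR.*-cong (PR.*-cong (⊗-congˡ (X ^^ suc N ⊗ Y ^^ suc N) V-exponent) Q-exponent) (⊗-congˡ P (inv1m-cong
           (solve 3 (λ v q qn → (v :* q) :* qn := (v :* qn) :* q) PR.refl V Q Qᴺ))) ⟩
    X ^^ suc N ⊗ Y ^^ suc N ⊗ (V ^^ (2 ℕ.* N) ⊗ V ^^ 2) ⊗ (Qᴬ ⊗ (Qᴺ ⊗ (Qᴺ ⊗ Q ^^ 2))) ⊗ (P ⊗ inv1m ((V ⊗ Qᴺ) ⊗ Q))
      ≈⟨ solve 11 (λ x xn y yn v2n v qa qn q p i →
            (x :* xn) :* (y :* yn) :* (v2n :* (v :* (v :* con (+ 1)))) :* (qa :* (qn :* (qn :* (q :* (q :* con (+ 1)))))) :* (p :* i)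
            := (xn :* yn :* v2n :* qa :* p) :* (x :* y :* (((v :* qn) :* q) :* (((v :* qn) :* q) :* con (+ 1))) :* i))
          PR.refl X (X ^^ N) Y (Y ^^ N) (V ^^ (2 ℕ.* N)) V Qᴬ Qᴺ Q P (inv1m ((V ⊗ Qᴺ) ⊗ Q)) ⟩
    iterFactor V N ⊗ feFactor (V ⊗ Qᴺ) ∎
    where
    open ≈-Reasoning
    P  = qPochInv (V ⊗ Q) N
    Qᴺ = Q ^^ N
    Qᴬ = Q ^^ (N ℕ.* N ℕ.+ N)
    V-exponent : V ^^ (2 ℕ.* suc N) ≈ V ^^ (2 ℕ.* N) ⊗ V ^^ 2
    V-exponent = PR.trans (^^-≡ V (2*[1+n]≡2*n+2 N)) (^^-+ V (2 ℕ.* N) 2)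
    Q-exponent : Q ^^ (suc N ℕ.* suc N ℕ.+ suc N) ≈ Qᴬ ⊗ (Qᴺ ⊗ (Qᴺ ⊗ Q ^^ 2))
    Q-exponent = PR.trans (^^-≡ Q ([1+n]²+[1+n]≡[n²+n]+[n+[n+2]] N))
                 (PR.trans (^^-+ Q (N ℕ.* N ℕ.+ N) (N ℕ.+ (N ℕ.+ 2)))
                 (⊗-congˡ Qᴬ (PR.trans (^^-+ Q N (N ℕ.+ 2)) (⊗-congˡ Qᴺ (^^-+ Q N 2)))))

  fT≈sgn⊗iterFactor : ∀ V N → fT V N ≈ sgn N ⊗ iterFactor V (suc N)
  fT≈sgn⊗iterFactor V N = begin
    fT V N
      ≈⟨ ⊗-congʳ (qPochInv (V ⊗ Q) (suc N)) (PR.*-cong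
           (⊗-congˡ (sgn N ⊗ X ^^ suc N ⊗ Y ^^ suc N) (^^-≡ V (sym (2*[1+n]≡2*n+2 N))))
           (^^-≡ Q (n²+3n+2≡[1+n]²+[1+n] N))) ⟩
    sgn N ⊗ X ^^ suc N ⊗ Y ^^ suc N ⊗ V ^^ (2 ℕ.* suc N) ⊗ Q ^^ (suc N ℕ.* suc N ℕ.+ suc N) ⊗ qPochInv (V ⊗ Q) (suc N)
      ≈⟨ solve 6 (λ s x y v q p → s :* x :* y :* v :* q :* p := s :* (x :* y :* v :* q :* p)) PR.refl
           (sgn N) (X ^^ suc N) (Y ^^ suc N) (V ^^ (2 ℕ.* suc N)) (Q ^^ (suc N ℕ.* suc N ℕ.+ suc N)) (qPochInv (V ⊗ Q) (suc N)) ⟩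
    sgn N ⊗ iterFactor V (suc N) ∎
    where open ≈-Reasoning

  eT≈sgn⊗iterFactor⊗P₁ : ∀ V N → eT V N ≈ sgn N ⊗ iterFactor V N ⊗ P₁ (V ⊗ Q ^^ N)
  eT≈sgn⊗iterFactor⊗P₁ V N = solve 7 (λ s x y v q p i → s :* x :* y :* v :* q :* p :* i := s :* (x :* y :* v :* q :* i) :* p) PR.refl
    (sgn N) (X ^^ N) (Y ^^ N) (V ^^ (2 ℕ.* N)) (Q ^^ (N ℕ.* N ℕ.+ N)) (P₁ (V ⊗ Q ^^ N)) (qPochInv (V ⊗ Q) N)

  stackGF₁ : PS
  stackGF₁ = stackGF one

  stackGF-iterate : ∀ V N → stackGF V ≈ fsum N (eT V) ⊕ fsum N (fT V) ⊗ stackGF₁ ⊕ sgn N ⊗ iterFactor V N ⊗ stackGF (V ⊗ Q ^^ N)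
  stackGF-iterate V zero = PR.trans (stackGF-cong (PR.sym (PR.*-identityʳ V)))
    (solve 2 (λ t1 tv → tv := con (+ 0) :+ con (+ 0) :* t1 :+ con (+ 1) :* (con (+ 1) :* con (+ 1) :* con (+ 1) :* con (+ 1) :* con (+ 1)) :* tv)
       PR.refl stackGF₁ (stackGF (V ⊗ one)))
  stackGF-iterate V (suc N) = begin
    stackGF V
      ≈⟨ stackGF-iterate V N ⟩
    Es ⊕ Fs ⊗ stackGF₁ ⊕ s ⊗ K ⊗ stackGF W
      ≈⟨ ⊕-congˡ (Es ⊕ Fs ⊗ stackGF₁) (⊗-congˡ (s ⊗ K) (PR.trans (functionalEquation W)
           (⊕-congˡ (P₁ W) (⊗-congˡ (feFactor W) (⊕-congˡ stackGF₁ (PR.-‿cong (stackGF-cong Wq≈VQᴺ⁺¹))))))) ⟩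
    Es ⊕ Fs ⊗ stackGF₁ ⊕ s ⊗ K ⊗ (P₁ W ⊕ feFactor W ⊗ (stackGF₁ ⊖ T′))
      ≈⟨ solve 8 (λ fe ff t1 s k p c twq → fe :+ ff :* t1 :+ s :* k :* (p :+ c :* (t1 :- twq))
                    := (fe :+ s :* k :* p) :+ (ff :+ s :* (k :* c)) :* t1 :+ (:- con (+ 1) :* s) :* (k :* c) :* twq)
           PR.refl Es Fs stackGF₁ s K (P₁ W) (feFactor W) T′ ⟩
    (Es ⊕ s ⊗ K ⊗ P₁ W) ⊕ (Fs ⊕ s ⊗ (K ⊗ feFactor W)) ⊗ stackGF₁ ⊕ (minusOne ⊗ s) ⊗ (K ⊗ feFactor W) ⊗ T′
      ≈⟨ PR.+-cong (PR.+-cong (⊕-congˡ Es (PR.sym (eT≈sgn⊗iterFactor⊗P₁ V N)))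
                               (⊗-congʳ stackGF₁ (⊕-congˡ Fs (PR.sym (PR.trans (fT≈sgn⊗iterFactor V N) (⊗-congˡ s (iterFactor-suc V N)))))))
                   (⊗-congʳ T′ (⊗-congˡ (minusOne ⊗ s) (PR.sym (iterFactor-suc V N)))) ⟩
    fsum (suc N) (eT V) ⊕ fsum (suc N) (fT V) ⊗ stackGF₁ ⊕ sgn (suc N) ⊗ iterFactor V (suc N) ⊗ T′ ∎
    where
    open ≈-Reasoning
    Es = fsum N (eT V)
    Fs = fsum N (fT V)
    s  = sgn N
    K  = iterFactor V N
    W  = V ⊗ Q ^^ N
    T′ = stackGF (V ⊗ Q ^^ suc N)
    Wq≈VQᴺ⁺¹ : W ⊗ Q ≈ V ⊗ Q ^^ suc N
    Wq≈VQᴺ⁺¹ = solve 3 (λ v qn q → (v :* qn) :* q := v :* (q :* qn)) PR.refl V (Q ^^ N) Q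

  Ord-iterFactor : ∀ V N → Ord N (iterFactor V N)
  Ord-iterFactor V N = Ord-⊗ˡ (qPochInv (V ⊗ Q) N) (Ord-⊗ˡ (Q ^^ (N ℕ.* N ℕ.+ N)) (Ord-⊗ˡ (V ^^ (2 ℕ.* N)) (Ord-⊗ˡ (Y ^^ N) (Ord-^^ N OrdX))))

  Ord-eT : ∀ V n → Ord n (eT V n)
  Ord-eT V n = Ord-⊗ˡ (qPochInv (V ⊗ Q) n) (Ord-⊗ˡ (P₁ (V ⊗ (Q ^^ n))) (Ord-⊗ˡ (Q ^^ (n ℕ.* n ℕ.+ n)) (Ord-⊗ˡ (V ^^ (2 ℕ.* n))
    (Ord-⊗ˡ (Y ^^ n) (Ord-⊗ʳ (minusOne ^^ n) (Ord-^^ n OrdX))))))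

  Ord-fT : ∀ V n → Ord (suc n) (fT V n)
  Ord-fT V n = Ord-⊗ˡ (qPochInv (V ⊗ Q) (suc n)) (Ord-⊗ˡ (Q ^^ (n ℕ.* n ℕ.+ 3 ℕ.* n ℕ.+ 2)) (Ord-⊗ˡ (V ^^ (2 ℕ.* n ℕ.+ 2))
    (Ord-⊗ˡ (Y ^^ suc n) (Ord-⊗ʳ (minusOne ^^ n) (Ord-^^ (suc n) OrdX)))))

  stackGF≈E⊕F⊗stackGF₁ : ∀ V → stackGF V ≈ E V ⊕ F V ⊗ stackGF₁
  stackGF≈E⊕F⊗stackGF₁ V = ≈[]⇒≈ approx
    where
    approx : ∀ N → stackGF V ≈[ N ] E V ⊕ F V ⊗ stackGF₁
    approx N = begin
      stackGF V
        ≈⟨ ≈⇒≈[] N (stackGF-iterate V N) ⟩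
      fsum N (eT V) ⊕ fsum N (fT V) ⊗ stackGF₁ ⊕ sgn N ⊗ iterFactor V N ⊗ stackGF (V ⊗ Q ^^ N)
        ≈⟨ ≈[]-⊕ (≈[]-⊕ (≈[]-sym E-trunc) (≈[]-⊗ (≈[]-sym F-trunc) (≈⇒≈[] N (PR.refl {stackGF₁})))) remainder ⟩
      E V ⊕ F V ⊗ stackGF₁ ⊕ zeroPS
        ≈⟨ ≈⇒≈[] N (PR.+-identityʳ (E V ⊕ F V ⊗ stackGF₁)) ⟩
      E V ⊕ F V ⊗ stackGF₁ ∎
      where
      open ≈[]-Reasoning N
      E-trunc : E V ≈[ N ] fsum N (eT V)
      E-trunc = infSum-trunc N (eT V) (Ord-eT V) (λ n N≤n → Ord-weaken N≤n (Ord-eT V n))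
      F-trunc : F V ≈[ N ] fsum N (fT V)
      F-trunc = infSum-trunc N (fT V) (λ n → Ord-weaken (ℕP.n≤1+n n) (Ord-fT V n))
                  (λ n N≤n → Ord-weaken (ℕP.m≤n⇒m≤1+n N≤n) (Ord-fT V n))
      remainder : sgn N ⊗ iterFactor V N ⊗ stackGF (V ⊗ Q ^^ N) ≈[ N ] zeroPS
      remainder = Ord-⊗ˡ (stackGF (V ⊗ Q ^^ N)) (Ord-⊗ʳ (sgn N) (Ord-iterFactor V N))

  RHS≈stackGF-U : RHS ≈ stackGF U
  RHS≈stackGF-U = begin
    (EU ⊕ E1 ⊗ FU ⊖ EU ⊗ F1) ⊗ I          ≈⟨ solve 5 (λ eu e1 fu f1 i → (eu :+ e1 :* fu :- eu :* f1) :* i := eu :* ((con (+ 1) :- f1) :* i) :+ fu :* (e1 :* i)) PR.refl EU E1 FU F1 I ⟩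
    EU ⊗ ((one ⊖ F1) ⊗ I) ⊕ FU ⊗ (E1 ⊗ I) ≈⟨ PR.+-cong (⊗-congˡ EU inverse) (⊗-congˡ FU (PR.sym T1≈E1⊗I)) ⟩
    EU ⊗ one ⊕ FU ⊗ stackGF₁                    ≈⟨ ⊕-congʳ (FU ⊗ stackGF₁) (PR.*-identityʳ EU) ⟩
    EU ⊕ FU ⊗ stackGF₁                          ≈⟨ PR.sym (stackGF≈E⊕F⊗stackGF₁ U) ⟩
    stackGF U                                  ∎
    where
    open ≈-Reasoning
    EU = E U
    E1 = E one
    FU = F U
    F1 = F one
    I = inv1m F1
    inverse : (one ⊖ F1) ⊗ I ≈ one
    inverse = inv1m-inverse (Ord-infSum (fT one) (λ n → Ord-weaken (s≤s z≤n) (Ord-fT one n)))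
    T1≈E1⊗I : stackGF₁ ≈ E1 ⊗ I
    T1≈E1⊗I = begin
      stackGF₁                        ≈⟨ PR.sym (PR.*-identityʳ stackGF₁) ⟩
      stackGF₁ ⊗ one                  ≈⟨ ⊗-congˡ stackGF₁ (PR.sym inverse) ⟩
      stackGF₁ ⊗ ((one ⊖ F1) ⊗ I)     ≈⟨ solve 3 (λ stackSeries f i → stackSeries :* ((con (+ 1) :- f) :* i) := (stackSeries :- f :* stackSeries) :* i) PR.refl stackGF₁ F1 I ⟩
      (stackGF₁ ⊖ F1 ⊗ stackGF₁) ⊗ I        ≈⟨ ⊗-congʳ I (⊕-congʳ (⊝ (F1 ⊗ stackGF₁)) (stackGF≈E⊕F⊗stackGF₁ one)) ⟩
      (E1 ⊕ F1 ⊗ stackGF₁ ⊖ F1 ⊗ stackGF₁) ⊗ I ≈⟨ ⊗-congʳ I (solve 2 (λ e ft → e :+ ft :- ft := e) PR.refl E1 (F1 ⊗ stackGF₁)) ⟩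
      E1 ⊗ I                    ∎

  sumTo-single : ∀ D d (G : ℕ → ℤ) → d ≤ D → (∀ m → m ≢ d → G m ≡ + 0) → sumTo D G ≡ G d
  sumTo-single zero    zero G z≤n h = refl
  sumTo-single (suc D) d G d≤ h with ℕP.m≤n⇒m<n∨m≡n d≤
  ... | inj₁ (s≤s d≤D) = trans (cong₂ ℤ._+_ (sumTo-single D d G d≤D h) (h (suc D) (λ e → ℕP.<⇒≢ (s≤s d≤D) (sym e)))) (ℤP.+-identityʳ _)
  ... | inj₂ refl      = trans (cong₂ ℤ._+_ (sumTo-0 D G (λ m m≤D → h m (λ e → ℕP.<⇒≢ (s≤s m≤D) e))) refl) (ℤP.+-identityˡ _)

  stackGF-U-coeff : ∀ d a b c → stackGF U d a b c ≡ + stackCount d a b c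
  stackGF-U-coeff d a b c = trans (sumTo-single (d ℕ.+ a ℕ.+ b ℕ.+ c) d G d≤D off) on
    where
    d≤D : d ≤ d ℕ.+ a ℕ.+ b ℕ.+ c
    d≤D = ℕP.≤-trans (ℕP.m≤m+n d a) (ℕP.≤-trans (ℕP.m≤m+n (d ℕ.+ a) b) (ℕP.m≤m+n (d ℕ.+ a ℕ.+ b) c))
    G : ℕ → ℤ
    G m = (stackSeries m ⊗ U ^^ m) d a b c
    shifted : ∀ m → G m ≡ (mono m 0 0 0 ⊗ stackSeries m) d a b c
    shifted m = PR.trans (⊗-congˡ (stackSeries m) (U-^^ m)) (PR.*-comm (stackSeries m) (mono m 0 0 0)) d a b c
    on : G d ≡ + stackCount d a b c
    on = trans (shifted d) (trans (mono-in d 0 0 0 (stackSeries d) d a b c ℕP.≤-refl z≤n z≤n z≤n) (cong (λ k → stackSeries d k a b c) (ℕP.n∸n≡0 d)))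
    off : ∀ m → m ≢ d → G m ≡ + 0
    off m m≢d with m ℕP.≤? d
    ... | no m≰d = trans (shifted m) (mono-out m 0 0 0 (stackSeries m) d a b c (inj₁ (ℕP.≰⇒> m≰d)))
    ... | yes m≤d = trans (shifted m) (trans (mono-in m 0 0 0 (stackSeries m) d a b c m≤d z≤n z≤n z≤n) (U-free (d ∸ m) refl))
      where
      U-free : ∀ k → k ≡ d ∸ m → stackSeries m k a b c ≡ + 0
      U-free zero    e = ⊥-elim (m≢d (ℕP.≤-antisym m≤d (ℕP.m∸n≡0⇒m≤n (sym e))))
      U-free (suc k) e = refl
module StackRows where

  open import Defs
  open import Data.Nat as ℕ using (ℕ; zero; suc; _∸_; z≤n; s≤s)
  import Data.Nat.Properties as ℕP
  open import Data.Integer as ℤ using (ℤ; +_; _⊔_; _⊓_)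
  import Data.Integer.Properties as ℤP
  open import Data.Product using (Σ; _×_; _,_; proj₁; proj₂)
  open import Data.Sum using (_⊎_; inj₁; inj₂)
  open import Data.List using (List; []; _∷_; _++_; _∷ʳ_; length; take; drop; foldr; map; [_])
  import Data.List.Properties as LP
  open import Data.List.Relation.Unary.Linked using (Linked; []; [-]; _∷_)
  open import Data.List.Relation.Unary.All using (All; []; _∷_)
  import Data.List.Relation.Unary.All.Properties as AllP
  open import Relation.Binary.PropositionalEquality as P using (_≡_; refl; cong; cong₂; trans; sym)

  lastRow : Row → List Row → Row
  lastRow r [] = r
  lastRow r (r' ∷ rs) = lastRow r' rs

  Linked-snoc⁺ : ∀ {ℓ} {R : Row → Row → Set ℓ} r rs y → Linked R (r ∷ rs) → R (lastRow r rs) y → Linked R (r ∷ (rs ∷ʳ y))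
  Linked-snoc⁺ r [] y [-] p = p ∷ [-]
  Linked-snoc⁺ r (r' ∷ rs) y (q ∷ l) p = q ∷ Linked-snoc⁺ r' rs y l p

  Linked-snoc⁻ : ∀ {ℓ} {R : Row → Row → Set ℓ} r rs y → Linked R (r ∷ (rs ∷ʳ y)) → Linked R (r ∷ rs) × R (lastRow r rs) y
  Linked-snoc⁻ r [] y (p ∷ [-]) = [-] , p
  Linked-snoc⁻ r (r' ∷ rs) y (q ∷ l) with Linked-snoc⁻ r' rs y l
  ... | l' , p = q ∷ l' , p

  take-++ˡ : ∀ n (xs ys : List Row) → n ℕ.≤ length xs → take n (xs ++ ys) ≡ take n xs
  take-++ˡ zero xs ys _ = refl
  take-++ˡ (suc n) (x ∷ xs) ys (s≤s p) = cong (x ∷_) (take-++ˡ n xs ys p)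

  drop-++ˡ : ∀ n (xs ys : List Row) → n ℕ.≤ length xs → drop n (xs ++ ys) ≡ drop n xs ++ ys
  drop-++ˡ zero xs ys _ = refl
  drop-++ˡ (suc n) (x ∷ xs) ys (s≤s p) = drop-++ˡ n xs ys p

  drop-ne : ∀ k r rs → k ℕ.< length (r ∷ rs) → Σ Row λ r' → Σ (List Row) λ rs' → (drop k (r ∷ rs) ≡ r' ∷ rs') × (lastRow r' rs' ≡ lastRow r rs)
  drop-ne zero r rs _ = r , rs , refl , refl
  drop-ne (suc k) r (r' ∷ rs) (s≤s p) = drop-ne k r' rs p

  Unimodal : List Row → Set
  Unimodal l = Σ ℕ (λ s → (1 ℕ.≤ s) × (s ℕ.≤ length l)
         × Linked (λ r r′ → right r ℤ.≤ right r′) (take s l)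
         × Linked (λ r r′ → right r′ ℤ.≤ right r) (drop (s ℕ.∸ 1) l))

  Increasing : List Row → Set
  Increasing l = Linked (λ r r′ → right r ℤ.≤ right r′) l

  length-snoc : ∀ (xs : List Row) y → length (xs ∷ʳ y) ≡ suc (length xs)
  length-snoc [] y = refl
  length-snoc (x ∷ xs) y = cong suc (length-snoc xs y)

  Unimodal-[-] : ∀ y → Unimodal [ y ]
  Unimodal-[-] y = 1 , s≤s z≤n , s≤s z≤n , [-] , [-]

  Unimodal-snoc⁺ : ∀ r rs y → Unimodal (r ∷ rs) → (right y ℤ.≤ right (lastRow r rs) ⊎ (Increasing (r ∷ rs) × right (lastRow r rs) ℤ.≤ right y)) → Unimodal (r ∷ (rs ∷ʳ y))
  Unimodal-snoc⁺ r rs y (s , 1≤s , s≤l , up , down) (inj₁ y≤) =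
    s , 1≤s , ℕP.≤-trans s≤l (ℕP.≤-trans (ℕP.n≤1+n _) (ℕP.≤-reflexive (sym (length-snoc (r ∷ rs) y)))) ,
    P.subst (Linked _) (sym (take-++ˡ s (r ∷ rs) [ y ] s≤l)) up ,
    P.subst (Linked _) (sym (drop-++ˡ (s ∸ 1) (r ∷ rs) [ y ] (ℕP.≤-trans (ℕP.m∸n≤m s 1) s≤l))) down'
    where
    down' : Linked (λ r r′ → right r′ ℤ.≤ right r) (drop (s ∸ 1) (r ∷ rs) ++ [ y ])
    down' with drop-ne (s ∸ 1) r rs (ℕP.<-≤-trans (ℕP.∸-monoˡ-< ℕP.≤-refl 1≤s) s≤l)
    ... | r' , rs' , e , el = P.subst (λ z → Linked (λ r r′ → right r′ ℤ.≤ right r) (z ++ [ y ])) (sym e)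
            (Linked-snoc⁺ r' rs' y (P.subst (Linked (λ r r′ → right r′ ℤ.≤ right r)) e down) (P.subst (λ z → right y ℤ.≤ right z) (sym el) y≤))
  Unimodal-snoc⁺ r rs y (s , 1≤s , s≤l , up , down) (inj₂ (inc , ≤y)) =
    suc (length (r ∷ rs)) , s≤s z≤n , ℕP.≤-reflexive (sym (length-snoc (r ∷ rs) y)) ,
    P.subst (Linked _) (sym (LP.take-all (suc (length (r ∷ rs))) (r ∷ (rs ∷ʳ y)) (ℕP.≤-reflexive (length-snoc (r ∷ rs) y))))
       (Linked-snoc⁺ r rs y inc ≤y) ,
    P.subst (Linked _) (sym (trans (drop-++ˡ (length (r ∷ rs)) (r ∷ rs) [ y ] ℕP.≤-refl)
       (cong (_++ [ y ]) (LP.drop-all (length (r ∷ rs)) (r ∷ rs) ℕP.≤-refl)))) [-]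

  Linked-len1 : ∀ {ℓ} {R : Row → Row → Set ℓ} (l : List Row) → length l ≡ 1 → Linked R l
  Linked-len1 (x ∷ []) _ = [-]

  Unimodal-snoc⁻ : ∀ r rs y → Unimodal (r ∷ (rs ∷ʳ y)) → Unimodal (r ∷ rs) × (right y ℤ.≤ right (lastRow r rs) ⊎ Increasing (r ∷ rs))
  Unimodal-snoc⁻ r rs y (s , 1≤s , s≤l , up , down) with ℕP.m≤n⇒m<n∨m≡n (ℕP.≤-trans s≤l (ℕP.≤-reflexive (length-snoc (r ∷ rs) y)))
  ... | inj₁ (s≤s s≤len) =
    (s , 1≤s , s≤len , P.subst (Linked _) (take-++ˡ s (r ∷ rs) [ y ] s≤len) up , proj₁ dd) , inj₁ (proj₂ dd)
    where
    dd : Linked (λ r r′ → right r′ ℤ.≤ right r) (drop (s ∸ 1) (r ∷ rs)) × (right y ℤ.≤ right (lastRow r rs))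
    dd with drop-ne (s ∸ 1) r rs (ℕP.<-≤-trans (ℕP.∸-monoˡ-< ℕP.≤-refl 1≤s) s≤len)
    ... | r' , rs' , e , el with Linked-snoc⁻ r' rs' y (P.subst (Linked (λ r r′ → right r′ ℤ.≤ right r)) (trans (drop-++ˡ (s ∸ 1) (r ∷ rs) [ y ] (ℕP.≤-trans (ℕP.m∸n≤m s 1) s≤len)) (cong (_++ [ y ]) e)) down)
    ... | l' , p = P.subst (Linked (λ r r′ → right r′ ℤ.≤ right r)) (sym e) l' , P.subst (λ z → right y ℤ.≤ right z) el p
  ... | inj₂ refl =
    (length (r ∷ rs) , s≤s z≤n , ℕP.≤-refl , P.subst (Linked _) (sym (LP.take-all _ (r ∷ rs) ℕP.≤-refl)) inc ,
       Linked-len1 _ (trans (LP.length-drop (length rs) (r ∷ rs)) (ℕP.m+n∸n≡m 1 (length rs)))) , inj₂ inc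
    where
    inc : Increasing (r ∷ rs)
    inc = proj₁ (Linked-snoc⁻ r rs y (P.subst (Linked _) (LP.take-all _ (r ∷ (rs ∷ʳ y)) (ℕP.≤-reflexive (length-snoc (r ∷ rs) y))) up))

  IsShiftedStack-snoc⁺ : ∀ r rs y → IsShiftedStack (r ∷ rs) → left y ≡ left (lastRow r rs) ℤ.- + 1 → left (lastRow r rs) ℤ.≤ right y →
    (right y ℤ.≤ right (lastRow r rs) ⊎ (Increasing (r ∷ rs) × right (lastRow r rs) ℤ.≤ right y)) → IsShiftedStack (r ∷ (rs ∷ʳ y))
  IsShiftedStack-snoc⁺ r rs y ((b₁ , rest , e) , all , lk , uni) ly L≤ry cond =
    (b₁ , rest ∷ʳ y , cong (_∷ʳ y) e) ,
    AllP.++⁺ all (ℤP.≤-trans (ℤP.≤-trans (ℤP.≤-reflexive ly) (ℤP.i-j≤i (left (lastRow r rs)) (+ 1))) L≤ry ∷ []) ,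
    Linked-snoc⁺ r rs y lk (ly , L≤ry) ,
    Unimodal-snoc⁺ r rs y uni cond

  IsShiftedStack-snoc⁻ : ∀ r rs y → IsShiftedStack (r ∷ (rs ∷ʳ y)) →
    IsShiftedStack (r ∷ rs) × (left y ≡ left (lastRow r rs) ℤ.- + 1) × (left (lastRow r rs) ℤ.≤ right y) ×
    (right y ℤ.≤ right (lastRow r rs) ⊎ Increasing (r ∷ rs))
  IsShiftedStack-snoc⁻ r rs y ((b₁ , rest , e) , all , lk , uni) =
    ((b₁ , rs , cong (_∷ rs) (LP.∷-injectiveˡ e)) , AllP.++⁻ˡ (r ∷ rs) all , proj₁ lk' , proj₁ un) ,
    proj₁ (proj₂ lk') , proj₂ (proj₂ lk') , proj₂ un
    where
    lk' = Linked-snoc⁻ r rs y lk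
    un = Unimodal-snoc⁻ r rs y uni

  IsShiftedStack-[-]⁺ : ∀ b → + 0 ℤ.≤ b → IsShiftedStack [ (+ 0 , b) ]
  IsShiftedStack-[-]⁺ b p = (b , [] , refl) , p ∷ [] , [-] , Unimodal-[-] _

  IsShiftedStack-[-]⁻ : ∀ y → IsShiftedStack [ y ] → (left y ≡ + 0) × (+ 0 ℤ.≤ right y)
  IsShiftedStack-[-]⁻ y ((b₁ , rest , e) , (p ∷ []) , _) with LP.∷-injectiveˡ e
  ... | refl = refl , p


  area-snoc : ∀ xs y → area (xs ∷ʳ y) ≡ area xs ℤ.+ rowWidth y
  area-snoc [] y = trans (ℤP.+-identityʳ (rowWidth y)) (sym (ℤP.+-identityˡ (rowWidth y)))
  area-snoc (x ∷ xs) y = trans (cong (λ z → rowWidth x ℤ.+ z) (area-snoc xs y)) (sym (ℤP.+-assoc (rowWidth x) (area xs) (rowWidth y)))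

  top-snoc : ∀ xs y → topRowWidth (xs ∷ʳ y) ≡ rowWidth y
  top-snoc [] y = refl
  top-snoc (x ∷ []) y = refl
  top-snoc (x ∷ x' ∷ xs) y = top-snoc (x' ∷ xs) y

  top-last : ∀ r rs → topRowWidth (r ∷ rs) ≡ rowWidth (lastRow r rs)
  top-last r [] = refl
  top-last r (r' ∷ rs) = top-last r' rs

  maxR minL : Row → List Row → ℤ
  maxR r rs = foldr _⊔_ (right r) (map right rs)
  minL r rs = foldr _⊓_ (left r) (map left rs)

  foldr-⊔-seed : ∀ u z l → foldr _⊔_ (u ⊔ z) l ≡ u ⊔ foldr _⊔_ z l
  foldr-⊔-seed u z [] = refl
  foldr-⊔-seed u z (v ∷ l) = trans (cong (v ⊔_) (foldr-⊔-seed u z l))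
    (trans (sym (ℤP.⊔-assoc v u _)) (trans (cong (_⊔ foldr _⊔_ z l) (ℤP.⊔-comm v u)) (ℤP.⊔-assoc u v _)))

  foldr-⊓-seed : ∀ u z l → foldr _⊓_ (u ⊓ z) l ≡ u ⊓ foldr _⊓_ z l
  foldr-⊓-seed u z [] = refl
  foldr-⊓-seed u z (v ∷ l) = trans (cong (v ⊓_) (foldr-⊓-seed u z l))
    (trans (sym (ℤP.⊓-assoc v u _)) (trans (cong (_⊓ foldr _⊓_ z l) (ℤP.⊓-comm v u)) (ℤP.⊓-assoc u v _)))

  maxR-snoc : ∀ r rs y → maxR r (rs ∷ʳ y) ≡ right y ⊔ maxR r rs
  maxR-snoc r rs y = trans (cong (foldr _⊔_ (right r)) (LP.map-++ right rs [ y ]))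
    (trans (LP.foldr-++ _⊔_ (right r) (map right rs) [ right y ]) (foldr-⊔-seed (right y) (right r) (map right rs)))

  minL-snoc : ∀ r rs y → minL r (rs ∷ʳ y) ≡ left y ⊓ minL r rs
  minL-snoc r rs y = trans (cong (foldr _⊓_ (left r)) (LP.map-++ left rs [ y ]))
    (trans (LP.foldr-++ _⊓_ (left r) (map left rs) [ left y ]) (foldr-⊓-seed (left y) (left r) (map left rs)))

  foldr-⊔-≥ : ∀ z l → z ℤ.≤ foldr _⊔_ z l
  foldr-⊔-≥ z [] = ℤP.≤-refl
  foldr-⊔-≥ z (v ∷ l) = ℤP.≤-trans (foldr-⊔-≥ z l) (ℤP.i≤j⊔i v _)

  foldr-⊓-≤ : ∀ z l → foldr _⊓_ z l ℤ.≤ z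
  foldr-⊓-≤ z [] = ℤP.≤-refl
  foldr-⊓-≤ z (v ∷ l) = ℤP.≤-trans (ℤP.i⊓j≤j v _) (foldr-⊓-≤ z l)

  ShiftedStep : Row → Row → Set
  ShiftedStep r r′ = (left r′ ≡ left r ℤ.- + 1) × (left r ℤ.≤ right r′)

  private
    minL-from : ∀ r rs z → Linked ShiftedStep (r ∷ rs) → left r ℤ.≤ z → left r ⊓ foldr _⊓_ z (map left rs) ≡ left (lastRow r rs)
    minL-from r [] z _ p = ℤP.i≤j⇒i⊓j≡i p
    minL-from r (r' ∷ rs) z ((e , _) ∷ lk) p =
      trans (sym (ℤP.⊓-assoc (left r) (left r') _))
        (trans (cong (_⊓ foldr _⊓_ z (map left rs)) (ℤP.i≥j⇒i⊓j≡j lr'≤lr))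
          (minL-from r' rs z lk (ℤP.≤-trans lr'≤lr p)))
      where
      lr'≤lr : left r' ℤ.≤ left r
      lr'≤lr = ℤP.≤-trans (ℤP.≤-reflexive e) (ℤP.i-j≤i (left r) (+ 1))

  minL-stack : ∀ r rs → Linked ShiftedStep (r ∷ rs) → minL r rs ≡ left (lastRow r rs)
  minL-stack r rs lk = trans (sym (ℤP.i≥j⇒i⊓j≡j (foldr-⊓-≤ (left r) (map left rs)))) (minL-from r rs (left r) lk ℤP.≤-refl)

  private
    maxR-≥last-from : ∀ r rs z → right (lastRow r rs) ℤ.≤ right r ⊔ foldr _⊔_ z (map right rs)
    maxR-≥last-from r [] z = ℤP.i≤i⊔j (right r) z
    maxR-≥last-from r (r' ∷ rs) z = ℤP.≤-trans (maxR-≥last-from r' rs z) (ℤP.i≤j⊔i (right r) _)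

    maxR-from-increasing : ∀ r rs z → Increasing (r ∷ rs) → z ℤ.≤ right r → right r ⊔ foldr _⊔_ z (map right rs) ≡ right (lastRow r rs)
    maxR-from-increasing r [] z _ p = ℤP.i≥j⇒i⊔j≡i p
    maxR-from-increasing r (r' ∷ rs) z (q ∷ inc) p =
      trans (sym (ℤP.⊔-assoc (right r) (right r') _))
        (trans (cong (_⊔ foldr _⊔_ z (map right rs)) (ℤP.i≤j⇒i⊔j≡j q))
          (maxR-from-increasing r' rs z inc (ℤP.≤-trans p q)))

  maxR-≥last : ∀ r rs → right (lastRow r rs) ℤ.≤ maxR r rs
  maxR-≥last r rs = ℤP.≤-trans (maxR-≥last-from r rs (right r)) (ℤP.≤-reflexive (ℤP.i≤j⇒i⊔j≡j (foldr-⊔-≥ (right r) (map right rs))))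

  maxR-inc : ∀ r rs → Increasing (r ∷ rs) → maxR r rs ≡ right (lastRow r rs)
  maxR-inc r rs inc = trans (sym (ℤP.i≤j⇒i⊔j≡j (foldr-⊔-≥ (right r) (map right rs)))) (maxR-from-increasing r rs (right r) inc ℤP.≤-refl)


  open import Data.Integer.Solver using (module +-*-Solver)
  open +-*-Solver using (solve; _:+_; _:-_; :-_; _:=_; con)

  lastLeft : List Row → ℤ
  lastLeft [] = + 1
  lastLeft (r ∷ rs) = left (lastRow r rs)

  topRow : ℕ → List Row → Row
  topRow k xs = (lastLeft xs ℤ.- + 1 , (lastLeft xs ℤ.- + 1) ℤ.+ + (k ∸ 1))

  addTopRow : ℕ → List Row → List Row
  addTopRow k xs = xs ∷ʳ topRow k xs

  +-monoʳ-≤-ℕ : ∀ X {p q} → p ℕ.≤ q → X ℤ.+ + p ℤ.≤ X ℤ.+ + q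
  +-monoʳ-≤-ℕ X p≤q = ℤP.+-monoʳ-≤ X (ℤ.+≤+ p≤q)

  +-cancelˡ-≤-ℕ : ∀ X {p q} → X ℤ.+ + p ℤ.≤ X ℤ.+ + q → p ℕ.≤ q
  +-cancelˡ-≤-ℕ X {p} {q} h = ℤP.drop‿+≤+ (P.subst₂ ℤ._≤_ (e p) (e q) (ℤP.+-monoʳ-≤ (ℤ.- X) h))
    where
    e : ∀ n → ℤ.- X ℤ.+ (X ℤ.+ + n) ≡ + n
    e n = solve 2 (λ x m → :- x :+ (x :+ m) := m) refl X (+ n)

  rowWidth-topRow : ∀ k' xs → rowWidth (topRow (suc k') xs) ≡ + suc k'
  rowWidth-topRow k' xs = trans (solve 2 (λ x m → (x :+ m) :- x :+ con (+ 1) := m :+ con (+ 1)) refl (lastLeft xs ℤ.- + 1) (+ k'))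
    (cong +_ (ℕP.+-comm k' 1))

  right-from-width : ∀ (r : Row) m → rowWidth r ≡ + m → right r ≡ (left r ℤ.- + 1) ℤ.+ + m
  right-from-width r m e = trans (solve 2 (λ R L → R := (L :- con (+ 1)) :+ (R :- L :+ con (+ 1))) refl (right r) (left r))
    (cong (λ z → (left r ℤ.- + 1) ℤ.+ z) e)

  module _ (r : Row) (rs : List Row) (k' m : ℕ) (rwm : rowWidth (lastRow r rs) ≡ + m) where
    private
      L = left (lastRow r rs)
      X₀ = L ℤ.- + 1
      y = topRow (suc k') (r ∷ rs)
      rl : right (lastRow r rs) ≡ X₀ ℤ.+ + m
      rl = right-from-width (lastRow r rs) m rwm
      LX : L ≡ X₀ ℤ.+ + 1
      LX = solve 1 (λ L → L := (L :- con (+ 1)) :+ con (+ 1)) refl L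

    ext-cond⁺₁ : k' ℕ.≤ m → right y ℤ.≤ right (lastRow r rs)
    ext-cond⁺₁ p = ℤP.≤-trans (+-monoʳ-≤-ℕ X₀ p) (ℤP.≤-reflexive (sym rl))

    ext-cond⁺₂ : m ℕ.≤ k' → right (lastRow r rs) ℤ.≤ right y
    ext-cond⁺₂ p = ℤP.≤-trans (ℤP.≤-reflexive rl) (+-monoʳ-≤-ℕ X₀ p)

    ext-condL : 1 ℕ.≤ k' → L ℤ.≤ right y
    ext-condL p = ℤP.≤-trans (ℤP.≤-reflexive LX) (+-monoʳ-≤-ℕ X₀ p)

    ext-cond⁻₁ : right y ℤ.≤ right (lastRow r rs) → k' ℕ.≤ m
    ext-cond⁻₁ h = +-cancelˡ-≤-ℕ X₀ (ℤP.≤-trans h (ℤP.≤-reflexive rl))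

    ext-cond⁻₂ : right (lastRow r rs) ℤ.≤ right y → m ℕ.≤ k'
    ext-cond⁻₂ h = +-cancelˡ-≤-ℕ X₀ (ℤP.≤-trans (ℤP.≤-reflexive (sym rl)) h)

    addTopRow-IsShiftedStack : IsShiftedStack (r ∷ rs) → 1 ℕ.≤ k' → (k' ℕ.≤ m ⊎ (Increasing (r ∷ rs) × m ℕ.≤ k')) → IsShiftedStack (addTopRow (suc k') (r ∷ rs))
    addTopRow-IsShiftedStack ss p (inj₁ q) = IsShiftedStack-snoc⁺ r rs y ss refl (ext-condL p) (inj₁ (ext-cond⁺₁ q))
    addTopRow-IsShiftedStack ss p (inj₂ (inc , q)) = IsShiftedStack-snoc⁺ r rs y ss refl (ext-condL p) (inj₂ (inc , ext-cond⁺₂ q))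

    addTopRow-Increasing : Increasing (r ∷ rs) → m ℕ.≤ k' → Increasing (addTopRow (suc k') (r ∷ rs))
    addTopRow-Increasing inc p = Linked-snoc⁺ r rs y inc (ext-cond⁺₂ p)

    addTopRow-width-extending : Linked ShiftedStep (r ∷ rs) → k' ℕ.≤ m → width (addTopRow (suc k') (r ∷ rs)) ≡ width (r ∷ rs) ℤ.+ + 1
    addTopRow-width-extending lk p = trans (cong₂ (λ u v → u ℤ.- v ℤ.+ + 1) (maxR-snoc r rs y) (minL-snoc r rs y))
      (trans (cong₂ (λ u v → u ℤ.- v ℤ.+ + 1) (ℤP.i≤j⇒i⊔j≡j (ℤP.≤-trans (ext-cond⁺₁ p) (maxR-≥last r rs)))
                                               (trans (cong (X₀ ⊓_) (minL-stack r rs lk)) (ℤP.i≤j⇒i⊓j≡i (ℤP.i-j≤i L (+ 1)))))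
        (trans (solve 2 (λ M L → M :- (L :- con (+ 1)) :+ con (+ 1) := (M :- L :+ con (+ 1)) :+ con (+ 1)) refl (maxR r rs) L)
          (cong (λ v → maxR r rs ℤ.- v ℤ.+ + 1 ℤ.+ + 1) (sym (minL-stack r rs lk)))))
      where open import Data.Integer using (_⊓_)

    addTopRow-width-increasing : Linked ShiftedStep (r ∷ rs) → Increasing (r ∷ rs) → m ℕ.≤ k' → width (addTopRow (suc k') (r ∷ rs)) ≡ + suc k'
    addTopRow-width-increasing lk inc p = trans (cong₂ (λ u v → u ℤ.- v ℤ.+ + 1) (maxR-snoc r rs y) (minL-snoc r rs y))
      (trans (cong₂ (λ u v → u ℤ.- v ℤ.+ + 1) (ℤP.i≥j⇒i⊔j≡i (ℤP.≤-trans (ℤP.≤-reflexive (maxR-inc r rs inc)) (ext-cond⁺₂ p)))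
                                               (trans (cong (X₀ ⊓_) (minL-stack r rs lk)) (ℤP.i≤j⇒i⊓j≡i (ℤP.i-j≤i L (+ 1)))))
        (rowWidth-topRow k' (r ∷ rs)))

  addTopRow-shape : ∀ r rs y → IsShiftedStack (r ∷ (rs ∷ʳ y)) → Σ ℕ λ k' → (y ≡ topRow (suc k') (r ∷ rs)) × (1 ℕ.≤ k')
  addTopRow-shape r rs y ss with IsShiftedStack-snoc⁻ r rs y ss
  ... | _ , ly , L≤ , _ = k' , ye , +-cancelˡ-≤-ℕ X₀ (ℤP.≤-trans (ℤP.≤-reflexive (sym LX)) (ℤP.≤-trans L≤ (ℤP.≤-reflexive ry)))
    where
    L = left (lastRow r rs)
    X₀ = L ℤ.- + 1
    LX : L ≡ X₀ ℤ.+ + 1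
    LX = solve 1 (λ L → L := (L :- con (+ 1)) :+ con (+ 1)) refl L
    ly≤ry : left y ℤ.≤ right y
    ly≤ry = ℤP.≤-trans (ℤP.≤-reflexive ly) (ℤP.≤-trans (ℤP.i-j≤i L (+ 1)) L≤)
    k' = ℤ.∣ left y ℤ.- right y ∣
    ry : right y ≡ X₀ ℤ.+ + k'
    ry = trans (solve 2 (λ R Ly → R := Ly :+ (R :- Ly)) refl (right y) (left y))
           (cong₂ ℤ._+_ ly (sym (ℤP.∣-∣-≤ ly≤ry)))
    ye : y ≡ topRow (suc k') (r ∷ rs)
    ye = cong₂ _,_ ly ry

  rowWidth-positive : ∀ (y : Row) → left y ℤ.≤ right y → Σ ℕ λ m → rowWidth y ≡ + suc m
  rowWidth-positive y p = ℤ.∣ left y ℤ.- right y ∣ , trans (solve 2 (λ R Ly → R :- Ly :+ con (+ 1) := (R :- Ly) :+ con (+ 1)) refl (right y) (left y))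
    (trans (cong (ℤ._+ + 1) (sym (ℤP.∣-∣-≤ p))) (cong +_ (ℕP.+-comm _ 1)))


module Enumeration where

  open import Defs
  open StackCounts using (subsetCount; subsetCountStep; stackCount; increasingCount; extendingCount; extendingCountAt; subsetCountAt; when; sumℕ)
  open StackRows
  open import Data.Nat as ℕ using (ℕ; zero; suc; _∸_; z≤n; s≤s; _≡ᵇ_; _≤ᵇ_)
  import Data.Nat.Properties as ℕP
  open import Data.Integer as ℤ using (ℤ; +_)
  import Data.Integer.Properties as ℤP
  open import Data.Bool using (Bool; true; false; if_then_else_; _∧_)
  open import Data.Product using (Σ; _×_; _,_; proj₁; proj₂)
  open import Data.Sum using (_⊎_; inj₁; inj₂)
  open import Data.List using (List; []; _∷_; _++_; _∷ʳ_; length; map; [_])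
  import Data.List.Properties as LP
  open import Relation.Binary.PropositionalEquality as P using (_≡_; refl; cong; cong₂; trans; sym)
  open import Relation.Nullary using (Dec; yes; no; ¬_)
  open import Data.Empty using (⊥-elim)
  import Data.Empty

  whenList : ∀ {p} {A : Set p} {B : Set} → Dec A → List B → List B
  whenList (yes _) l = l
  whenList (no _) l = []

  concatTo : ∀ {B : Set} → ℕ → (ℕ → List B) → List B
  concatTo zero f = f 0
  concatTo (suc n) f = concatTo n f ++ f (suc n)

  increasingStacks : ℕ → ℕ → ℕ → List (List Row)
  increasingStacksTop : ℕ → ℕ → ℕ → List (List Row)
  increasingStacks zero b c = if (b ≡ᵇ 0) ∧ (c ≡ᵇ 0) then [ [] ] else []
  increasingStacks (suc j) b c = increasingStacks j b c ++ increasingStacksTop j b c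
  increasingStacksTop j zero c = []
  increasingStacksTop j (suc b) c = whenList (suc j ℕP.≤? c) (map (addTopRow (suc j)) (increasingStacks j b (c ∸ suc j)))

  increasingStacksAt : ℕ → ℕ → ℕ → ℕ → List (List Row)
  increasingStacksAt k zero b c = increasingStacks k b c
  increasingStacksAt k (suc _) b c = []

  stacks : ℕ → ℕ → ℕ → ℕ → List (List Row)
  increasingCase : ℕ → ℕ → ℕ → ℕ → List (List Row)
  extendingCase : ℕ → ℕ → ℕ → ℕ → List (List Row)
  extendingCaseAt : ℕ → ℕ → ℕ → ℕ → ℕ → List (List Row)

  stacks zero a b c = []
  stacks (suc zero) a b c = if (a ≡ᵇ 1) ∧ (b ≡ᵇ 1) ∧ (c ≡ᵇ 1) then [ addTopRow 1 [] ] else []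
  stacks (suc (suc k)) a zero c = []
  stacks (suc (suc k)) a (suc b) c = increasingCase k a b c ++ extendingCase k a b c

  increasingCase k a b c = whenList (suc (suc k) ℕP.≤? a) (whenList (suc (suc k) ℕP.≤? c) (map (addTopRow (suc (suc k))) (increasingStacksAt k (a ∸ suc (suc k)) b (c ∸ suc (suc k)))))
  extendingCase k a b c = whenList (1 ℕP.≤? a) (whenList (suc (suc k) ℕP.≤? c)
     (concatTo (a ∸ 1 ℕ.+ b ℕ.+ (c ∸ suc (suc k))) (extendingCaseAt k (a ∸ 1) b (c ∸ suc (suc k)))))
  extendingCaseAt k a b c m = if suc k ≤ᵇ m then map (addTopRow (suc (suc k))) (stacks m a b c) else []


  length-whenList : ∀ {p} {A : Set p} {B : Set} (d : Dec A) (l : List B) → length (whenList d l) ≡ when d (length l)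
  length-whenList (yes _) l = refl
  length-whenList (no _) l = refl

  length-concatTo : ∀ {B : Set} n (f : ℕ → List B) → length (concatTo n f) ≡ sumℕ n (λ m → length (f m))
  length-concatTo zero f = refl
  length-concatTo (suc n) f = trans (LP.length-++ (concatTo n f)) (cong (ℕ._+ length (f (suc n))) (length-concatTo n f))

  sumℕ-cong : ∀ n {f g : ℕ → ℕ} → (∀ m → f m ≡ g m) → sumℕ n f ≡ sumℕ n g
  sumℕ-cong zero h = h 0
  sumℕ-cong (suc n) h = cong₂ ℕ._+_ (sumℕ-cong n h) (h (suc n))

  when-cong : ∀ {p} {A : Set p} (d : Dec A) {m n} → m ≡ n → when d m ≡ when d n
  when-cong d refl = refl

  length-increasingStacks : ∀ j b c → length (increasingStacks j b c) ≡ subsetCount j b c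
  length-increasingStacks zero b c with (b ≡ᵇ 0) ∧ (c ≡ᵇ 0)
  ... | true = refl
  ... | false = refl
  length-increasingStacks (suc j) b c = trans (LP.length-++ (increasingStacks j b c)) (cong₂ ℕ._+_ (length-increasingStacks j b c) (st b))
    where
    st : ∀ b → length (increasingStacksTop j b c) ≡ subsetCountStep j b c
    st zero = refl
    st (suc b) = trans (length-whenList (suc j ℕP.≤? c) _) (when-cong (suc j ℕP.≤? c) (trans (LP.length-map _ (increasingStacks j b (c ∸ suc j))) (length-increasingStacks j b (c ∸ suc j))))

  length-stacks : ∀ k a b c → length (stacks k a b c) ≡ stackCount k a b c
  length-stacks zero a b c = refl
  length-stacks (suc zero) a b c with (a ≡ᵇ 1) ∧ (b ≡ᵇ 1) ∧ (c ≡ᵇ 1)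
  ... | true = refl
  ... | false = refl
  length-stacks (suc (suc k)) a zero c = refl
  length-stacks (suc (suc k)) a (suc b) c = trans (LP.length-++ (increasingCase k a b c)) (cong₂ ℕ._+_ li le)
    where
    K = suc (suc k)
    πlen : ∀ a' → length (increasingStacksAt k a' b (c ∸ K)) ≡ subsetCountAt k a' b (c ∸ K)
    πlen zero = length-increasingStacks k b (c ∸ K)
    πlen (suc a') = refl
    li : length (increasingCase k a b c) ≡ increasingCount k a b c
    li = trans (length-whenList (K ℕP.≤? a) _) (when-cong (K ℕP.≤? a) (trans (length-whenList (K ℕP.≤? c) _) (when-cong (K ℕP.≤? c)
           (trans (LP.length-map _ (increasingStacksAt k (a ∸ K) b (c ∸ K))) (πlen (a ∸ K))))))
    et : ∀ m → length (extendingCaseAt k (a ∸ 1) b (c ∸ K) m) ≡ extendingCountAt k (a ∸ 1) b (c ∸ K) m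
    et m with suc k ≤ᵇ m
    ... | true = trans (LP.length-map _ (stacks m (a ∸ 1) b (c ∸ K))) (length-stacks m (a ∸ 1) b (c ∸ K))
    ... | false = refl
    le : length (extendingCase k a b c) ≡ extendingCount k a b c
    le = trans (length-whenList (1 ℕP.≤? a) _) (when-cong (1 ℕP.≤? a) (trans (length-whenList (K ℕP.≤? c) _) (when-cong (K ℕP.≤? c)
           (trans (length-concatTo (a ∸ 1 ℕ.+ b ℕ.+ (c ∸ K)) (extendingCaseAt k (a ∸ 1) b (c ∸ K))) (sumℕ-cong (a ∸ 1 ℕ.+ b ℕ.+ (c ∸ K)) et)))))


  open import Data.List.Membership.Propositional using (_∈_)
  open import Data.List.Membership.Propositional.Properties using (∈-map⁺; ∈-map⁻; ∈-++⁺ˡ; ∈-++⁺ʳ; ∈-++⁻)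
  open import Data.List.Relation.Unary.Any using (here)

  ∈-whenList⁻ : ∀ {p} {A : Set p} {B : Set} (d : Dec A) {l : List B} {x} → x ∈ whenList d l → A × x ∈ l
  ∈-whenList⁻ (yes a) m = a , m
  ∈-whenList⁻ (no _) ()

  ∈-whenList⁺ : ∀ {p} {A : Set p} {B : Set} (d : Dec A) {l : List B} {x} → A → x ∈ l → x ∈ whenList d l
  ∈-whenList⁺ (yes _) _ m = m
  ∈-whenList⁺ (no ¬a) a _ = ⊥-elim (¬a a)

  ∈-if⁻ : ∀ {B : Set} (b : Bool) {l : List B} {x} → x ∈ (if b then l else []) → (b ≡ true) × x ∈ l
  ∈-if⁻ true m = refl , m
  ∈-if⁻ false ()

  ∈-concatTo⁻ : ∀ {B : Set} n (f : ℕ → List B) {x} → x ∈ concatTo n f → Σ ℕ λ m → (m ℕ.≤ n) × x ∈ f m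
  ∈-concatTo⁻ zero f m = 0 , z≤n , m
  ∈-concatTo⁻ (suc n) f m with ∈-++⁻ (concatTo n f) m
  ... | inj₁ m' = let (k , k≤n , mk) = ∈-concatTo⁻ n f m' in k , ℕP.m≤n⇒m≤1+n k≤n , mk
  ... | inj₂ m' = suc n , ℕP.≤-refl , m'

  ∈-concatTo⁺ : ∀ {B : Set} n (f : ℕ → List B) {x} m → m ℕ.≤ n → x ∈ f m → x ∈ concatTo n f
  ∈-concatTo⁺ zero f zero z≤n mem = mem
  ∈-concatTo⁺ (suc n) f m m≤ mem with ℕP.m≤n⇒m<n∨m≡n m≤
  ... | inj₁ (s≤s m≤n) = ∈-++⁺ˡ (∈-concatTo⁺ n f m m≤n mem)
  ... | inj₂ refl = ∈-++⁺ʳ (concatTo n f) mem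

  ≡ᵇ-true : ∀ m n → (m ≡ᵇ n) ≡ true → m ≡ n
  ≡ᵇ-true m n e = ℕP.≡ᵇ⇒≡ m n (P.subst Data.Bool.T (sym e) _)

  ∧-true : ∀ x y → x ∧ y ≡ true → (x ≡ true) × (y ≡ true)
  ∧-true true true refl = refl , refl


  module _ (r : Row) (rs : List Row) (k' m a' b' c' : ℕ) where
    private
      rwm : ShiftedStackWith m a' b' c' (r ∷ rs) → rowWidth (lastRow r rs) ≡ + m
      rwm (_ , top , _) = trans (sym (top-last r rs)) top
      common : ShiftedStackWith m a' b' c' (r ∷ rs) →
        (topRowWidth (addTopRow (suc k') (r ∷ rs)) ≡ + suc k') × (length (addTopRow (suc k') (r ∷ rs)) ≡ suc b') × (area (addTopRow (suc k') (r ∷ rs)) ≡ + (c' ℕ.+ suc k'))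
      common (_ , _ , _ , h , ar) =
        trans (top-snoc (r ∷ rs) (topRow (suc k') (r ∷ rs))) (rowWidth-topRow k' (r ∷ rs)) ,
        trans (length-snoc (r ∷ rs) _) (cong suc h) ,
        trans (area-snoc (r ∷ rs) _) (trans (cong₂ ℤ._+_ ar (rowWidth-topRow k' (r ∷ rs))) (sym (ℤP.pos-+ c' (suc k'))))

    addTopRow-extending′ : ShiftedStackWith m a' b' c' (r ∷ rs) → 1 ℕ.≤ k' → k' ℕ.≤ m → ShiftedStackWith (suc k') (suc a') (suc b') (c' ℕ.+ suc k') (addTopRow (suc k') (r ∷ rs))
    addTopRow-extending′ w@(ss , top , wd , h , ar) p q =
      addTopRow-IsShiftedStack r rs k' m (rwm w) ss p (inj₁ q) , proj₁ (common w) ,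
      trans (addTopRow-width-extending r rs k' m (rwm w) (proj₁ (proj₂ (proj₂ ss))) q) (trans (cong (ℤ._+ + 1) wd) (cong +_ (ℕP.+-comm a' 1))) ,
      proj₂ (common w)

    addTopRow-increasing′ : ShiftedStackWith m a' b' c' (r ∷ rs) → Increasing (r ∷ rs) → 1 ℕ.≤ k' → m ℕ.≤ k' → ShiftedStackWith (suc k') (suc k') (suc b') (c' ℕ.+ suc k') (addTopRow (suc k') (r ∷ rs))
    addTopRow-increasing′ w@(ss , top , wd , h , ar) inc p q =
      addTopRow-IsShiftedStack r rs k' m (rwm w) ss p (inj₂ (inc , q)) , proj₁ (common w) ,
      addTopRow-width-increasing r rs k' m (rwm w) (proj₁ (proj₂ (proj₂ ss))) inc q ,
      proj₂ (common w)

  singleRow-ShiftedStackWith : ∀ k' → ShiftedStackWith (suc k') (suc k') 1 (suc k') (addTopRow (suc k') [])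
  singleRow-ShiftedStackWith k' = IsShiftedStack-[-]⁺ (+ k') (ℤ.+≤+ z≤n) , rowWidth-topRow k' [] , rowWidth-topRow k' [] , refl ,
    trans (ℤP.+-identityʳ _) (rowWidth-topRow k' [])


  addTopRow-extending : ∀ k' m a' b' c' ys → ShiftedStackWith m a' b' c' ys → 1 ℕ.≤ k' → k' ℕ.≤ m → ShiftedStackWith (suc k') (suc a') (suc b') (c' ℕ.+ suc k') (addTopRow (suc k') ys)
  addTopRow-extending k' m a' b' c' [] (((_ , _ , ()) , _) , _)
  addTopRow-extending k' m a' b' c' (r ∷ rs) s p q = addTopRow-extending′ r rs k' m a' b' c' s p q

  addTopRow-increasing : ∀ k' m a' b' c' ys → ShiftedStackWith m a' b' c' ys → Increasing ys → 1 ℕ.≤ k' → m ℕ.≤ k' →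
    ShiftedStackWith (suc k') (suc k') (suc b') (c' ℕ.+ suc k') (addTopRow (suc k') ys) × Increasing (addTopRow (suc k') ys)
  addTopRow-increasing k' m a' b' c' [] (((_ , _ , ()) , _) , _)
  addTopRow-increasing k' m a' b' c' (r ∷ rs) s inc p q = addTopRow-increasing′ r rs k' m a' b' c' s inc p q , addTopRow-Increasing r rs k' m (trans (sym (top-last r rs)) (proj₁ (proj₂ s))) inc q

  subst-area : ∀ {k a b c c' xs} → c ≡ c' → ShiftedStackWith k a b c xs → ShiftedStackWith k a b c' xs
  subst-area refl w = w

  subst-width : ∀ {k a a' b c xs} → a ≡ a' → ShiftedStackWith k a b c xs → ShiftedStackWith k a' b c xs
  subst-width refl w = w

  IncreasingStack : ℕ → ℕ → ℕ → List Row → Set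
  IncreasingStack j b c xs = (xs ≡ [] × b ≡ 0 × c ≡ 0) ⊎ (Σ ℕ λ w → (suc w ℕ.≤ j) × ShiftedStackWith (suc w) (suc w) b c xs × Increasing xs)

  increasingStacks-sound : ∀ j b c xs → xs ∈ increasingStacks j b c → IncreasingStack j b c xs
  increasingStacks-sound zero b c xs mem with ∈-if⁻ ((b ≡ᵇ 0) ∧ (c ≡ᵇ 0)) mem
  ... | e , here refl = inj₁ (refl , ≡ᵇ-true b 0 (proj₁ (∧-true _ _ e)) , ≡ᵇ-true c 0 (proj₂ (∧-true _ _ e)))
  increasingStacks-sound (suc j) b c xs mem with ∈-++⁻ (increasingStacks j b c) mem
  ... | inj₁ m' with increasingStacks-sound j b c xs m'
  ...   | inj₁ e = inj₁ e
  ...   | inj₂ (w , w≤ , s , inc) = inj₂ (w , ℕP.m≤n⇒m≤1+n w≤ , s , inc)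
  increasingStacks-sound (suc j) (suc b) c xs mem | inj₂ m' with ∈-whenList⁻ (suc j ℕP.≤? c) m'
  ... | sj≤c , m'' with ∈-map⁻ _ m''
  ... | zs , zmem , refl with increasingStacks-sound j b (c ∸ suc j) zs zmem
  ... | inj₁ (refl , refl , e) = inj₂ (j , ℕP.≤-refl ,
          subst-area (trans (sym (cong (λ z → z ℕ.+ suc j) e)) (ℕP.m∸n+n≡m sj≤c)) (singleRow-ShiftedStackWith j) , [-])
    where open import Data.List.Relation.Unary.Linked using ([-])
  ... | inj₂ (w , w≤ , s , inc) = let (s' , inc') = addTopRow-increasing j (suc w) (suc w) b (c ∸ suc j) zs s inc (ℕP.≤-trans (s≤s z≤n) w≤) w≤
          in inj₂ (j , ℕP.≤-refl , subst-area (ℕP.m∸n+n≡m sj≤c) s' , inc')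

  ∈-increasingStacksAt⁻ : ∀ {k b c ys} a' → ys ∈ increasingStacksAt k a' b c → (a' ≡ 0) × ys ∈ increasingStacks k b c
  ∈-increasingStacksAt⁻ zero m = refl , m
  ∈-increasingStacksAt⁻ (suc a') ()

  ∈-increasingCase⁻ : ∀ k a b c {xs} → xs ∈ increasingCase k a b c →
    Σ (List Row) λ ys → xs ≡ addTopRow (suc (suc k)) ys × a ≡ suc (suc k) × suc (suc k) ℕ.≤ c
                         × ys ∈ increasingStacks k b (c ∸ suc (suc k))
  ∈-increasingCase⁻ k a b c mem with ∈-whenList⁻ (suc (suc k) ℕP.≤? a) mem
  ... | K≤a , m₁ with ∈-whenList⁻ (suc (suc k) ℕP.≤? c) m₁
  ... | K≤c , m₂ with ∈-map⁻ _ m₂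
  ... | ys , ym , refl with ∈-increasingStacksAt⁻ (a ∸ suc (suc k)) ym
  ... | a∸K≡0 , ym′ = ys , refl , sym (ℕP.≤-antisym K≤a (ℕP.m∸n≡0⇒m≤n a∸K≡0)) , K≤c , ym′

  ∈-extendingCase⁻ : ∀ k a b c {xs} → xs ∈ extendingCase k a b c →
    Σ ℕ λ m → Σ (List Row) λ ys → xs ≡ addTopRow (suc (suc k)) ys × 1 ℕ.≤ a × suc (suc k) ℕ.≤ c × suc k ℕ.≤ m
                                   × ys ∈ stacks m (a ∸ 1) b (c ∸ suc (suc k))
  ∈-extendingCase⁻ k a b c mem with ∈-whenList⁻ (1 ℕP.≤? a) mem
  ... | 1≤a , m₁ with ∈-whenList⁻ (suc (suc k) ℕP.≤? c) m₁
  ... | K≤c , m₂ with ∈-concatTo⁻ (a ∸ 1 ℕ.+ b ℕ.+ (c ∸ suc (suc k))) (extendingCaseAt k (a ∸ 1) b (c ∸ suc (suc k))) m₂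
  ... | m , _ , m₃ with ∈-if⁻ (suc k ≤ᵇ m) m₃
  ... | k<m , m₄ with ∈-map⁻ _ m₄
  ... | ys , ym , refl = m , ys , refl , 1≤a , K≤c , ℕP.≤ᵇ⇒≤ (suc k) m (P.subst Data.Bool.T (sym k<m) _) , ym

  stacks-sound : ∀ k a b c xs → xs ∈ stacks k a b c → ShiftedStackWith k a b c xs
  stacks-sound (suc zero) a b c xs mem with ∈-if⁻ ((a ≡ᵇ 1) ∧ (b ≡ᵇ 1) ∧ (c ≡ᵇ 1)) mem
  ... | e , here refl with ∧-true _ _ e
  ... | ea , e' with ∧-true _ _ e'
  ... | eb , ec with ≡ᵇ-true a 1 ea | ≡ᵇ-true b 1 eb | ≡ᵇ-true c 1 ec
  ... | refl | refl | refl = singleRow-ShiftedStackWith 0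
  stacks-sound (suc (suc k)) a (suc b) c xs mem with ∈-++⁻ (increasingCase k a b c) mem
  ... | inj₁ mi with ∈-increasingCase⁻ k a b c mi
  ...   | ys , refl , refl , K≤c , ym = subst-area (ℕP.m∸n+n≡m K≤c) (fromIncreasing (increasingStacks-sound k b (c ∸ K) ys ym))
      where
      K = suc (suc k)
      fromIncreasing : IncreasingStack k b (c ∸ K) ys → ShiftedStackWith K K (suc b) (c ∸ K ℕ.+ K) (addTopRow K ys)
      fromIncreasing (inj₁ (refl , refl , e)) = subst-area (cong (ℕ._+ K) (sym e)) (singleRow-ShiftedStackWith (suc k))
      fromIncreasing (inj₂ (w , w≤ , s , inc)) = proj₁ (addTopRow-increasing (suc k) (suc w) (suc w) b (c ∸ K) ys s inc (s≤s z≤n) (ℕP.m≤n⇒m≤1+n w≤))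
  stacks-sound (suc (suc k)) a (suc b) c xs mem | inj₂ me with ∈-extendingCase⁻ k a b c me
  ... | m , ys , refl , 1≤a , K≤c , k<m , ym =
    subst-width (trans (ℕP.+-comm 1 (a ∸ 1)) (ℕP.m∸n+n≡m 1≤a)) (subst-area (ℕP.m∸n+n≡m K≤c)
      (addTopRow-extending (suc k) m (a ∸ 1) b (c ∸ suc (suc k)) ys (stacks-sound m (a ∸ 1) b (c ∸ suc (suc k)) ys ym) (s≤s z≤n) k<m))

  nonneg⇒ℕ : ∀ (i : ℤ) → + 0 ℤ.≤ i → Σ ℕ (λ n → i ≡ + n)
  nonneg⇒ℕ i p = ℤ.∣ i ∣ , sym (ℤP.0≤i⇒+∣i∣≡i p)

  open import Data.List.Relation.Unary.All using (All; []; _∷_)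

  All-last : ∀ {P : Row → Set} r rs → All P (r ∷ rs) → P (lastRow r rs)
  All-last r [] (p ∷ []) = p
  All-last r (r' ∷ rs) (_ ∷ ps) = All-last r' rs ps

  area-nonneg : ∀ l → All (λ r → left r ℤ.≤ right r) l → + 0 ℤ.≤ area l
  area-nonneg [] [] = ℤP.≤-refl
  area-nonneg (r ∷ l) (p ∷ ps) = ℤP.≤-trans (ℤP.≤-reflexive refl) (ℤP.+-mono-≤ {+ 0} {rowWidth r} {+ 0} {area l}
    (ℤP.≤-trans (ℤ.+≤+ z≤n) (ℤP.≤-reflexive (sym (proj₂ (rowWidth-positive r p))))) (area-nonneg l ps))

  width-nonneg : ∀ r rs → IsShiftedStack (r ∷ rs) → + 0 ℤ.≤ width (r ∷ rs)
  width-nonneg r rs (_ , all , lk , _) =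
    ℤP.≤-trans (ℤ.+≤+ z≤n) (ℤP.≤-trans (ℤP.≤-reflexive (sym (proj₂ (rowWidth-positive (lastRow r rs) (All-last r rs all)))))
      (ℤP.+-monoˡ-≤ (+ 1) (ℤP.+-mono-≤ (maxR-≥last r rs) (ℤP.neg-mono-≤ (ℤP.≤-reflexive (minL-stack r rs lk))))))

  record TopRowDecomposition (r : Row) (rs : List Row) (y : Row) (k a b c : ℕ) : Set where
    field
      k' m a' c' : ℕ
      ek : k ≡ suc k'
      1≤k' : 1 ℕ.≤ k'
      ye : y ≡ topRow (suc k') (r ∷ rs)
      ec : c ≡ c' ℕ.+ suc k'
      eb : b ≡ suc (length (r ∷ rs))
      sswi : ShiftedStackWith m a' (length (r ∷ rs)) c' (r ∷ rs)
      cases : (k' ℕ.≤ m × a ≡ suc a') ⊎ (Increasing (r ∷ rs) × m ℕ.< k' × a ≡ suc k')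

  decompose-top-row : ∀ r rs y k a b c → ShiftedStackWith k a b c (r ∷ (rs ∷ʳ y)) → TopRowDecomposition r rs y k a b c
  decompose-top-row r rs y k a b c (ss , top , wd , h , ar) with IsShiftedStack-snoc⁻ r rs y ss | addTopRow-shape r rs y ss
  ... | ssi , ly , L≤ , cond | k' , refl , 1≤k' = record
    { k' = k' ; m = suc m₀ ; a' = a' ; c' = c'
    ; ek = ℤP.+-injective (trans (sym top) (trans (top-snoc (r ∷ rs) y) (rowWidth-topRow k' (r ∷ rs))))
    ; 1≤k' = 1≤k'
    ; ye = refl
    ; ec = ℤP.+-injective (trans (sym ar) (trans (area-snoc (r ∷ rs) y) (trans (cong₂ ℤ._+_ c'e (rowWidth-topRow k' (r ∷ rs))) (sym (ℤP.pos-+ c' (suc k'))))))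
    ; eb = trans (sym h) (length-snoc (r ∷ rs) y)
    ; sswi = ssi , trans (top-last r rs) m₀e , a'e , refl , c'e
    ; cases = cs }
    where
    all = proj₁ (proj₂ ssi)
    lk = proj₁ (proj₂ (proj₂ ssi))
    m₀ = proj₁ (rowWidth-positive (lastRow r rs) (All-last r rs all))
    m₀e = proj₂ (rowWidth-positive (lastRow r rs) (All-last r rs all))
    a' = proj₁ (nonneg⇒ℕ (width (r ∷ rs)) (width-nonneg r rs ssi))
    a'e = proj₂ (nonneg⇒ℕ (width (r ∷ rs)) (width-nonneg r rs ssi))
    c' = proj₁ (nonneg⇒ℕ (area (r ∷ rs)) (area-nonneg (r ∷ rs) all))
    c'e = proj₂ (nonneg⇒ℕ (area (r ∷ rs)) (area-nonneg (r ∷ rs) all))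
    cs : (k' ℕ.≤ suc m₀ × a ≡ suc a') ⊎ (Increasing (r ∷ rs) × suc m₀ ℕ.< k' × a ≡ suc k')
    cs with k' ℕP.≤? suc m₀
    ... | yes p = inj₁ (p , ℤP.+-injective (trans (sym wd) (trans (addTopRow-width-extending r rs k' (suc m₀) m₀e lk p)
                          (trans (cong (ℤ._+ + 1) a'e) (cong +_ (ℕP.+-comm a' 1))))))
    ... | no ¬p = fromCond cond ¬p
      where
      fromCond : (right (topRow (suc k') (r ∷ rs)) ℤ.≤ right (lastRow r rs) ⊎ Increasing (r ∷ rs)) → ¬ (k' ℕ.≤ suc m₀) →
                 (k' ℕ.≤ suc m₀ × a ≡ suc a') ⊎ (Increasing (r ∷ rs) × suc m₀ ℕ.< k' × a ≡ suc k')
      fromCond (inj₁ y≤) ¬p = ⊥-elim (¬p (ext-cond⁻₁ r rs k' (suc m₀) m₀e y≤))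
      fromCond (inj₂ inc) ¬p = inj₂ (inc , ℕP.≰⇒> ¬p , ℤP.+-injective (trans (sym wd) (addTopRow-width-increasing r rs k' (suc m₀) m₀e lk inc (ℕP.<⇒≤ (ℕP.≰⇒> ¬p)))))

  []∈increasingStacks : ∀ j → [] ∈ increasingStacks j 0 0
  []∈increasingStacks zero = here refl
  []∈increasingStacks (suc j) = ∈-++⁺ˡ ([]∈increasingStacks j)

  ∈-increasingStacksAt⁺ : ∀ {k b c ys} a' → a' ≡ 0 → ys ∈ increasingStacks k b c → ys ∈ increasingStacksAt k a' b c
  ∈-increasingStacksAt⁺ zero _ m = m

  mem-nonempty : ∀ {B : Set} {x : B} (l : List B) → x ∈ l → 0 ℕ.< length l
  mem-nonempty (_ ∷ _) _ = s≤s z≤n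

  stacks-top≤width : ∀ m a b c ys → ys ∈ stacks m a b c → m ℕ.≤ a
  stacks-top≤width m a b c ys mem with m ℕP.≤? a
  ... | yes p = p
  ... | no ¬p = ⊥-elim (ℕP.<-irrefl refl (ℕP.<-≤-trans (mem-nonempty _ mem)
                   (ℕP.≤-reflexive (trans (length-stacks m a b c) (StackCounts.stackCount-narrow m a b c (ℕP.≰⇒> ¬p))))))


  ∈-increasingStacksTop : ∀ j b c' zs → zs ∈ increasingStacks j b c' → addTopRow (suc j) zs ∈ increasingStacksTop j (suc b) (c' ℕ.+ suc j)
  ∈-increasingStacksTop j b c' zs zm = ∈-whenList⁺ (suc j ℕP.≤? (c' ℕ.+ suc j)) (ℕP.m≤n+m (suc j) c')
    (P.subst (λ z → addTopRow (suc j) zs ∈ map (addTopRow (suc j)) (increasingStacks j b z)) (sym (ℕP.m+n∸n≡m c' (suc j))) (∈-map⁺ _ zm))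

  ∈-increasingCase : ∀ k'' b' c' ys → ys ∈ increasingStacks k'' b' c' → addTopRow (suc (suc k'')) ys ∈ stacks (suc (suc k'')) (suc (suc k'')) (suc b') (c' ℕ.+ suc (suc k''))
  ∈-increasingCase k'' b' c' ys ym = ∈-++⁺ˡ (∈-whenList⁺ (K ℕP.≤? K) ℕP.≤-refl (∈-whenList⁺ (K ℕP.≤? (c' ℕ.+ K)) (ℕP.m≤n+m K c')
    (∈-map⁺ _ (P.subst (λ z → ys ∈ increasingStacksAt k'' (K ∸ K) b' z) (sym (ℕP.m+n∸n≡m c' K)) (∈-increasingStacksAt⁺ (K ∸ K) (ℕP.n∸n≡0 K) ym)))))
    where K = suc (suc k'')

  T→≡' : ∀ {b} → Data.Bool.T b → b ≡ true
  T→≡' {true} _ = refl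

  ∈-extendingCase : ∀ k'' a' b' c' m ys → m ℕ.≤ a' → suc k'' ℕ.≤ m → ys ∈ stacks m a' b' c' →
    addTopRow (suc (suc k'')) ys ∈ stacks (suc (suc k'')) (suc a') (suc b') (c' ℕ.+ suc (suc k''))
  ∈-extendingCase k'' a' b' c' m ys m≤a' k≤m ym = ∈-++⁺ʳ (increasingCase k'' (suc a') b' (c' ℕ.+ K))
    (∈-whenList⁺ (1 ℕP.≤? suc a') (s≤s z≤n) (∈-whenList⁺ (K ℕP.≤? (c' ℕ.+ K)) (ℕP.m≤n+m K c')
      (P.subst (λ z → addTopRow K ys ∈ concatTo (a' ℕ.+ b' ℕ.+ z) (extendingCaseAt k'' a' b' z)) (sym (ℕP.m+n∸n≡m c' K))
        (∈-concatTo⁺ (a' ℕ.+ b' ℕ.+ c') (extendingCaseAt k'' a' b' c') m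
           (ℕP.≤-trans m≤a' (ℕP.≤-trans (ℕP.m≤m+n a' b') (ℕP.m≤m+n (a' ℕ.+ b') c'))) inT))))
    where
    K = suc (suc k'')
    inT : addTopRow K ys ∈ extendingCaseAt k'' a' b' c' m
    inT rewrite T→≡' (ℕP.≤⇒≤ᵇ k≤m) = ∈-map⁺ _ ym

  open import Data.List.Base using (InitLast; initLast; _∷ʳ′_)
  import Data.List.Base as LB

  singleRow-shape : ∀ k a b c y → ShiftedStackWith k a b c [ y ] →
    Σ ℕ λ k0 → (k ≡ suc k0) × (a ≡ suc k0) × (b ≡ 1) × (c ≡ suc k0) × (y ≡ topRow (suc k0) [])
  singleRow-shape k a b c y (ss , top , wd , h , ar) with IsShiftedStack-[-]⁻ y ss
  ... | ly , ry≥ = k0 , ek , ea , sym h , ec , cong₂ _,_ ly ry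
    where
    p : left y ℤ.≤ right y
    p = ℤP.≤-trans (ℤP.≤-reflexive ly) ry≥
    k0 = proj₁ (rowWidth-positive y p)
    e = proj₂ (rowWidth-positive y p)
    ek = ℤP.+-injective (trans (sym top) e)
    ea = ℤP.+-injective (trans (sym wd) e)
    ec = ℤP.+-injective (trans (sym ar) (trans (ℤP.+-identityʳ _) e))
    ry : right y ≡ (+ 1 ℤ.- + 1) ℤ.+ + k0
    ry = trans (right-from-width y (suc k0) e) (trans (cong (λ z → (z ℤ.- + 1) ℤ.+ + suc k0) ly)
           (+-*-Solver.solve 1 (λ K → (con (+ 0) :- con (+ 1)) :+ (con (+ 1) :+ K) := (con (+ 1) :- con (+ 1)) :+ K) refl (+ k0)))
      where
      open import Data.Integer.Solver using (module +-*-Solver)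
      open +-*-Solver using (_:+_; _:-_; _:=_; con)

  subst-∈-increasingStacksTop : ∀ {xs xs' j j' b b' c c'} → xs ≡ xs' → j ≡ j' → b ≡ b' → c ≡ c' → xs ∈ increasingStacksTop j b c → xs' ∈ increasingStacksTop j' b' c'
  subst-∈-increasingStacksTop refl refl refl refl m = m

  increasingStacks-complete : ∀ j w a b c xs → ShiftedStackWith (suc w) a b c xs → Increasing xs → suc w ℕ.≤ j → xs ∈ increasingStacks j b c
  increasingStacks-complete (suc j) w a b c xs s inc sw≤ with suc w ℕP.≤? j
  ... | yes p = ∈-++⁺ˡ (increasingStacks-complete j w a b c xs s inc p)
  ... | no ¬p with ℕP.≤-antisym (ℕP.≤-pred sw≤) (ℕP.≤-pred (ℕP.≰⇒> ¬p))
  ... | refl = ∈-++⁺ʳ (increasingStacks w b c) (go xs (initLast xs) s inc)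
    where
    go : ∀ xs → InitLast xs → ShiftedStackWith (suc w) a b c xs → Increasing xs → xs ∈ increasingStacksTop w b c
    go .[] LB.[] (((_ , _ , ()) , _) , _) _
    go .(LB.[] ∷ʳ y) (LB.[] ∷ʳ′ y) s _ with singleRow-shape (suc w) a b c y s
    ... | k0 , refl , _ , refl , refl , refl = ∈-increasingStacksTop w 0 0 [] ([]∈increasingStacks w)
    go .((r ∷ rs) ∷ʳ y) ((r ∷ rs) ∷ʳ′ y) s inc = res
      where
      D = decompose-top-row r rs y (suc w) a b c s
      open TopRowDecomposition D
      res : (r ∷ rs) ∷ʳ y ∈ increasingStacksTop w b c
      res = subst-∈-increasingStacksTop (cong (λ z → (r ∷ rs) ∷ʳ z) (sym ye')) refl (sym eb) (sym ec')
        (∈-increasingStacksTop w (length (r ∷ rs)) c' (r ∷ rs)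
          (increasingStacks-complete w m' a' (length (r ∷ rs)) c' (r ∷ rs) (P.subst (λ z → ShiftedStackWith z a' (length (r ∷ rs)) c' (r ∷ rs)) me sswi) inci
             (ℕP.≤-trans (ℕP.≤-reflexive (sym me)) mle)))
        where
        kj : k' ≡ w
        kj = sym (ℕP.suc-injective ek)
        ye' : y ≡ topRow (suc w) (r ∷ rs)
        ye' = trans ye (cong (λ z → topRow (suc z) (r ∷ rs)) kj)
        ec' : c ≡ c' ℕ.+ suc w
        ec' = trans ec (cong (λ z → c' ℕ.+ suc z) kj)
        lsn = Linked-snoc⁻ r rs (topRow (suc w) (r ∷ rs)) (P.subst Increasing (cong (λ z → (r ∷ rs) ∷ʳ z) ye') inc)
        inci = proj₁ lsn
        top-m : rowWidth (lastRow r rs) ≡ + m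
        top-m = trans (sym (top-last r rs)) (proj₁ (proj₂ sswi))
        mle : m ℕ.≤ w
        mle = ext-cond⁻₂ r rs w m top-m (proj₂ lsn)
        rwl = rowWidth-positive (lastRow r rs) (All-last r rs (proj₁ (proj₂ (proj₁ sswi))))
        m' = proj₁ rwl
        me : m ≡ suc m'
        me = ℤP.+-injective (trans (sym top-m) (proj₂ rwl))

  subst-∈-stacks : ∀ {xs xs' k k' a a' b b' c c'} → xs ≡ xs' → k ≡ k' → a ≡ a' → b ≡ b' → c ≡ c' → xs ∈ stacks k a b c → xs' ∈ stacks k' a' b' c'
  subst-∈-stacks refl refl refl refl refl m = m

  singleRow-∈ : ∀ k0 → addTopRow (suc k0) [] ∈ stacks (suc k0) (suc k0) 1 (suc k0)
  singleRow-∈ zero = here refl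
  singleRow-∈ (suc k'') = ∈-increasingCase k'' 0 0 [] ([]∈increasingStacks k'')

  ∈-extendingCase′ : ∀ r rs b' k' m a' c' → 1 ℕ.≤ k' → k' ℕ.≤ m → m ℕ.≤ a' → (r ∷ rs) ∈ stacks m a' b' c' →
    addTopRow (suc k') (r ∷ rs) ∈ stacks (suc k') (suc a') (suc b') (c' ℕ.+ suc k')
  ∈-extendingCase′ r rs b' (suc k'') m a' c' _ k≤m m≤a ym = ∈-extendingCase k'' a' b' c' m (r ∷ rs) m≤a k≤m ym

  ∈-increasingCase′ : ∀ r rs b' k' c' → 1 ℕ.≤ k' → (r ∷ rs) ∈ increasingStacks (ℕ.pred k') b' c' →
    addTopRow (suc k') (r ∷ rs) ∈ stacks (suc k') (suc k') (suc b') (c' ℕ.+ suc k')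
  ∈-increasingCase′ r rs b' (suc k'') c' _ ym = ∈-increasingCase k'' b' c' (r ∷ rs) ym

  <⇒≤pred : ∀ {x y} → suc x ℕ.≤ y → x ℕ.≤ ℕ.pred y
  <⇒≤pred (s≤s p) = p

  subst-height : ∀ {k a b b' c xs} → b ≡ b' → ShiftedStackWith k a b c xs → ShiftedStackWith k a b' c xs
  subst-height refl w = w

  stacks-complete : ∀ b k a c xs → ShiftedStackWith k a b c xs → xs ∈ stacks k a b c
  stacks-complete zero k a c [] (((_ , _ , ()) , _) , _)
  stacks-complete zero k a c (x ∷ xs) (_ , _ , _ , () , _)
  stacks-complete (suc b') k a c xs s = go xs (initLast xs) s
    where
    go : ∀ xs → InitLast xs → ShiftedStackWith k a (suc b') c xs → xs ∈ stacks k a (suc b') c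
    go .[] LB.[] (((_ , _ , ()) , _) , _)
    go .(LB.[] ∷ʳ y) (LB.[] ∷ʳ′ y) s with singleRow-shape k a (suc b') c y s
    ... | k0 , ek , ea , eb , ec , ey = subst-∈-stacks (cong [_] (sym ey)) (sym ek) (sym ea) (sym eb) (sym ec) (singleRow-∈ k0)
    go .((r ∷ rs) ∷ʳ y) ((r ∷ rs) ∷ʳ′ y) s = res cases
      where
      D = decompose-top-row r rs y k a (suc b') c s
      open TopRowDecomposition D
      lb : length (r ∷ rs) ≡ b'
      lb = sym (ℕP.suc-injective eb)
      sw = subst-height lb sswi
      ih : (r ∷ rs) ∈ stacks m a' b' c'
      ih = stacks-complete b' m a' c' (r ∷ rs) sw
      xe : addTopRow (suc k') (r ∷ rs) ≡ (r ∷ rs) ∷ʳ y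
      xe = cong (λ z → (r ∷ rs) ∷ʳ z) (sym ye)
      res : (k' ℕ.≤ m × a ≡ suc a') ⊎ (Increasing (r ∷ rs) × m ℕ.< k' × a ≡ suc k') → (r ∷ rs) ∷ʳ y ∈ stacks k a (suc b') c
      res (inj₁ (k≤m , ea)) = subst-∈-stacks xe (sym ek) (sym ea) refl (sym ec)
         (∈-extendingCase′ r rs b' k' m a' c' 1≤k' k≤m (stacks-top≤width m a' b' c' (r ∷ rs) ih) ih)
      res (inj₂ (inc , m<k , ea)) = subst-∈-stacks xe (sym ek) (sym ea) refl (sym ec)
         (∈-increasingCase′ r rs b' k' c' 1≤k' (increasingStacks-complete (ℕ.pred k') m' a' b' c' (r ∷ rs) (P.subst (λ z → ShiftedStackWith z a' b' c' (r ∷ rs)) me sw) inc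
            (<⇒≤pred (P.subst (λ z → suc z ℕ.≤ k') me m<k))))
        where
        top-m : rowWidth (lastRow r rs) ≡ + m
        top-m = trans (sym (top-last r rs)) (proj₁ (proj₂ sswi))
        rwl = rowWidth-positive (lastRow r rs) (All-last r rs (proj₁ (proj₂ (proj₁ sswi))))
        m' = proj₁ rwl
        me : m ≡ suc m'
        me = ℤP.+-injective (trans (sym top-m) (proj₂ rwl))


  open import Data.List.Relation.Unary.Unique.Propositional using (Unique)
  import Data.List.Relation.Unary.Unique.Propositional.Properties as UP
  import Data.List.Relation.Unary.AllPairs as AP

  addTopRow-injective : ∀ k {xs ys} → addTopRow k xs ≡ addTopRow k ys → xs ≡ ys
  addTopRow-injective k {xs} {ys} e = LP.∷ʳ-injectiveˡ xs ys e

  topRowWidth-addTopRow : ∀ k' xs → topRowWidth (addTopRow (suc k') xs) ≡ + suc k'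
  topRowWidth-addTopRow k' xs = trans (top-snoc xs (topRow (suc k') xs)) (rowWidth-topRow k' xs)

  increasingStacks-top≤ : ∀ j b c xs → xs ∈ increasingStacks j b c → topRowWidth xs ℤ.≤ + j
  increasingStacks-top≤ j b c xs mem with increasingStacks-sound j b c xs mem
  ... | inj₁ (refl , _ , _) = ℤ.+≤+ z≤n
  ... | inj₂ (w , w≤ , (_ , top , _) , _) = ℤP.≤-trans (ℤP.≤-reflexive top) (ℤ.+≤+ w≤)

  stacks-topRowWidth : ∀ k a b c xs → xs ∈ stacks k a b c → topRowWidth xs ≡ + k
  stacks-topRowWidth k a b c xs mem = proj₁ (proj₂ (stacks-sound k a b c xs mem))

  whenList-unique : ∀ {p} {A : Set p} {B : Set} (d : Dec A) {l : List B} → Unique l → Unique (whenList d l)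
  whenList-unique (yes _) u = u
  whenList-unique (no _) u = AP.[]

  if-unique : ∀ {B : Set} (b : Bool) {l : List B} → Unique l → Unique (if b then l else [])
  if-unique true u = u
  if-unique false u = AP.[]

  [-]-unique : ∀ {B : Set} (x : B) → Unique [ x ]
  [-]-unique x = Data.List.Relation.Unary.All.[] AP.∷ AP.[]

  concatTo-unique : ∀ {B : Set} n (f : ℕ → List B) → (∀ m → Unique (f m)) → (∀ m m' v → v ∈ f m → v ∈ f m' → m ≡ m') → Unique (concatTo n f)
  concatTo-unique zero f u d = u 0
  concatTo-unique (suc n) f u d = UP.++⁺ (concatTo-unique n f u d) (u (suc n)) disj
    where
    disj : ∀ {v} → ¬ (v ∈ concatTo n f × v ∈ f (suc n))
    disj (m1 , m2) with ∈-concatTo⁻ n f m1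
    ... | m , m≤n , mm = ℕP.<-irrefl (d m (suc n) _ mm m2) (s≤s m≤n)

  increasingStacks-unique : ∀ j b c → Unique (increasingStacks j b c)
  increasingStacks-unique zero b c = if-unique ((b ≡ᵇ 0) ∧ (c ≡ᵇ 0)) ([-]-unique [])
  increasingStacks-unique (suc j) b c = UP.++⁺ (increasingStacks-unique j b c) (st b) disj
    where
    st : ∀ b → Unique (increasingStacksTop j b c)
    st zero = AP.[]
    st (suc b) = whenList-unique (suc j ℕP.≤? c) (UP.map⁺ (addTopRow-injective (suc j)) (increasingStacks-unique j b (c ∸ suc j)))
    disj : ∀ {v} → ¬ (v ∈ increasingStacks j b c × v ∈ increasingStacksTop j b c)
    disj {v} (m1 , m2) = lem b m2
      where
      lem : ∀ b → v ∈ increasingStacksTop j b c → Data.Empty.⊥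
      lem zero ()
      lem (suc b') m2 with ∈-whenList⁻ (suc j ℕP.≤? c) m2
      ... | _ , m3 with ∈-map⁻ _ m3
      ... | zs , _ , refl = ℕP.<-irrefl refl (ℤP.drop‿+≤+ (ℤP.≤-trans (ℤP.≤-reflexive (sym (topRowWidth-addTopRow j zs))) (increasingStacks-top≤ j b c _ m1)))

  increasingCase-extendingCase-disjoint : ∀ k a b c {v} → v ∈ increasingCase k a b c → v ∈ extendingCase k a b c → Data.Empty.⊥
  increasingCase-extendingCase-disjoint k a b c m₁ m₂ with ∈-increasingCase⁻ k a b c m₁ | ∈-extendingCase⁻ k a b c m₂
  ... | ys , refl , _ , _ , ym | m , zs , e , _ , _ , k<m , zm = ℕP.<-irrefl refl (ℕP.≤-trans k<m m≤k)
    where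
    m≤k : m ℕ.≤ k
    m≤k = ℤP.drop‿+≤+ (ℤP.≤-trans (ℤP.≤-reflexive (sym (stacks-topRowWidth m _ _ _ zs zm)))
            (ℤP.≤-trans (ℤP.≤-reflexive (cong topRowWidth (sym (addTopRow-injective (suc (suc k)) e))))
               (increasingStacks-top≤ k b (c ∸ suc (suc k)) ys ym)))

  stacks-unique : ∀ k a b c → Unique (stacks k a b c)
  stacks-unique zero a b c = AP.[]
  stacks-unique (suc zero) a b c = if-unique ((a ≡ᵇ 1) ∧ (b ≡ᵇ 1) ∧ (c ≡ᵇ 1)) ([-]-unique _)
  stacks-unique (suc (suc k)) a zero c = AP.[]
  stacks-unique (suc (suc k)) a (suc b) c = UP.++⁺ uI uE disj
    where
    K = suc (suc k)
    uπ : ∀ a' → Unique (increasingStacksAt k a' b (c ∸ K))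
    uπ zero = increasingStacks-unique k b (c ∸ K)
    uπ (suc a') = AP.[]
    uI : Unique (increasingCase k a b c)
    uI = whenList-unique (K ℕP.≤? a) (whenList-unique (K ℕP.≤? c) (UP.map⁺ (addTopRow-injective K) (uπ (a ∸ K))))
    uT : ∀ m → Unique (extendingCaseAt k (a ∸ 1) b (c ∸ K) m)
    uT m = if-unique (suc k ≤ᵇ m) (UP.map⁺ (addTopRow-injective K) (stacks-unique m (a ∸ 1) b (c ∸ K)))
    dT : ∀ m m' v → v ∈ extendingCaseAt k (a ∸ 1) b (c ∸ K) m → v ∈ extendingCaseAt k (a ∸ 1) b (c ∸ K) m' → m ≡ m'
    dT m m' v m1 m2 with ∈-if⁻ (suc k ≤ᵇ m) m1 | ∈-if⁻ (suc k ≤ᵇ m') m2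
    ... | _ , m1' | _ , m2' with ∈-map⁻ _ m1' | ∈-map⁻ _ m2'
    ... | ys , ym , refl | zs , zm , e = ℤP.+-injective (trans (sym (stacks-topRowWidth m _ _ _ ys ym)) (trans (cong topRowWidth (addTopRow-injective K e)) (stacks-topRowWidth m' _ _ _ zs zm)))
    uE : Unique (extendingCase k a b c)
    uE = whenList-unique (1 ℕP.≤? a) (whenList-unique (K ℕP.≤? c) (concatTo-unique (a ∸ 1 ℕ.+ b ℕ.+ (c ∸ K)) (extendingCaseAt k (a ∸ 1) b (c ∸ K)) uT dT))
    disj : ∀ {v} → ¬ (v ∈ increasingCase k a b c × v ∈ extendingCase k a b c)
    disj (m₁ , m₂) = increasingCase-extendingCase-disjoint k a b c m₁ m₂

open Enumeration using (stacks; stacks-unique; stacks-sound; stacks-complete; length-stacks)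
open Iteration using (RHS≈stackGF-U; stackGF-U-coeff)
open StackCounts using (stackCount)
open FunctionalEquation using (stackGF)
open import Function.Bundles using (mk⇔)
open import Data.Product using (_,_)
open import Relation.Binary.PropositionalEquality using (cong; sym; module ≡-Reasoning)

mainTheorem6 : (d a b c : ℕ) →
    Σ (List (List Row)) (λ L → Unique L
    × ((s : List Row) → (s ∈ L) ⇔ ShiftedStackWith d a b c s)
    × (RHS d a b c ≡ + (length L)))
mainTheorem6 d a b c =
  stacks d a b c , stacks-unique d a b c , (λ s → mk⇔ (stacks-sound d a b c s) (stacks-complete b d a c s)) , coefficient
  where
  open ≡-Reasoning
  coefficient : RHS d a b c ≡ + length (stacks d a b c)
  coefficient = begin
    RHS d a b c                 ≡⟨ RHS≈stackGF-U d a b c ⟩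
    stackGF U d a b c           ≡⟨ stackGF-U-coeff d a b c ⟩
    + stackCount d a b c        ≡⟨ cong +_ (sym (length-stacks d a b c)) ⟩
    + length (stacks d a b c)   ∎
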